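{- Let $T_{\not\exists}$ be a set of $\exists$-free formulas and $A(x)$ an $\exists$-free formula of $\mathcal{L}^\omega_*$ whose only free variable is $x$. If $$\mathrm{IL}^{\omega}_*+\mathrm{AC}^{\omega}_*+\mathrm{IP}^*_{\not\exists}+T_{\not\exists}\vdash\exists x\,A(x),$$ then there exist closed terms $t_1,\ldots,t_n$ such that $$\mathrm{IL}^{\omega}_*+T_{\not\exists}\vdash A(t_1)\lor\ldots\lor A(t_n).$$
   Context: Fix a first-order language $\mathcal{L}$ with at least one constant symbol. Types: $G$; $\sigma\to\tau$; $\sigma^*$. Constants: function symbols of $\mathcal{L}$; $\Pi_{\sigma,\tau}:\sigma\to\tau\to\sigma$; $\Sigma_{\rho,\sigma,\tau}:(\rho\to\sigma\to\tau)\to(\rho\to\sigma)\to\rho\to\tau$; $\mathfrak{s}_\sigma:\sigma\to\sigma^*$; $\cup_\sigma:\sigma^*\to\sigma^*\to\sigma^*$; $\bigcup_{\sigma,\tau}:\sigma^*\to(\sigma\to\tau^*)\to\tau^*$. Terms: constants, typed variables, applications. Atomic formulas: $\bot$, $t=_\rho q$, $t\in_\rho q$ ($q:\rho^*$), $R(t_1,\dots,t_n)$. Formulas of $\mathcal{L}^\omega_*$: closed under $\lor,\land,\to,\forall x,\exists x$ and bounded quantifiers $\forall x\in t,\exists x\in t$. A formula is $\exists$-free if it contains no unbounded $\exists x$. $\mathrm{IL}^{\omega}_*$ is intuitionistic predicate logic in all finite types with: $x=x$; $x=y\land A\to A'$ ($A$ atomic); $\forall x\in t\,A\leftrightarrow\forall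 x(x\in t\to A)$; $\exists x\in t\,A\leftrightarrow\exists x(x\in t\land A)$; $\Sigma xyz=xz(yz)$; $\Pi xy=x$; $w\in\mathfrak{s}x\leftrightarrow w=x$; $w\in\cup xy\leftrightarrow w\in x\lor w\in y$; $z\in x\land w\in yz\to w\in\bigcup xy$; $\bigcup(\mathfrak{s}x)y=yx$; $\bigcup(\cup xy)z=\cup(\bigcup xz)(\bigcup yz)$. $\mathrm{AC}^{\omega}_*$: $\forall x^\rho\exists y^\sigma A(x,y)\to\exists f^{\rho\to\sigma^*}\forall x\exists y\in fx\,A(x,y)$. $\mathrm{IP}^*_{\not\exists}$: $(B(x)\to\exists y\,A(y))\to\exists w(B(x)\to\exists y\in w\,A(y))$ for $\exists$-free $B$. -}

module Defs where

open import Data.Nat using (ℕ; zero; suc)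
open import Data.List using (List; []; _∷_; map)
open import Data.List.NonEmpty using (List⁺; _∷_)
open import Data.Vec using (Vec)
import Data.Vec as Vec

record Signature : Set₁ where
  field
    Fun   : ℕ → Set
    Rel   : ℕ → Set
    const : Fun 0

module Logic (L : Signature) where
  open Signature L

  infixr 30 _⇒_
  infix 35 _*
  infixl 40 _·_
  infixr 15 _⇒'_
  infix 14 _⇔'_
  infixr 16 _∨'_
  infixr 17 _∧'_
  infix 20 _≐_ _∈'_

  data Ty : Set where
    G   : Ty
    _⇒_ : Ty → Ty → Ty
    _*  : Ty → Ty

  Gⁿ : ℕ → Ty
  Gⁿ zero    = G
  Gⁿ (suc n) = G ⇒ Gⁿ n

  Con : Set
  Con = List Ty

  variable
    Γ Δ : Con
    ρ σ τ : Ty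
    n : ℕ

  data Var : Con → Ty → Set where
    vz : Var (σ ∷ Γ) σ
    vs : Var Γ σ → Var (τ ∷ Γ) σ

  data Tm (Γ : Con) : Ty → Set where
    var    : Var Γ σ → Tm Γ σ
    fun    : Fun n → Tm Γ (Gⁿ n)
    Πc     : Tm Γ (σ ⇒ τ ⇒ σ)
    Σc     : Tm Γ ((ρ ⇒ σ ⇒ τ) ⇒ (ρ ⇒ σ) ⇒ ρ ⇒ τ)
    sng    : Tm Γ (σ ⇒ σ *)
    cup    : Tm Γ (σ * ⇒ σ * ⇒ σ *)
    bigcup : Tm Γ (σ * ⇒ (σ ⇒ τ *) ⇒ τ *)
    _·_    : Tm Γ (σ ⇒ τ) → Tm Γ σ → Tm Γ τ

  data Fm (Γ : Con) : Set where
    ⊥'         : Fm Γ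
    _≐_        : Tm Γ ρ → Tm Γ ρ → Fm Γ
    _∈'_       : Tm Γ ρ → Tm Γ (ρ *) → Fm Γ
    rel        : Rel n → Vec (Tm Γ G) n → Fm Γ
    _∨'_ _∧'_ _⇒'_ : Fm Γ → Fm Γ → Fm Γ
    ∀' ∃'      : (σ : Ty) → Fm (σ ∷ Γ) → Fm Γ
    ∀∈ ∃∈      : Tm Γ (σ *) → Fm (σ ∷ Γ) → Fm Γ

  _⇔'_ : Fm Γ → Fm Γ → Fm Γ
  A ⇔' B = (A ⇒' B) ∧' (B ⇒' A)

  data Atomic : Fm Γ → Set where
    at⊥   : Atomic {Γ} ⊥'
    at≐   : {s t : Tm Γ ρ} → Atomic (s ≐ t)
    at∈   : {s : Tm Γ ρ} {t : Tm Γ (ρ *)} → Atomic (s ∈' t)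
    atrel : {R : Rel n} {ts : Vec (Tm Γ G) n} → Atomic (rel R ts)

  data ExFree : Fm Γ → Set where
    ef-at  : {A : Fm Γ} → Atomic A → ExFree A
    ef-∨   : {A B : Fm Γ} → ExFree A → ExFree B → ExFree (A ∨' B)
    ef-∧   : {A B : Fm Γ} → ExFree A → ExFree B → ExFree (A ∧' B)
    ef-⇒   : {A B : Fm Γ} → ExFree A → ExFree B → ExFree (A ⇒' B)
    ef-∀   : {A : Fm (σ ∷ Γ)} → ExFree A → ExFree (∀' σ A)
    ef-∀∈  : {t : Tm Γ (σ *)} {A : Fm (σ ∷ Γ)} → ExFree A → ExFree (∀∈ t A)
    ef-∃∈  : {t : Tm Γ (σ *)} {A : Fm (σ ∷ Γ)} → ExFree A → ExFree (∃∈ t A)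

  Ren : Con → Con → Set
  Ren Γ Δ = ∀ {σ} → Var Γ σ → Var Δ σ

  liftR : Ren Γ Δ → Ren (σ ∷ Γ) (σ ∷ Δ)
  liftR r vz     = vz
  liftR r (vs x) = vs (r x)

  renT : Ren Γ Δ → Tm Γ σ → Tm Δ σ
  renT r (var x) = var (r x)
  renT r (fun f) = fun f
  renT r Πc      = Πc
  renT r Σc      = Σc
  renT r sng     = sng
  renT r cup     = cup
  renT r bigcup  = bigcup
  renT r (s · t) = renT r s · renT r t

  renF : Ren Γ Δ → Fm Γ → Fm Δ
  renF r ⊥'        = ⊥'
  renF r (s ≐ t)   = renT r s ≐ renT r t
  renF r (s ∈' t)  = renT r s ∈' renT r t
  renF r (rel R ts) = rel R (Vec.map (renT r) ts)
  renF r (A ∨' B)  = renF r A ∨' renF r B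
  renF r (A ∧' B)  = renF r A ∧' renF r B
  renF r (A ⇒' B)  = renF r A ⇒' renF r B
  renF r (∀' σ A)  = ∀' σ (renF (liftR r) A)
  renF r (∃' σ A)  = ∃' σ (renF (liftR r) A)
  renF r (∀∈ t A)  = ∀∈ (renT r t) (renF (liftR r) A)
  renF r (∃∈ t A)  = ∃∈ (renT r t) (renF (liftR r) A)

  wkT : Tm Γ σ → Tm (τ ∷ Γ) σ
  wkT = renT vs

  wkF : Fm Γ → Fm (τ ∷ Γ)
  wkF = renF vs

  closeR : Ren [] Γ
  closeR ()

  Sub : Con → Con → Set
  Sub Γ Δ = ∀ {σ} → Var Γ σ → Tm Δ σ

  liftS : Sub Γ Δ → Sub (σ ∷ Γ) (σ ∷ Δ)
  liftS s vz     = var vz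
  liftS s (vs x) = wkT (s x)

  subT : Sub Γ Δ → Tm Γ σ → Tm Δ σ
  subT s (var x) = s x
  subT s (fun f) = fun f
  subT s Πc      = Πc
  subT s Σc      = Σc
  subT s sng     = sng
  subT s cup     = cup
  subT s bigcup  = bigcup
  subT s (a · b) = subT s a · subT s b

  subF : Sub Γ Δ → Fm Γ → Fm Δ
  subF s ⊥'        = ⊥'
  subF s (a ≐ b)   = subT s a ≐ subT s b
  subF s (a ∈' b)  = subT s a ∈' subT s b
  subF s (rel R ts) = rel R (Vec.map (subT s) ts)
  subF s (A ∨' B)  = subF s A ∨' subF s B
  subF s (A ∧' B)  = subF s A ∧' subF s B
  subF s (A ⇒' B)  = subF s A ⇒' subF s B
  subF s (∀' σ A)  = ∀' σ (subF (liftS s) A)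
  subF s (∃' σ A)  = ∃' σ (subF (liftS s) A)
  subF s (∀∈ t A)  = ∀∈ (subT s t) (subF (liftS s) A)
  subF s (∃∈ t A)  = ∃∈ (subT s t) (subF (liftS s) A)

  single : Tm Γ σ → Sub (σ ∷ Γ) Γ
  single t vz     = t
  single t (vs x) = var x

  _[_] : Fm (σ ∷ Γ) → Tm Γ σ → Fm Γ
  A [ t ] = subF (single t) A

  data ILAx : Fm Γ → Set where
    ax-refl   : (t : Tm Γ σ) → ILAx (t ≐ t)
    ax-eq     : (A : Fm (σ ∷ Γ)) → Atomic A → (s t : Tm Γ σ) →
                ILAx ((s ≐ t ∧' A [ s ]) ⇒' A [ t ])
    ax-∀∈     : (t : Tm Γ (σ *)) (A : Fm (σ ∷ Γ)) →
                ILAx (∀∈ t A ⇔' ∀' σ (var vz ∈' wkT t ⇒' A))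
    ax-∃∈     : (t : Tm Γ (σ *)) (A : Fm (σ ∷ Γ)) →
                ILAx (∃∈ t A ⇔' ∃' σ (var vz ∈' wkT t ∧' A))
    ax-Σ      : (x : Tm Γ (ρ ⇒ σ ⇒ τ)) (y : Tm Γ (ρ ⇒ σ)) (z : Tm Γ ρ) →
                ILAx (Σc · x · y · z ≐ x · z · (y · z))
    ax-Π      : (x : Tm Γ σ) (y : Tm Γ τ) → ILAx (Πc · x · y ≐ x)
    ax-sng    : (w x : Tm Γ σ) → ILAx (w ∈' sng · x ⇔' w ≐ x)
    ax-cup    : (w : Tm Γ σ) (x y : Tm Γ (σ *)) →
                ILAx (w ∈' cup · x · y ⇔' (w ∈' x ∨' w ∈' y))
    ax-bigcup : (z : Tm Γ σ) (x : Tm Γ (σ *)) (y : Tm Γ (σ ⇒ τ *)) (w : Tm Γ τ) →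
                ILAx ((z ∈' x ∧' w ∈' y · z) ⇒' w ∈' bigcup · x · y)
    ax-⋃sng   : (x : Tm Γ σ) (y : Tm Γ (σ ⇒ τ *)) →
                ILAx (bigcup · (sng · x) · y ≐ y · x)
    ax-⋃cup   : (x y : Tm Γ (σ *)) (z : Tm Γ (σ ⇒ τ *)) →
                ILAx (bigcup · (cup · x · y) · z ≐ cup · (bigcup · x · z) · (bigcup · y · z))

  -- AC^ω_* : ∀x^ρ ∃y^σ A(x,y) → ∃f^{ρ→σ*} ∀x ∃y∈fx A(x,y)
  data ACAx : Fm Γ → Set where
    ac : (A : Fm (σ ∷ ρ ∷ Γ)) →
         ACAx (∀' ρ (∃' σ A) ⇒'
               ∃' (ρ ⇒ σ *) (∀' ρ (∃∈ (var (vs vz) · var vz)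
                                       (renF (liftR (liftR vs)) A))))

  -- IP^*_∄ : (B → ∃y A(y)) → ∃w (B → ∃y∈w A(y)),  B ∃-free
  data IPAx : Fm Γ → Set where
    ip : (B : Fm Γ) → ExFree B → (A : Fm (σ ∷ Γ)) →
         IPAx ((B ⇒' ∃' σ A) ⇒'
               ∃' (σ *) (wkF B ⇒' ∃∈ (var vz) (renF (liftR vs) A)))

  data TAx (T : Fm [] → Set) {Γ : Con} : Fm Γ → Set where
    tax : (B : Fm []) → T B → TAx T (renF closeR B)

  Axioms : Set₁
  Axioms = ∀ {Γ} → Fm Γ → Set

  IL+ : (Fm [] → Set) → Axioms
  IL+ T A = ILAx A ⊎ TAx T A
    where open import Data.Sum using (_⊎_)

  IL+AC+IP+ : (Fm [] → Set) → Axioms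
  IL+AC+IP+ T A = ILAx A ⊎ (ACAx A ⊎ (IPAx A ⊎ TAx T A))
    where open import Data.Sum using (_⊎_)

  -- Intuitionistic natural deduction in all finite types.
  -- Prov Ax Γ Hs A : A derivable from hypotheses Hs, with free variables
  -- typed by Γ, using the extra axioms Ax.

  data _∋_ {Γ : Con} : List (Fm Γ) → Fm Γ → Set where
    here  : {A : Fm Γ} {Hs : List (Fm Γ)} → (A ∷ Hs) ∋ A
    there : {A B : Fm Γ} {Hs : List (Fm Γ)} → Hs ∋ A → (B ∷ Hs) ∋ A

  data Prov (Ax : Axioms) : (Γ : Con) → List (Fm Γ) → Fm Γ → Set where
    hyp  : {Hs : List (Fm Γ)} {A : Fm Γ} → Hs ∋ A → Prov Ax Γ Hs A
    ax   : {Hs : List (Fm Γ)} {A : Fm Γ} → Ax A → Prov Ax Γ Hs A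
    ⊥E   : {Hs : List (Fm Γ)} {A : Fm Γ} → Prov Ax Γ Hs ⊥' → Prov Ax Γ Hs A
    ∧I   : {Hs : List (Fm Γ)} {A B : Fm Γ} →
           Prov Ax Γ Hs A → Prov Ax Γ Hs B → Prov Ax Γ Hs (A ∧' B)
    ∧E₁  : {Hs : List (Fm Γ)} {A B : Fm Γ} → Prov Ax Γ Hs (A ∧' B) → Prov Ax Γ Hs A
    ∧E₂  : {Hs : List (Fm Γ)} {A B : Fm Γ} → Prov Ax Γ Hs (A ∧' B) → Prov Ax Γ Hs B
    ∨I₁  : {Hs : List (Fm Γ)} {A B : Fm Γ} → Prov Ax Γ Hs A → Prov Ax Γ Hs (A ∨' B)
    ∨I₂  : {Hs : List (Fm Γ)} {A B : Fm Γ} → Prov Ax Γ Hs B → Prov Ax Γ Hs (A ∨' B)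
    ∨E   : {Hs : List (Fm Γ)} {A B C : Fm Γ} → Prov Ax Γ Hs (A ∨' B) →
           Prov Ax Γ (A ∷ Hs) C → Prov Ax Γ (B ∷ Hs) C → Prov Ax Γ Hs C
    ⇒I   : {Hs : List (Fm Γ)} {A B : Fm Γ} → Prov Ax Γ (A ∷ Hs) B → Prov Ax Γ Hs (A ⇒' B)
    ⇒E   : {Hs : List (Fm Γ)} {A B : Fm Γ} →
           Prov Ax Γ Hs (A ⇒' B) → Prov Ax Γ Hs A → Prov Ax Γ Hs B
    ∀I   : {Hs : List (Fm Γ)} {A : Fm (σ ∷ Γ)} →
           Prov Ax (σ ∷ Γ) (map wkF Hs) A → Prov Ax Γ Hs (∀' σ A)
    ∀E   : {Hs : List (Fm Γ)} {A : Fm (σ ∷ Γ)} →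
           Prov Ax Γ Hs (∀' σ A) → (t : Tm Γ σ) → Prov Ax Γ Hs (A [ t ])
    ∃I   : {Hs : List (Fm Γ)} {A : Fm (σ ∷ Γ)} →
           (t : Tm Γ σ) → Prov Ax Γ Hs (A [ t ]) → Prov Ax Γ Hs (∃' σ A)
    ∃E   : {Hs : List (Fm Γ)} {A : Fm (σ ∷ Γ)} {C : Fm Γ} →
           Prov Ax Γ Hs (∃' σ A) →
           Prov Ax (σ ∷ Γ) (A ∷ map wkF Hs) (wkF C) → Prov Ax Γ Hs C

  _⊢_ : Axioms → Fm [] → Set
  Ax ⊢ A = Prov Ax [] [] A

  ⋁′ : Fm [] → List (Fm []) → Fm []
  ⋁′ A []       = A
  ⋁′ A (B ∷ Bs) = A ∨' ⋁′ B Bs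

  ⋁ : List⁺ (Fm []) → Fm []
  ⋁ (A ∷ Bs) = ⋁′ A Bs

{-# OPTIONS --safe #-}
-- Herbrandized modified realizability.  Every formula A gets a list HrTy A of
-- realizer types and, for terms as of these types, a formula hr A γ as
-- ("as realizes A[γ]") in which each unbounded ∃x is bounded by a set-valued
-- component of the realizer.  Every theorem of IL+AC+IP+T has a realizer, and
-- IL+T proves that it realizes: AC is realized by putting the choice function
-- into a singleton; IP because the realizers of an ∃-free premise are irrelevant,
-- so dummies will do; the rules that merge realizers (∨E, ∃E) by taking unions,
-- which is sound because hr is monotone for pointwise inclusion.  For ∃-free A,
-- hr A is equivalent to A, so ∃x A yields IL+T ⊢ ∃x∈w A for a closed term w.
-- Finally, by a computability argument every closed term of type σ* provably
-- equals a finite union of singletons {t₁} ∪ … ∪ {tₙ}, and ∃x∈{t₁,…,tₙ} A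
-- gives A(t₁) ∨ … ∨ A(tₙ).
module Submission where

open import Defs
open import Data.Nat using (ℕ; zero; suc)
open import Data.List using (List; []; _∷_; map; _++_)
import Data.List.Properties as List
open import Data.List.NonEmpty using (List⁺; _∷_; _⁺++⁺_)
import Data.List.NonEmpty as List⁺
import Data.List.NonEmpty.Properties as List⁺ₚ
open import Data.List.Relation.Unary.All using (All; []; _∷_)
import Data.List.Relation.Unary.All as All
open import Data.List.Relation.Unary.All.Properties using (++⁺; ++⁻ˡ; ++⁻ʳ; map-cong; map-∘; map-id)
import Data.Vec as Vec
import Data.Vec.Properties as VecP
open import Data.Product using (Σ; ∃; _×_; _,_; proj₁; proj₂)
open import Data.Sum using (inj₁; inj₂)
open import Data.Unit using (⊤; tt)
open import Function using (_∘_)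
open import Relation.Binary.PropositionalEquality hiding ([_])

module Substitution (L : Signature) where
  open Logic L

  variable
    Θ : Con

  infixr 9 _∘S_ _∘RS_ _∘SR_
  infix 4 _≗S_

  _≗S_ : Sub Γ Δ → Sub Γ Δ → Set
  s ≗S s′ = ∀ {σ} (x : Var _ σ) → s x ≡ s′ x

  _∘S_ : Sub Δ Θ → Sub Γ Δ → Sub Γ Θ
  (s′ ∘S s) x = subT s′ (s x)

  _∘RS_ : Ren Δ Θ → Sub Γ Δ → Sub Γ Θ
  (r ∘RS s) x = renT r (s x)

  _∘SR_ : Sub Δ Θ → Ren Γ Δ → Sub Γ Θ
  (s ∘SR r) x = s (r x)

  liftS-cong : {s s′ : Sub Γ Δ} → s ≗S s′ → liftS {σ = σ} s ≗S liftS s′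
  liftS-cong e vz     = refl
  liftS-cong e (vs x) = cong wkT (e x)

  subT-cong : {s s′ : Sub Γ Δ} → s ≗S s′ → (t : Tm Γ σ) → subT s t ≡ subT s′ t
  subT-cong e (var x) = e x
  subT-cong e (fun f) = refl
  subT-cong e Πc      = refl
  subT-cong e Σc      = refl
  subT-cong e sng     = refl
  subT-cong e cup     = refl
  subT-cong e bigcup  = refl
  subT-cong e (t · u) = cong₂ _·_ (subT-cong e t) (subT-cong e u)

  subF-cong : {s s′ : Sub Γ Δ} → s ≗S s′ → (A : Fm Γ) → subF s A ≡ subF s′ A
  subF-cong e ⊥'         = refl
  subF-cong e (a ≐ b)    = cong₂ _≐_ (subT-cong e a) (subT-cong e b)
  subF-cong e (a ∈' b)   = cong₂ _∈'_ (subT-cong e a) (subT-cong e b)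
  subF-cong e (rel R ts) = cong (rel R) (VecP.map-cong (subT-cong e) ts)
  subF-cong e (A ∨' B)   = cong₂ _∨'_ (subF-cong e A) (subF-cong e B)
  subF-cong e (A ∧' B)   = cong₂ _∧'_ (subF-cong e A) (subF-cong e B)
  subF-cong e (A ⇒' B)   = cong₂ _⇒'_ (subF-cong e A) (subF-cong e B)
  subF-cong e (∀' σ A)   = cong (∀' σ) (subF-cong (liftS-cong e) A)
  subF-cong e (∃' σ A)   = cong (∃' σ) (subF-cong (liftS-cong e) A)
  subF-cong e (∀∈ t A)   = cong₂ ∀∈ (subT-cong e t) (subF-cong (liftS-cong e) A)
  subF-cong e (∃∈ t A)   = cong₂ ∃∈ (subT-cong e t) (subF-cong (liftS-cong e) A)

  renT-∘ : (r′ : Ren Δ Θ) (r : Ren Γ Δ) (t : Tm Γ σ) → renT r′ (renT r t) ≡ renT (λ x → r′ (r x)) t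
  renT-∘ r′ r (var x) = refl
  renT-∘ r′ r (fun f) = refl
  renT-∘ r′ r Πc      = refl
  renT-∘ r′ r Σc      = refl
  renT-∘ r′ r sng     = refl
  renT-∘ r′ r cup     = refl
  renT-∘ r′ r bigcup  = refl
  renT-∘ r′ r (t · u) = cong₂ _·_ (renT-∘ r′ r t) (renT-∘ r′ r u)

  liftS-∘SR : (s : Sub Δ Θ) (r : Ren Γ Δ) → liftS {σ = σ} s ∘SR liftR r ≗S liftS (s ∘SR r)
  liftS-∘SR s r vz     = refl
  liftS-∘SR s r (vs x) = refl

  subT-renT : (s : Sub Δ Θ) (r : Ren Γ Δ) (t : Tm Γ σ) → subT s (renT r t) ≡ subT (s ∘SR r) t
  subT-renT s r (var x) = refl
  subT-renT s r (fun f) = refl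
  subT-renT s r Πc      = refl
  subT-renT s r Σc      = refl
  subT-renT s r sng     = refl
  subT-renT s r cup     = refl
  subT-renT s r bigcup  = refl
  subT-renT s r (t · u) = cong₂ _·_ (subT-renT s r t) (subT-renT s r u)

  subF-renF : (s : Sub Δ Θ) (r : Ren Γ Δ) (A : Fm Γ) → subF s (renF r A) ≡ subF (s ∘SR r) A
  subF-renF s r ⊥'         = refl
  subF-renF s r (a ≐ b)    = cong₂ _≐_ (subT-renT s r a) (subT-renT s r b)
  subF-renF s r (a ∈' b)   = cong₂ _∈'_ (subT-renT s r a) (subT-renT s r b)
  subF-renF s r (rel R ts) = cong (rel R) (trans (sym (VecP.map-∘ (subT s) (renT r) ts)) (VecP.map-cong (subT-renT s r) ts))
  subF-renF s r (A ∨' B)   = cong₂ _∨'_ (subF-renF s r A) (subF-renF s r B)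
  subF-renF s r (A ∧' B)   = cong₂ _∧'_ (subF-renF s r A) (subF-renF s r B)
  subF-renF s r (A ⇒' B)   = cong₂ _⇒'_ (subF-renF s r A) (subF-renF s r B)
  subF-renF s r (∀' σ A)   = cong (∀' σ) (trans (subF-renF (liftS s) (liftR r) A) (subF-cong (liftS-∘SR s r) A))
  subF-renF s r (∃' σ A)   = cong (∃' σ) (trans (subF-renF (liftS s) (liftR r) A) (subF-cong (liftS-∘SR s r) A))
  subF-renF s r (∀∈ t A)   = cong₂ ∀∈ (subT-renT s r t) (trans (subF-renF (liftS s) (liftR r) A) (subF-cong (liftS-∘SR s r) A))
  subF-renF s r (∃∈ t A)   = cong₂ ∃∈ (subT-renT s r t) (trans (subF-renF (liftS s) (liftR r) A) (subF-cong (liftS-∘SR s r) A))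

  liftR-∘RS : (r : Ren Δ Θ) (s : Sub Γ Δ) → liftR {σ = σ} r ∘RS liftS s ≗S liftS (r ∘RS s)
  liftR-∘RS r s vz     = refl
  liftR-∘RS r s (vs x) = trans (renT-∘ (liftR r) vs (s x)) (sym (renT-∘ vs r (s x)))

  renT-subT : (r : Ren Δ Θ) (s : Sub Γ Δ) (t : Tm Γ σ) → renT r (subT s t) ≡ subT (r ∘RS s) t
  renT-subT r s (var x) = refl
  renT-subT r s (fun f) = refl
  renT-subT r s Πc      = refl
  renT-subT r s Σc      = refl
  renT-subT r s sng     = refl
  renT-subT r s cup     = refl
  renT-subT r s bigcup  = refl
  renT-subT r s (t · u) = cong₂ _·_ (renT-subT r s t) (renT-subT r s u)

  renF-subF : (r : Ren Δ Θ) (s : Sub Γ Δ) (A : Fm Γ) → renF r (subF s A) ≡ subF (r ∘RS s) A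
  renF-subF r s ⊥'         = refl
  renF-subF r s (a ≐ b)    = cong₂ _≐_ (renT-subT r s a) (renT-subT r s b)
  renF-subF r s (a ∈' b)   = cong₂ _∈'_ (renT-subT r s a) (renT-subT r s b)
  renF-subF r s (rel R ts) = cong (rel R) (trans (sym (VecP.map-∘ (renT r) (subT s) ts)) (VecP.map-cong (renT-subT r s) ts))
  renF-subF r s (A ∨' B)   = cong₂ _∨'_ (renF-subF r s A) (renF-subF r s B)
  renF-subF r s (A ∧' B)   = cong₂ _∧'_ (renF-subF r s A) (renF-subF r s B)
  renF-subF r s (A ⇒' B)   = cong₂ _⇒'_ (renF-subF r s A) (renF-subF r s B)
  renF-subF r s (∀' σ A)   = cong (∀' σ) (trans (renF-subF (liftR r) (liftS s) A) (subF-cong (liftR-∘RS r s) A))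
  renF-subF r s (∃' σ A)   = cong (∃' σ) (trans (renF-subF (liftR r) (liftS s) A) (subF-cong (liftR-∘RS r s) A))
  renF-subF r s (∀∈ t A)   = cong₂ ∀∈ (renT-subT r s t) (trans (renF-subF (liftR r) (liftS s) A) (subF-cong (liftR-∘RS r s) A))
  renF-subF r s (∃∈ t A)   = cong₂ ∃∈ (renT-subT r s t) (trans (renF-subF (liftR r) (liftS s) A) (subF-cong (liftR-∘RS r s) A))

  subT-liftS-wkT : (s : Sub Γ Δ) (t : Tm Γ τ) → subT (liftS {σ = σ} s) (wkT t) ≡ wkT (subT s t)
  subT-liftS-wkT s t = trans (subT-renT (liftS s) vs t) (sym (renT-subT vs s t))

  subF-liftS-wkF : (s : Sub Γ Δ) (A : Fm Γ) → subF (liftS {σ = σ} s) (wkF A) ≡ wkF (subF s A)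
  subF-liftS-wkF s A = trans (subF-renF (liftS s) vs A) (sym (renF-subF vs s A))

  liftS-∘S : (s′ : Sub Δ Θ) (s : Sub Γ Δ) → liftS {σ = σ} s′ ∘S liftS s ≗S liftS (s′ ∘S s)
  liftS-∘S s′ s vz     = refl
  liftS-∘S s′ s (vs x) = subT-liftS-wkT s′ (s x)

  subT-∘ : (s′ : Sub Δ Θ) (s : Sub Γ Δ) (t : Tm Γ σ) → subT s′ (subT s t) ≡ subT (s′ ∘S s) t
  subT-∘ s′ s (var x) = refl
  subT-∘ s′ s (fun f) = refl
  subT-∘ s′ s Πc      = refl
  subT-∘ s′ s Σc      = refl
  subT-∘ s′ s sng     = refl
  subT-∘ s′ s cup     = refl
  subT-∘ s′ s bigcup  = refl
  subT-∘ s′ s (t · u) = cong₂ _·_ (subT-∘ s′ s t) (subT-∘ s′ s u)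

  subF-∘ : (s′ : Sub Δ Θ) (s : Sub Γ Δ) (A : Fm Γ) → subF s′ (subF s A) ≡ subF (s′ ∘S s) A
  subF-∘ s′ s ⊥'         = refl
  subF-∘ s′ s (a ≐ b)    = cong₂ _≐_ (subT-∘ s′ s a) (subT-∘ s′ s b)
  subF-∘ s′ s (a ∈' b)   = cong₂ _∈'_ (subT-∘ s′ s a) (subT-∘ s′ s b)
  subF-∘ s′ s (rel R ts) = cong (rel R) (trans (sym (VecP.map-∘ (subT s′) (subT s) ts)) (VecP.map-cong (subT-∘ s′ s) ts))
  subF-∘ s′ s (A ∨' B)   = cong₂ _∨'_ (subF-∘ s′ s A) (subF-∘ s′ s B)
  subF-∘ s′ s (A ∧' B)   = cong₂ _∧'_ (subF-∘ s′ s A) (subF-∘ s′ s B)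
  subF-∘ s′ s (A ⇒' B)   = cong₂ _⇒'_ (subF-∘ s′ s A) (subF-∘ s′ s B)
  subF-∘ s′ s (∀' σ A)   = cong (∀' σ) (trans (subF-∘ (liftS s′) (liftS s) A) (subF-cong (liftS-∘S s′ s) A))
  subF-∘ s′ s (∃' σ A)   = cong (∃' σ) (trans (subF-∘ (liftS s′) (liftS s) A) (subF-cong (liftS-∘S s′ s) A))
  subF-∘ s′ s (∀∈ t A)   = cong₂ ∀∈ (subT-∘ s′ s t) (trans (subF-∘ (liftS s′) (liftS s) A) (subF-cong (liftS-∘S s′ s) A))
  subF-∘ s′ s (∃∈ t A)   = cong₂ ∃∈ (subT-∘ s′ s t) (trans (subF-∘ (liftS s′) (liftS s) A) (subF-cong (liftS-∘S s′ s) A))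

  liftS-var : liftS {σ = σ} (var {Γ = Γ}) ≗S var
  liftS-var vz     = refl
  liftS-var (vs x) = refl

  subT-id : (t : Tm Γ σ) → subT var t ≡ t
  subT-id (var x) = refl
  subT-id (fun f) = refl
  subT-id Πc      = refl
  subT-id Σc      = refl
  subT-id sng     = refl
  subT-id cup     = refl
  subT-id bigcup  = refl
  subT-id (t · u) = cong₂ _·_ (subT-id t) (subT-id u)

  subF-id : (A : Fm Γ) → subF var A ≡ A
  subF-id ⊥'         = refl
  subF-id (a ≐ b)    = cong₂ _≐_ (subT-id a) (subT-id b)
  subF-id (a ∈' b)   = cong₂ _∈'_ (subT-id a) (subT-id b)
  subF-id (rel R ts) = cong (rel R) (trans (VecP.map-cong subT-id ts) (VecP.map-id ts))
  subF-id (A ∨' B)   = cong₂ _∨'_ (subF-id A) (subF-id B)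
  subF-id (A ∧' B)   = cong₂ _∧'_ (subF-id A) (subF-id B)
  subF-id (A ⇒' B)   = cong₂ _⇒'_ (subF-id A) (subF-id B)
  subF-id (∀' σ A)   = cong (∀' σ) (trans (subF-cong liftS-var A) (subF-id A))
  subF-id (∃' σ A)   = cong (∃' σ) (trans (subF-cong liftS-var A) (subF-id A))
  subF-id (∀∈ t A)   = cong₂ ∀∈ (subT-id t) (trans (subF-cong liftS-var A) (subF-id A))
  subF-id (∃∈ t A)   = cong₂ ∃∈ (subT-id t) (trans (subF-cong liftS-var A) (subF-id A))

  liftS-var∘ : (r : Ren Γ Δ) → liftS {σ = σ} (var ∘SR r) ≗S var ∘SR liftR r
  liftS-var∘ r vz     = refl
  liftS-var∘ r (vs x) = refl

  renT≡subT : (r : Ren Γ Δ) (t : Tm Γ σ) → renT r t ≡ subT (var ∘SR r) t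
  renT≡subT r (var x) = refl
  renT≡subT r (fun f) = refl
  renT≡subT r Πc      = refl
  renT≡subT r Σc      = refl
  renT≡subT r sng     = refl
  renT≡subT r cup     = refl
  renT≡subT r bigcup  = refl
  renT≡subT r (t · u) = cong₂ _·_ (renT≡subT r t) (renT≡subT r u)

  renF≡subF : (r : Ren Γ Δ) (A : Fm Γ) → renF r A ≡ subF (var ∘SR r) A
  renF≡subF r ⊥'         = refl
  renF≡subF r (a ≐ b)    = cong₂ _≐_ (renT≡subT r a) (renT≡subT r b)
  renF≡subF r (a ∈' b)   = cong₂ _∈'_ (renT≡subT r a) (renT≡subT r b)
  renF≡subF r (rel R ts) = cong (rel R) (VecP.map-cong (renT≡subT r) ts)
  renF≡subF r (A ∨' B)   = cong₂ _∨'_ (renF≡subF r A) (renF≡subF r B)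
  renF≡subF r (A ∧' B)   = cong₂ _∧'_ (renF≡subF r A) (renF≡subF r B)
  renF≡subF r (A ⇒' B)   = cong₂ _⇒'_ (renF≡subF r A) (renF≡subF r B)
  renF≡subF r (∀' σ A)   = cong (∀' σ) (trans (renF≡subF (liftR r) A) (sym (subF-cong (liftS-var∘ r) A)))
  renF≡subF r (∃' σ A)   = cong (∃' σ) (trans (renF≡subF (liftR r) A) (sym (subF-cong (liftS-var∘ r) A)))
  renF≡subF r (∀∈ t A)   = cong₂ ∀∈ (renT≡subT r t) (trans (renF≡subF (liftR r) A) (sym (subF-cong (liftS-var∘ r) A)))
  renF≡subF r (∃∈ t A)   = cong₂ ∃∈ (renT≡subT r t) (trans (renF≡subF (liftR r) A) (sym (subF-cong (liftS-var∘ r) A)))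

  infixl 5 _▸_
  _▸_ : Sub Γ Δ → Tm Δ σ → Sub (σ ∷ Γ) Δ
  (s ▸ a) vz     = a
  (s ▸ a) (vs x) = s x

  subT-▸-wkT : (s : Sub Γ Δ) (a : Tm Δ σ) (t : Tm Γ τ) → subT (s ▸ a) (wkT t) ≡ subT s t
  subT-▸-wkT s a t = subT-renT (s ▸ a) vs t

  subT-single-wkT : (a : Tm Γ σ) (t : Tm Γ τ) → subT (single a) (wkT t) ≡ t
  subT-single-wkT a t = trans (subT-renT (single a) vs t) (subT-id t)

  single-∘S-liftS : (s : Sub Γ Δ) (a : Tm Δ σ) → single a ∘S liftS s ≗S s ▸ a
  single-∘S-liftS s a vz     = refl
  single-∘S-liftS s a (vs x) = subT-single-wkT a (s x)

  ∘S-single : (s : Sub Γ Δ) (t : Tm Γ σ) → s ∘S single t ≗S s ▸ subT s t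
  ∘S-single s t vz     = refl
  ∘S-single s t (vs x) = refl

  subF-[] : (s : Sub Γ Δ) (A : Fm (σ ∷ Γ)) (t : Tm Γ σ) → subF s (A [ t ]) ≡ subF (liftS s) A [ subT s t ]
  subF-[] s A t = begin
    subF s (A [ t ])                         ≡⟨ subF-∘ s (single t) A ⟩
    subF (s ∘S single t) A                   ≡⟨ subF-cong (∘S-single s t) A ⟩
    subF (s ▸ subT s t) A                    ≡⟨ subF-cong (single-∘S-liftS s (subT s t)) A ⟨
    subF (single (subT s t) ∘S liftS s) A    ≡⟨ subF-∘ (single (subT s t)) (liftS s) A ⟨
    subF (liftS s) A [ subT s t ]            ∎
    where open ≡-Reasoning

  single-vz∘liftR-vs : single (var vz) ∘SR liftR vs ≗S var {Γ = σ ∷ Γ}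
  single-vz∘liftR-vs vz     = refl
  single-vz∘liftR-vs (vs x) = refl

  renT-liftR-vs-[vz] : (t : Tm (σ ∷ Γ) τ) → subT (single (var vz)) (renT (liftR vs) t) ≡ t
  renT-liftR-vs-[vz] t = trans (subT-renT (single (var vz)) (liftR vs) t) (trans (subT-cong single-vz∘liftR-vs t) (subT-id t))

  renF-liftR-vs-[vz] : (A : Fm (σ ∷ Γ)) → renF (liftR vs) A [ var vz ] ≡ A
  renF-liftR-vs-[vz] A = trans (subF-renF (single (var vz)) (liftR vs) A) (trans (subF-cong single-vz∘liftR-vs A) (subF-id A))

  wkT∘single : (a : Tm Γ σ) → vs {τ = τ} ∘RS single a ≗S single (wkT a) ∘SR liftR vs
  wkT∘single a vz     = refl
  wkT∘single a (vs x) = refl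

  subT-closed : (s : Sub Γ Δ) (t : Tm [] σ) → subT s (renT closeR t) ≡ renT closeR t
  subT-closed s t = trans (subT-renT s closeR t) (trans (subT-cong (λ ()) t) (sym (renT≡subT closeR t)))

  subF-closed : (s : Sub Γ Δ) (A : Fm []) → subF s (renF closeR A) ≡ renF closeR A
  subF-closed s A = trans (subF-renF s closeR A) (trans (subF-cong (λ ()) A) (sym (renF≡subF closeR A)))

  Atomic-subF : (s : Sub Γ Δ) {A : Fm Γ} → Atomic A → Atomic (subF s A)
  Atomic-subF s at⊥   = at⊥
  Atomic-subF s at≐   = at≐
  Atomic-subF s at∈   = at∈
  Atomic-subF s atrel = atrel

  ExFree-subF : (s : Sub Γ Δ) {A : Fm Γ} → ExFree A → ExFree (subF s A)
  ExFree-subF s (ef-at a)  = ef-at (Atomic-subF s a)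
  ExFree-subF s (ef-∨ a b) = ef-∨ (ExFree-subF s a) (ExFree-subF s b)
  ExFree-subF s (ef-∧ a b) = ef-∧ (ExFree-subF s a) (ExFree-subF s b)
  ExFree-subF s (ef-⇒ a b) = ef-⇒ (ExFree-subF s a) (ExFree-subF s b)
  ExFree-subF s (ef-∀ a)   = ef-∀ (ExFree-subF (liftS s) a)
  ExFree-subF s (ef-∀∈ a)  = ef-∀∈ (ExFree-subF (liftS s) a)
  ExFree-subF s (ef-∃∈ a)  = ef-∃∈ (ExFree-subF (liftS s) a)

  ILAx-subF : (s : Sub Γ Δ) {A : Fm Γ} → ILAx A → ILAx (subF s A)
  ILAx-subF s (ax-refl t) = ax-refl (subT s t)
  ILAx-subF s (ax-eq A a u v) =
    subst ILAx (cong₂ (λ X Y → (subT s u ≐ subT s v ∧' X) ⇒' Y) (sym (subF-[] s A u)) (sym (subF-[] s A v)))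
      (ax-eq (subF (liftS s) A) (Atomic-subF (liftS s) a) (subT s u) (subT s v))
  ILAx-subF s (ax-∀∈ {σ = σ} t A) =
    subst ILAx (cong (λ X → ∀∈ (subT s t) (subF (liftS s) A) ⇔' ∀' σ (var vz ∈' X ⇒' subF (liftS s) A)) (sym (subT-liftS-wkT s t)))
      (ax-∀∈ (subT s t) (subF (liftS s) A))
  ILAx-subF s (ax-∃∈ {σ = σ} t A) =
    subst ILAx (cong (λ X → ∃∈ (subT s t) (subF (liftS s) A) ⇔' ∃' σ (var vz ∈' X ∧' subF (liftS s) A)) (sym (subT-liftS-wkT s t)))
      (ax-∃∈ (subT s t) (subF (liftS s) A))
  ILAx-subF s (ax-Σ x y z)        = ax-Σ (subT s x) (subT s y) (subT s z)
  ILAx-subF s (ax-Π x y)          = ax-Π (subT s x) (subT s y)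
  ILAx-subF s (ax-sng w x)        = ax-sng (subT s w) (subT s x)
  ILAx-subF s (ax-cup w x y)      = ax-cup (subT s w) (subT s x) (subT s y)
  ILAx-subF s (ax-bigcup z x y w) = ax-bigcup (subT s z) (subT s x) (subT s y) (subT s w)
  ILAx-subF s (ax-⋃sng x y)       = ax-⋃sng (subT s x) (subT s y)
  ILAx-subF s (ax-⋃cup x y z)     = ax-⋃cup (subT s x) (subT s y) (subT s z)

module Derivations (L : Signature) (T : Logic.Fm L [] → Set) where
  open Logic L hiding (_⊢_)
  open Substitution L

  infix 4 _⊢_
  _⊢_ : List (Fm Γ) → Fm Γ → Set
  Ps ⊢ A = Prov (IL+ T) _ Ps A

  variable
    Ps Qs : List (Fm Γ)

  ⊢-cast : {A B : Fm Γ} → A ≡ B → Ps ⊢ A → Ps ⊢ B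
  ⊢-cast refl d = d

  ∋-map⁺ : (f : Fm Γ → Fm Δ) {Hs : List (Fm Γ)} {A : Fm Γ} → Hs ∋ A → map f Hs ∋ f A
  ∋-map⁺ f here      = here
  ∋-map⁺ f (there i) = there (∋-map⁺ f i)

  ∋-map⁻ : (f : Fm Γ → Fm Δ) {Hs : List (Fm Γ)} {B : Fm Δ} → map f Hs ∋ B → Σ (Fm Γ) λ A → Hs ∋ A × B ≡ f A
  ∋-map⁻ f {H ∷ Hs} here = H , here , refl
  ∋-map⁻ f {H ∷ Hs} (there i) with ∋-map⁻ f i
  ... | A , j , e = A , there j , e

  TAx-subF : (s : Sub Γ Δ) {A : Fm Γ} → TAx T A → TAx T (subF s A)
  TAx-subF s (tax B b) = subst (TAx T) (sym (subF-closed s B)) (tax B b)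

  IL+-subF : (s : Sub Γ Δ) {A : Fm Γ} → IL+ T A → IL+ T (subF s A)
  IL+-subF s (inj₁ a) = inj₁ (ILAx-subF s a)
  IL+-subF s (inj₂ a) = inj₂ (TAx-subF s a)

  HypMap : Sub Γ Δ → List (Fm Γ) → List (Fm Δ) → Set
  HypMap s Hs Ps = ∀ {A} → Hs ∋ A → Ps ∋ subF s A

  HypMap-wkF : (s : Sub Γ Δ) {Hs : List (Fm Γ)} → HypMap s Hs Ps → HypMap (liftS {σ = σ} s) (map wkF Hs) (map wkF Ps)
  HypMap-wkF s h i with ∋-map⁻ wkF i
  ... | A , j , refl = subst (_ ∋_) (sym (subF-liftS-wkF s A)) (∋-map⁺ wkF (h j))

  HypMap-∷ : (s : Sub Γ Δ) {Hs : List (Fm Γ)} {B : Fm Γ} → HypMap s Hs Ps → HypMap s (B ∷ Hs) (subF s B ∷ Ps)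
  HypMap-∷ s h here      = here
  HypMap-∷ s h (there i) = there (h i)

  HypMap-∷-wkF : (s : Sub Γ Δ) {Hs : List (Fm Γ)} {B : Fm (σ ∷ Γ)} →
                 HypMap s Hs Ps → HypMap (liftS s) (B ∷ map wkF Hs) (subF (liftS s) B ∷ map wkF Ps)
  HypMap-∷-wkF s h here      = here
  HypMap-∷-wkF s h (there i) = there (HypMap-wkF s h i)

  ⊢-subF : (s : Sub Γ Δ) {Hs : List (Fm Γ)} {A : Fm Γ} → HypMap s Hs Ps → Hs ⊢ A → Ps ⊢ subF s A
  ⊢-subF s h (hyp i)      = hyp (h i)
  ⊢-subF s h (ax a)       = ax (IL+-subF s a)
  ⊢-subF s h (⊥E d)       = ⊥E (⊢-subF s h d)
  ⊢-subF s h (∧I d e)     = ∧I (⊢-subF s h d) (⊢-subF s h e)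
  ⊢-subF s h (∧E₁ d)      = ∧E₁ (⊢-subF s h d)
  ⊢-subF s h (∧E₂ d)      = ∧E₂ (⊢-subF s h d)
  ⊢-subF s h (∨I₁ d)      = ∨I₁ (⊢-subF s h d)
  ⊢-subF s h (∨I₂ d)      = ∨I₂ (⊢-subF s h d)
  ⊢-subF s h (∨E d e f)   = ∨E (⊢-subF s h d) (⊢-subF s (HypMap-∷ s h) e) (⊢-subF s (HypMap-∷ s h) f)
  ⊢-subF s h (⇒I d)       = ⇒I (⊢-subF s (HypMap-∷ s h) d)
  ⊢-subF s h (⇒E d e)     = ⇒E (⊢-subF s h d) (⊢-subF s h e)
  ⊢-subF s h (∀I d)       = ∀I (⊢-subF (liftS s) (HypMap-wkF s h) d)
  ⊢-subF s h (∀E {A = A} d t) = ⊢-cast (sym (subF-[] s A t)) (∀E (⊢-subF s h d) (subT s t))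
  ⊢-subF s h (∃I {A = A} t d) = ∃I (subT s t) (⊢-cast (subF-[] s A t) (⊢-subF s h d))
  ⊢-subF s h (∃E {C = C} d e) = ∃E (⊢-subF s h d) (⊢-cast (subF-liftS-wkF s C) (⊢-subF (liftS s) (HypMap-∷-wkF s h) e))

  ⊢-wkF : {A : Fm Γ} → Ps ⊢ A → map (wkF {τ = σ}) Ps ⊢ wkF A
  ⊢-wkF {Ps = Ps} {A = A} d = ⊢-cast (sym (renF≡subF vs A)) (⊢-subF (var ∘SR vs) h d)
    where
    h : HypMap (var ∘SR vs) Ps (map wkF Ps)
    h {B} i = subst (_ ∋_) (renF≡subF vs B) (∋-map⁺ wkF i)

  ⊢-mono : {A : Fm Γ} → (∀ {B} → Ps ∋ B → Qs ∋ B) → Ps ⊢ A → Qs ⊢ A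
  ⊢-mono {A = A} h d = ⊢-cast (subF-id A) (⊢-subF var (λ {B} i → subst (_ ∋_) (sym (subF-id B)) (h i)) d)

  ⊢-weaken : {A B : Fm Γ} → Ps ⊢ A → B ∷ Ps ⊢ A
  ⊢-weaken = ⊢-mono there

  cut : {A B : Fm Γ} → Ps ⊢ A → A ∷ Ps ⊢ B → Ps ⊢ B
  cut a d = ⇒E (⇒I d) a

  ∀E-vz : {A : Fm (σ ∷ Γ)} → Ps ⊢ ∀' σ A → map wkF Ps ⊢ A
  ∀E-vz {A = A} d = ⊢-cast (renF-liftR-vs-[vz] A) (∀E (⊢-wkF d) (var vz))

  ∃I-vz : {Qs : List (Fm (σ ∷ Γ))} {A : Fm (σ ∷ Γ)} → Qs ⊢ A → Qs ⊢ wkF (∃' σ A)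
  ∃I-vz {A = A} d = ∃I (var vz) (⊢-cast (sym (renF-liftR-vs-[vz] A)) d)

  axiom : {A : Fm Γ} → ILAx A → Ps ⊢ A
  axiom a = ax (inj₁ a)

  ≐-refl : (t : Tm Γ σ) → Ps ⊢ t ≐ t
  ≐-refl t = axiom (ax-refl t)

  ≐-subst-atomic : (A : Fm (σ ∷ Γ)) → Atomic A → {s t : Tm Γ σ} → Ps ⊢ s ≐ t → Ps ⊢ A [ s ] → Ps ⊢ A [ t ]
  ≐-subst-atomic A a {s} {t} e d = ⇒E (axiom (ax-eq A a s t)) (∧I e d)

  ≐-sym : {s t : Tm Γ σ} → Ps ⊢ s ≐ t → Ps ⊢ t ≐ s
  ≐-sym {s = s} {t} e =
    ⊢-cast (cong (t ≐_) (subT-single-wkT t s))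
      (≐-subst-atomic (var vz ≐ wkT s) at≐ e (⊢-cast (cong (s ≐_) (sym (subT-single-wkT s s))) (≐-refl s)))

  ≐-trans : {s t u : Tm Γ σ} → Ps ⊢ s ≐ t → Ps ⊢ t ≐ u → Ps ⊢ s ≐ u
  ≐-trans {s = s} {t} {u} e e′ =
    ⊢-cast (cong (_≐ u) (subT-single-wkT u s))
      (≐-subst-atomic (wkT s ≐ var vz) at≐ e′ (⊢-cast (cong (_≐ t) (sym (subT-single-wkT t s))) e))

  ≐-cong : (u : Tm (σ ∷ Γ) τ) {s t : Tm Γ σ} → Ps ⊢ s ≐ t → Ps ⊢ subT (single s) u ≐ subT (single t) u
  ≐-cong u {s} {t} e =
    ⊢-cast (cong (_≐ subT (single t) u) (subT-single-wkT t us))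
      (≐-subst-atomic (wkT us ≐ u) at≐ e (⊢-cast (cong (_≐ us) (sym (subT-single-wkT s us))) (≐-refl us)))
    where us = subT (single s) u

  ·-cong : {f g : Tm Γ (σ ⇒ τ)} {a b : Tm Γ σ} → Ps ⊢ f ≐ g → Ps ⊢ a ≐ b → Ps ⊢ f · a ≐ g · b
  ·-cong {f = f} {g} {a} {b} e e′ = ≐-trans
    (⊢-cast (cong₂ (λ X Y → f · X ≐ g · Y) (subT-single-wkT f a) (subT-single-wkT g a)) (≐-cong (var vz · wkT a) e))
    (⊢-cast (cong₂ (λ X Y → X · a ≐ Y · b) (subT-single-wkT a g) (subT-single-wkT b g)) (≐-cong (wkT g · var vz) e′))

  ∀∈-unfold : {t : Tm Γ (σ *)} {A : Fm (σ ∷ Γ)} → Ps ⊢ ∀∈ t A → Ps ⊢ ∀' σ (var vz ∈' wkT t ⇒' A)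
  ∀∈-unfold {t = t} {A} = ⇒E (∧E₁ (axiom (ax-∀∈ t A)))

  ∀∈-fold : {t : Tm Γ (σ *)} {A : Fm (σ ∷ Γ)} → Ps ⊢ ∀' σ (var vz ∈' wkT t ⇒' A) → Ps ⊢ ∀∈ t A
  ∀∈-fold {t = t} {A} = ⇒E (∧E₂ (axiom (ax-∀∈ t A)))

  ∃∈-unfold : {t : Tm Γ (σ *)} {A : Fm (σ ∷ Γ)} → Ps ⊢ ∃∈ t A → Ps ⊢ ∃' σ (var vz ∈' wkT t ∧' A)
  ∃∈-unfold {t = t} {A} = ⇒E (∧E₁ (axiom (ax-∃∈ t A)))

  ∃∈-fold : {t : Tm Γ (σ *)} {A : Fm (σ ∷ Γ)} → Ps ⊢ ∃' σ (var vz ∈' wkT t ∧' A) → Ps ⊢ ∃∈ t A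
  ∃∈-fold {t = t} {A} = ⇒E (∧E₂ (axiom (ax-∃∈ t A)))

  ∀∈I : {t : Tm Γ (σ *)} {A : Fm (σ ∷ Γ)} → var vz ∈' wkT t ∷ map wkF Ps ⊢ A → Ps ⊢ ∀∈ t A
  ∀∈I d = ∀∈-fold (∀I (⇒I d))

  ∀∈E-vz : {t : Tm Γ (σ *)} {A : Fm (σ ∷ Γ)} → Ps ⊢ ∀∈ t A → var vz ∈' wkT t ∷ map wkF Ps ⊢ A
  ∀∈E-vz d = ⇒E (⊢-weaken (∀E-vz (∀∈-unfold d))) (hyp here)

  ∀∈E : {t : Tm Γ (σ *)} {A : Fm (σ ∷ Γ)} → Ps ⊢ ∀∈ t A → (u : Tm Γ σ) → Ps ⊢ u ∈' t → Ps ⊢ A [ u ]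
  ∀∈E {t = t} {A} d u = ⇒E (⊢-cast (cong (λ X → u ∈' X ⇒' A [ u ]) (subT-single-wkT u t)) (∀E (∀∈-unfold d) u))

  ∃∈I : {t : Tm Γ (σ *)} {A : Fm (σ ∷ Γ)} (u : Tm Γ σ) → Ps ⊢ u ∈' t → Ps ⊢ A [ u ] → Ps ⊢ ∃∈ t A
  ∃∈I {t = t} u m a = ∃∈-fold (∃I u (∧I (⊢-cast (cong (u ∈'_) (sym (subT-single-wkT u t))) m) a))

  ∃∈E : {t : Tm Γ (σ *)} {A : Fm (σ ∷ Γ)} {C : Fm Γ} →
        Ps ⊢ ∃∈ t A → A ∷ var vz ∈' wkT t ∷ map wkF Ps ⊢ wkF C → Ps ⊢ C
  ∃∈E d e = ∃E (∃∈-unfold d) (cut (∧E₁ (hyp here)) (cut (∧E₂ (hyp (there here))) (⊢-mono skip e)))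
    where
    skip : {A B C D : Fm (σ ∷ Γ)} {Qs : List (Fm (σ ∷ Γ))} → (A ∷ B ∷ Qs) ∋ D → (A ∷ B ∷ C ∷ Qs) ∋ D
    skip here              = here
    skip (there here)      = there here
    skip (there (there i)) = there (there (there i))

  ∃∈I-vz : {t : Tm Γ (σ *)} {A : Fm (σ ∷ Γ)} {Qs : List (Fm (σ ∷ Γ))} → Qs ⊢ var vz ∈' wkT t → Qs ⊢ A → Qs ⊢ wkF (∃∈ t A)
  ∃∈I-vz {A = A} m d = ∃∈I (var vz) m (⊢-cast (sym (renF-liftR-vs-[vz] A)) d)

  ∈-congʳ : {a : Tm Γ σ} {b c : Tm Γ (σ *)} → Ps ⊢ b ≐ c → Ps ⊢ a ∈' b → Ps ⊢ a ∈' c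
  ∈-congʳ {a = a} {b} {c} e m =
    ⊢-cast (cong (_∈' c) (subT-single-wkT c a))
      (≐-subst-atomic (wkT a ∈' var vz) at∈ e (⊢-cast (cong (_∈' b) (sym (subT-single-wkT b a))) m))

  ∃∈-cong : {s t : Tm Γ (σ *)} {A : Fm (σ ∷ Γ)} → Ps ⊢ s ≐ t → Ps ⊢ ∃∈ s A → Ps ⊢ ∃∈ t A
  ∃∈-cong e d = ∃∈E d (∃∈I-vz (∈-congʳ (⊢-weaken (⊢-weaken (⊢-wkF e))) (hyp (there here))) (hyp here))

  ∈-sng : (u : Tm Γ σ) → Ps ⊢ u ∈' sng · u
  ∈-sng u = ⇒E (∧E₂ (axiom (ax-sng u u))) (≐-refl u)

  -- A substitution θ : Sub Γ (σ ∷ Δ) is a context with a hole vz, filled by single s ∘S θ.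
  -- Stating Leibniz's law for all such θ lets the induction pass under binders.
  liftHole : Sub Γ (σ ∷ Δ) → Sub (τ ∷ Γ) (σ ∷ τ ∷ Δ)
  liftHole θ vz     = var (vs vz)
  liftHole θ (vs x) = renT (liftR vs) (θ x)

  liftS-plug : (θ : Sub Γ (σ ∷ Δ)) (u : Tm Δ σ) → liftS {σ = τ} (single u ∘S θ) ≗S single (wkT u) ∘S liftHole θ
  liftS-plug θ u vz     = refl
  liftS-plug θ u (vs x) =
    trans (renT-subT vs (single u) (θ x)) (trans (subT-cong (wkT∘single u) (θ x)) (sym (subT-renT (single (wkT u)) (liftR vs) (θ x))))

  ≐-cong-plug : (θ : Sub Γ (σ ∷ Δ)) (u : Tm Γ τ) {s t : Tm Δ σ} →
                Ps ⊢ s ≐ t → Ps ⊢ subT (single s ∘S θ) u ≐ subT (single t ∘S θ) u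
  ≐-cong-plug θ u {s} {t} e = ⊢-cast (cong₂ _≐_ (subT-∘ (single s) θ u) (subT-∘ (single t) θ u)) (≐-cong (subT θ u) e)

  ≐-subst-plug-atomic : (X : Fm Γ) → Atomic X → (θ : Sub Γ (σ ∷ Δ)) {s t : Tm Δ σ} →
                        Ps ⊢ s ≐ t → Ps ⊢ subF (single s ∘S θ) X → Ps ⊢ subF (single t ∘S θ) X
  ≐-subst-plug-atomic X a θ {s} {t} e d =
    ⊢-cast (subF-∘ (single t) θ X) (≐-subst-atomic (subF θ X) (Atomic-subF θ a) e (⊢-cast (sym (subF-∘ (single s) θ X)) d))

  ≐-subst-plug : (X : Fm Γ) (θ : Sub Γ (σ ∷ Δ)) {s t : Tm Δ σ} →
                 Ps ⊢ s ≐ t → Ps ⊢ subF (single s ∘S θ) X → Ps ⊢ subF (single t ∘S θ) X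
  ≐-subst-plug-binder : (Y : Fm (τ ∷ Γ)) (θ : Sub Γ (σ ∷ Δ)) {s t : Tm Δ σ} {Qs : List (Fm (τ ∷ Δ))} →
                        Qs ⊢ wkT s ≐ wkT t → Qs ⊢ subF (liftS (single s ∘S θ)) Y → Qs ⊢ subF (liftS (single t ∘S θ)) Y

  ≐-subst-plug ⊥'         θ e d = d
  ≐-subst-plug (a ≐ b)    θ e d = ≐-subst-plug-atomic (a ≐ b) at≐ θ e d
  ≐-subst-plug (a ∈' b)   θ e d = ≐-subst-plug-atomic (a ∈' b) at∈ θ e d
  ≐-subst-plug (rel R ts) θ e d = ≐-subst-plug-atomic (rel R ts) atrel θ e d
  ≐-subst-plug (A ∨' B)   θ e d =
    ∨E d (∨I₁ (≐-subst-plug A θ (⊢-weaken e) (hyp here))) (∨I₂ (≐-subst-plug B θ (⊢-weaken e) (hyp here)))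
  ≐-subst-plug (A ∧' B)   θ e d = ∧I (≐-subst-plug A θ e (∧E₁ d)) (≐-subst-plug B θ e (∧E₂ d))
  ≐-subst-plug (A ⇒' B)   θ e d =
    ⇒I (≐-subst-plug B θ (⊢-weaken e) (⇒E (⊢-weaken d) (≐-subst-plug A θ (≐-sym (⊢-weaken e)) (hyp here))))
  ≐-subst-plug (∀' τ Y)   θ e d = ∀I (≐-subst-plug-binder Y θ (⊢-wkF e) (∀E-vz d))
  ≐-subst-plug (∃' τ Y)   θ e d = ∃E d (∃I-vz (≐-subst-plug-binder Y θ (⊢-weaken (⊢-wkF e)) (hyp here)))
  ≐-subst-plug (∀∈ u Y)   θ e d = ∀∈I (≐-subst-plug-binder Y θ (⊢-weaken (⊢-wkF e)) (⇒E (⊢-weaken (∀E-vz (∀∈-unfold d))) u∈))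
    where u∈ = ∈-congʳ (⊢-weaken (⊢-wkF (≐-sym (≐-cong-plug θ u e)))) (hyp here)
  ≐-subst-plug (∃∈ u Y)   θ e d =
    ∃∈E d (∃∈I-vz (∈-congʳ (⊢-weaken (⊢-weaken (⊢-wkF (≐-cong-plug θ u e)))) (hyp (there here)))
                  (≐-subst-plug-binder Y θ (⊢-weaken (⊢-weaken (⊢-wkF e))) (hyp here)))

  ≐-subst-plug-binder Y θ {s} {t} e d =
    ⊢-cast (sym (subF-cong (liftS-plug θ t) Y)) (≐-subst-plug Y (liftHole θ) e (⊢-cast (subF-cong (liftS-plug θ s) Y) d))

  ≐-subst : (A : Fm (σ ∷ Γ)) {s t : Tm Γ σ} → Ps ⊢ s ≐ t → Ps ⊢ A [ s ] → Ps ⊢ A [ t ]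
  ≐-subst A {s} {t} e d = ⊢-cast (subF-cong (λ _ → refl) A) (≐-subst-plug A var e (⊢-cast (subF-cong (λ _ → refl) A) d))

module Tuples (L : Signature) where
  open Logic L
  open Substitution L

  variable
    Ts Us Vs Ws : List Ty

  Tms : Con → List Ty → Set
  Tms Δ = All (Tm Δ)

  subTs : Sub Γ Δ → Tms Γ Ts → Tms Δ Ts
  subTs s = All.map (subT s)

  wkTs : Tms Γ Ts → Tms (σ ∷ Γ) Ts
  wkTs = All.map wkT

  castT : Ts ≡ Us → Tms Δ Ts → Tms Δ Us
  castT = subst (Tms _)

  map-fuse : {P Q R : Ty → Set} {f : ∀ {τ} → Q τ → R τ} {g : ∀ {τ} → P τ → Q τ} {h : ∀ {τ} → P τ → R τ} →
             (∀ {τ} (x : P τ) → f (g x) ≡ h x) → (xs : All P Ts) → All.map f (All.map g xs) ≡ All.map h xs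
  map-fuse e xs = trans (map-∘ xs) (map-cong xs e)

  map-++⁺ : {P Q : Ty → Set} (f : ∀ {τ} → P τ → Q τ) (xs : All P Ts) (ys : All P Us) →
            All.map f (++⁺ xs ys) ≡ ++⁺ (All.map f xs) (All.map f ys)
  map-++⁺ f []       ys = refl
  map-++⁺ f (x ∷ xs) ys = cong (f x ∷_) (map-++⁺ f xs ys)

  map-++⁻ˡ : {P Q : Ty → Set} (f : ∀ {τ} → P τ → Q τ) (Ts : List Ty) (xs : All P (Ts ++ Us)) →
             All.map f (++⁻ˡ Ts xs) ≡ ++⁻ˡ Ts (All.map f xs)
  map-++⁻ˡ f []       xs       = refl
  map-++⁻ˡ f (τ ∷ Ts) (x ∷ xs) = cong (f x ∷_) (map-++⁻ˡ f Ts xs)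

  map-++⁻ʳ : {P Q : Ty → Set} (f : ∀ {τ} → P τ → Q τ) (Ts : List Ty) (xs : All P (Ts ++ Us)) →
             All.map f (++⁻ʳ Ts xs) ≡ ++⁻ʳ Ts (All.map f xs)
  map-++⁻ʳ f []       xs       = refl
  map-++⁻ʳ f (τ ∷ Ts) (x ∷ xs) = map-++⁻ʳ f Ts xs

  ++⁻ˡ-++⁺ : {P : Ty → Set} (xs : All P Ts) (ys : All P Us) → ++⁻ˡ Ts (++⁺ xs ys) ≡ xs
  ++⁻ˡ-++⁺ []       ys = refl
  ++⁻ˡ-++⁺ (x ∷ xs) ys = cong (x ∷_) (++⁻ˡ-++⁺ xs ys)

  ++⁻ʳ-++⁺ : {P : Ty → Set} (xs : All P Ts) (ys : All P Us) → ++⁻ʳ Ts (++⁺ xs ys) ≡ ys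
  ++⁻ʳ-++⁺ []       ys = refl
  ++⁻ʳ-++⁺ (x ∷ xs) ys = ++⁻ʳ-++⁺ xs ys

  map-castT : (f : ∀ {τ} → Tm Γ τ → Tm Δ τ) (p : Ts ≡ Us) (as : Tms Γ Ts) → All.map f (castT p as) ≡ castT p (All.map f as)
  map-castT f refl as = refl

  castT-subTs-castT : (p : Us ≡ Ts) (s : Sub Γ Δ) (as : Tms Γ Ts) → castT p (subTs s (castT (sym p) as)) ≡ subTs s as
  castT-subTs-castT refl s as = refl

  castT-cancel : (p : Ts ≡ Us) (q : Us ≡ Ts) (as : Tms Δ Ts) → castT q (castT p as) ≡ as
  castT-cancel refl refl as = refl

  castT-∷ : (p : Ts ≡ Us) (q : τ ∷ Ts ≡ τ ∷ Us) (a : Tm Δ τ) (as : Tms Δ Ts) → castT q (a ∷ as) ≡ a ∷ castT p as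
  castT-∷ refl refl a as = refl

  castT-++⁻ˡ : (p : Ts ≡ Us) (q : Vs ≡ Ws) (r : Ts ++ Vs ≡ Us ++ Ws) (as : Tms Δ (Ts ++ Vs)) →
               castT p (++⁻ˡ Ts as) ≡ ++⁻ˡ Us (castT r as)
  castT-++⁻ˡ refl refl refl as = refl

  castT-++⁻ʳ : (p : Ts ≡ Us) (q : Vs ≡ Ws) (r : Ts ++ Vs ≡ Us ++ Ws) (as : Tms Δ (Ts ++ Vs)) →
               castT q (++⁻ʳ Ts as) ≡ ++⁻ʳ Us (castT r as)
  castT-++⁻ʳ refl refl refl as = refl

  subTs-cong : {s s′ : Sub Γ Δ} → s ≗S s′ → (as : Tms Γ Ts) → subTs s as ≡ subTs s′ as
  subTs-cong e as = map-cong as (subT-cong e)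

  subTs-id : (as : Tms Γ Ts) → subTs var as ≡ as
  subTs-id as = trans (map-cong as subT-id) (map-id as)

  subTs-∘ : (s′ : Sub Δ Θ) (s : Sub Γ Δ) (as : Tms Γ Ts) → subTs s′ (subTs s as) ≡ subTs (s′ ∘S s) as
  subTs-∘ s′ s = map-fuse (subT-∘ s′ s)

  subTs-liftS-wkTs : (s : Sub Γ Δ) (as : Tms Γ Ts) → subTs (liftS {σ = σ} s) (wkTs as) ≡ wkTs (subTs s as)
  subTs-liftS-wkTs s as = trans (map-fuse (subT-liftS-wkT s) as) (sym (map-∘ as))

  subTs-▸-wkTs : (s : Sub Γ Δ) (a : Tm Δ σ) (as : Tms Γ Ts) → subTs (s ▸ a) (wkTs as) ≡ subTs s as
  subTs-▸-wkTs s a = map-fuse (subT-▸-wkT s a)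

  subTs-single-wkTs : (a : Tm Γ σ) (as : Tms Γ Ts) → subTs (single a) (wkTs as) ≡ as
  subTs-single-wkTs a as = trans (map-fuse (subT-single-wkT a) as) (map-id as)

  wkTs-subTs : (s : Sub Γ Δ) (as : Tms Γ Ts) → wkTs {σ = σ} (subTs s as) ≡ subTs (vs ∘RS s) as
  wkTs-subTs s = map-fuse (renT-subT vs s)

  wkTs≡subTs : (as : Tms Γ Ts) → wkTs {σ = σ} as ≡ subTs (var ∘SR vs) as
  wkTs≡subTs as = map-cong as (renT≡subT vs)

  -- The head of Ts is the last argument, as in vars Ts, which binds the head of Ts to vz.
  infixr 20 _⇒⃗_
  _⇒⃗_ : List Ty → Ty → Ty
  []       ⇒⃗ ρ = ρ
  (τ ∷ Ts) ⇒⃗ ρ = Ts ⇒⃗ (τ ⇒ ρ)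

  infixr 20 _⇉_
  _⇉_ : List Ty → List Ty → List Ty
  Ts ⇉ Us = map (Ts ⇒⃗_) Us

  infixl 40 _·⃗_ _·ₜ_
  _·⃗_ : Tm Δ (Ts ⇒⃗ ρ) → Tms Δ Ts → Tm Δ ρ
  f ·⃗ []       = f
  f ·⃗ (a ∷ as) = (f ·⃗ as) · a

  _·ₜ_ : Tms Δ (Ts ⇉ Us) → Tms Δ Ts → Tms Δ Us
  _·ₜ_ {Us = []}     []       as = []
  _·ₜ_ {Us = U ∷ Us} (f ∷ fs) as = f ·⃗ as ∷ fs ·ₜ as

  subT-·⃗ : (s : Sub Γ Δ) (f : Tm Γ (Ts ⇒⃗ ρ)) (as : Tms Γ Ts) → subT s (f ·⃗ as) ≡ subT s f ·⃗ subTs s as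
  subT-·⃗ s f []       = refl
  subT-·⃗ s f (a ∷ as) = cong (_· subT s a) (subT-·⃗ s f as)

  subTs-·ₜ : (s : Sub Γ Δ) (fs : Tms Γ (Ts ⇉ Us)) (as : Tms Γ Ts) → subTs s (fs ·ₜ as) ≡ subTs s fs ·ₜ subTs s as
  subTs-·ₜ {Us = []}     s []       as = refl
  subTs-·ₜ {Us = U ∷ Us} s (f ∷ fs) as = cong₂ _∷_ (subT-·⃗ s f as) (subTs-·ₜ s fs as)

  wkT-·⃗ : (f : Tm Γ (Ts ⇒⃗ ρ)) (as : Tms Γ Ts) → wkT {τ = σ} (f ·⃗ as) ≡ wkT f ·⃗ wkTs as
  wkT-·⃗ f []       = refl
  wkT-·⃗ f (a ∷ as) = cong (_· wkT a) (wkT-·⃗ f as)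

  castT-wkTs-·vz : (p : Ts ≡ Us) (q : (σ ∷ []) ⇉ Ts ≡ (σ ∷ []) ⇉ Us) (fs : Tms Δ ((σ ∷ []) ⇉ Ts)) →
                   castT p (wkTs fs ·ₜ (var vz ∷ [])) ≡ wkTs (castT q fs) ·ₜ (var vz ∷ [])
  castT-wkTs-·vz refl refl fs = refl

  ·ₜ-[] : (fs : Tms Δ ([] ⇉ Us)) → fs ·ₜ [] ≡ castT (List.map-id Us) fs
  ·ₜ-[] {Us = []}     []       = refl
  ·ₜ-[] {Us = U ∷ Us} (f ∷ fs) = trans (cong (f ∷_) (·ₜ-[] fs)) (sym (castT-∷ (List.map-id Us) (List.map-id (U ∷ Us)) f fs))

  infixr 5 _++ˢ_
  _++ˢ_ : Tms Δ Ts → Sub Γ Δ → Sub (Ts ++ Γ) Δ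
  ([] ++ˢ s) x = s x
  ((a ∷ as) ++ˢ s) = (as ++ˢ s) ▸ a

  ∘S-++ˢ : (s′ : Sub Δ Θ) (as : Tms Δ Ts) (s : Sub Γ Δ) → s′ ∘S (as ++ˢ s) ≗S subTs s′ as ++ˢ (s′ ∘S s)
  ∘S-++ˢ s′ []       s x      = refl
  ∘S-++ˢ s′ (a ∷ as) s vz     = refl
  ∘S-++ˢ s′ (a ∷ as) s (vs x) = ∘S-++ˢ s′ as s x

  ++ˢ-cong : {as bs : Tms Δ Ts} {s s′ : Sub Γ Δ} → as ≡ bs → s ≗S s′ → as ++ˢ s ≗S bs ++ˢ s′
  ++ˢ-cong {as = []}     refl e x      = e x
  ++ˢ-cong {as = a ∷ as} refl e vz     = refl
  ++ˢ-cong {as = a ∷ as} refl e (vs x) = ++ˢ-cong {as = as} refl e x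

  wkT* : (Ts : List Ty) → Tm Γ τ → Tm (Ts ++ Γ) τ
  wkT* []       t = t
  wkT* (σ ∷ Ts) t = wkT (wkT* Ts t)

  wkF* : (Ts : List Ty) → Fm Γ → Fm (Ts ++ Γ)
  wkF* []       A = A
  wkF* (σ ∷ Ts) A = wkF (wkF* Ts A)

  wkTs* : (Ts : List Ty) → Tms Γ Us → Tms (Ts ++ Γ) Us
  wkTs* Ts = All.map (wkT* Ts)

  wkS* : (Ts : List Ty) → Sub Γ Δ → Sub Γ (Ts ++ Δ)
  wkS* Ts s x = wkT* Ts (s x)

  vars : (Ts : List Ty) → Tms (Ts ++ Γ) Ts
  vars []       = []
  vars (τ ∷ Ts) = var vz ∷ wkTs (vars Ts)

  liftS* : (Ts : List Ty) → Sub Γ Δ → Sub (Ts ++ Γ) (Ts ++ Δ)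
  liftS* []       s = s
  liftS* (τ ∷ Ts) s = liftS (liftS* Ts s)

  ∀⃗ : (Ts : List Ty) → Fm (Ts ++ Γ) → Fm Γ
  ∀⃗ []       A = A
  ∀⃗ (τ ∷ Ts) A = ∀⃗ Ts (∀' τ A)

  wkF*-≐ : (Xs : List Ty) (a b : Tm Γ τ) → wkF* Xs (a ≐ b) ≡ (wkT* Xs a ≐ wkT* Xs b)
  wkF*-≐ []       a b = refl
  wkF*-≐ (σ ∷ Xs) a b = cong wkF (wkF*-≐ Xs a b)

  subF-∀⃗ : (s : Sub Γ Δ) (Ts : List Ty) (A : Fm (Ts ++ Γ)) → subF s (∀⃗ Ts A) ≡ ∀⃗ Ts (subF (liftS* Ts s) A)
  subF-∀⃗ s []       A = refl
  subF-∀⃗ s (τ ∷ Ts) A = subF-∀⃗ s Ts (∀' τ A)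

  subT-liftS*-wkT* : (s : Sub Γ Δ) (Ts : List Ty) (t : Tm Γ τ) → subT (liftS* Ts s) (wkT* Ts t) ≡ wkT* Ts (subT s t)
  subT-liftS*-wkT* s []       t = refl
  subT-liftS*-wkT* s (σ ∷ Ts) t = trans (subT-liftS-wkT (liftS* Ts s) (wkT* Ts t)) (cong wkT (subT-liftS*-wkT* s Ts t))

  subTs-liftS*-vars : (s : Sub Γ Δ) (Ts : List Ty) → subTs (liftS* Ts s) (vars Ts) ≡ vars Ts
  subTs-liftS*-vars s []       = refl
  subTs-liftS*-vars s (τ ∷ Ts) = cong (var vz ∷_) (trans (subTs-liftS-wkTs (liftS* Ts s) (vars Ts)) (cong wkTs (subTs-liftS*-vars s Ts)))

  subT-++ˢ-wkT* : (Ts : List Ty) (as : Tms Δ Ts) (s : Sub Γ Δ) (t : Tm Γ τ) → subT (as ++ˢ s) (wkT* Ts t) ≡ subT s t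
  subT-++ˢ-wkT* []       []       s t = subT-cong (λ _ → refl) t
  subT-++ˢ-wkT* (σ ∷ Ts) (a ∷ as) s t = trans (subT-▸-wkT (as ++ˢ s) a (wkT* Ts t)) (subT-++ˢ-wkT* Ts as s t)

  subTs-liftS*-wkTs* : (s : Sub Γ Δ) (Ts : List Ty) (as : Tms Γ Us) → subTs (liftS* Ts s) (wkTs* Ts as) ≡ wkTs* Ts (subTs s as)
  subTs-liftS*-wkTs* s Ts as = trans (map-fuse (subT-liftS*-wkT* s Ts) as) (sym (map-∘ as))

  subTs-++ˢ-wkTs* : (Ts : List Ty) (as : Tms Δ Ts) (s : Sub Γ Δ) (bs : Tms Γ Us) → subTs (as ++ˢ s) (wkTs* Ts bs) ≡ subTs s bs
  subTs-++ˢ-wkTs* Ts as s = map-fuse (subT-++ˢ-wkT* Ts as s)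

  subTs-++ˢ-vars : (Ts : List Ty) (as : Tms Δ Ts) (s : Sub Γ Δ) → subTs (as ++ˢ s) (vars Ts) ≡ as
  subTs-++ˢ-vars []       []       s = refl
  subTs-++ˢ-vars (τ ∷ Ts) (a ∷ as) s = cong (a ∷_) (trans (subTs-▸-wkTs (as ++ˢ s) a (vars Ts)) (subTs-++ˢ-vars Ts as s))

  subTs-++ˢ-wkTs-vars : (Ts : List Ty) (s : Sub Γ (τ ∷ Ts ++ Δ)) → subTs (vars (τ ∷ Ts) ++ˢ s) (wkTs (vars Ts)) ≡ wkTs (vars Ts)
  subTs-++ˢ-wkTs-vars Ts s = trans (subTs-▸-wkTs (wkTs (vars Ts) ++ˢ s) (var vz) (vars Ts)) (subTs-++ˢ-vars Ts (wkTs (vars Ts)) s)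

  ++ˢ-∘S-wkS* : (Ts : List Ty) (as : Tms Δ Ts) (s : Sub Γ Δ) → (as ++ˢ var) ∘S wkS* Ts s ≗S s
  ++ˢ-∘S-wkS* Ts as s x = trans (subT-++ˢ-wkT* Ts as var (s x)) (subT-id (s x))

  subT-wkS* : (Ts : List Ty) (s : Sub Γ Δ) (t : Tm Γ τ) → subT (wkS* Ts s) t ≡ wkT* Ts (subT s t)
  subT-wkS* []       s t = refl
  subT-wkS* (σ ∷ Ts) s t = trans (sym (renT-subT vs (wkS* Ts s) t)) (cong wkT (subT-wkS* Ts s t))

  subTs-wkS* : (Ts : List Ty) (s : Sub Γ Δ) (as : Tms Γ Us) → subTs (wkS* Ts s) as ≡ wkTs* Ts (subTs s as)
  subTs-wkS* Ts s as = trans (map-cong as (subT-wkS* Ts s)) (sym (map-∘ as))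

  subTs-vars-++ˢ-wkTs* : (Xs : List Ty) (s : Sub Γ Δ) (as : Tms Γ Us) → subTs (vars Xs ++ˢ wkS* Xs s) (wkTs* Xs as) ≡ wkTs* Xs (subTs s as)
  subTs-vars-++ˢ-wkTs* Xs s as = trans (subTs-++ˢ-wkTs* Xs (vars Xs) (wkS* Xs s) as) (subTs-wkS* Xs s as)

  subF-wkS* : (Ts : List Ty) (s : Sub Γ Δ) (A : Fm Γ) → subF (wkS* Ts s) A ≡ wkF* Ts (subF s A)
  subF-wkS* []       s A = subF-cong (λ _ → refl) A
  subF-wkS* (σ ∷ Ts) s A = trans (sym (renF-subF vs (wkS* Ts s) A)) (cong wkF (subF-wkS* Ts s A))

  wkT*-· : (Xs : List Ty) (f : Tm Γ (σ ⇒ τ)) (a : Tm Γ σ) → wkT* Xs (f · a) ≡ wkT* Xs f · wkT* Xs a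
  wkT*-· []       f a = refl
  wkT*-· (ρ ∷ Xs) f a = cong wkT (wkT*-· Xs f a)

  wkT*-·⃗ : (Xs : List Ty) (f : Tm Γ (Ts ⇒⃗ ρ)) (as : Tms Γ Ts) → wkT* Xs (f ·⃗ as) ≡ wkT* Xs f ·⃗ wkTs* Xs as
  wkT*-·⃗ Xs f []       = refl
  wkT*-·⃗ Xs f (a ∷ as) = trans (wkT*-· Xs (f ·⃗ as) a) (cong (_· wkT* Xs a) (wkT*-·⃗ Xs f as))

  wkTs*-·ₜ : (Xs : List Ty) (fs : Tms Γ (Ts ⇉ Us)) (as : Tms Γ Ts) → wkTs* Xs (fs ·ₜ as) ≡ wkTs* Xs fs ·ₜ wkTs* Xs as
  wkTs*-·ₜ {Us = []}     Xs []       as = refl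
  wkTs*-·ₜ {Us = U ∷ Us} Xs (f ∷ fs) as = cong₂ _∷_ (wkT*-·⃗ Xs f as) (wkTs*-·ₜ Xs fs as)

  dummy : (τ : Ty) → Tm Γ τ
  dummy G       = fun (Signature.const L)
  dummy (σ ⇒ τ) = Πc · dummy τ
  dummy (σ *)   = sng · dummy σ

  dummies : (Ts : List Ty) → Tms Γ Ts
  dummies []       = []
  dummies (τ ∷ Ts) = dummy τ ∷ dummies Ts

  subT-dummy : (s : Sub Γ Δ) (τ : Ty) → subT s (dummy τ) ≡ dummy τ
  subT-dummy s G       = refl
  subT-dummy s (σ ⇒ τ) = cong (Πc ·_) (subT-dummy s τ)
  subT-dummy s (σ *)   = cong (sng ·_) (subT-dummy s σ)

  subTs-dummies : (s : Sub Γ Δ) (Ts : List Ty) → subTs s (dummies Ts) ≡ dummies Ts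
  subTs-dummies s []       = refl
  subTs-dummies s (τ ∷ Ts) = cong₂ _∷_ (subT-dummy s τ) (subTs-dummies s Ts)

  wkTs*-dummies : (Xs Ts : List Ty) → wkTs* {Γ = Γ} Xs (dummies Ts) ≡ dummies Ts
  wkTs*-dummies Xs Ts = begin
    wkTs* Xs (dummies Ts)                ≡⟨ cong (wkTs* Xs) (subTs-id (dummies Ts)) ⟨
    wkTs* Xs (subTs var (dummies Ts))    ≡⟨ subTs-wkS* Xs var (dummies Ts) ⟨
    subTs (wkS* Xs var) (dummies Ts)     ≡⟨ subTs-dummies (wkS* Xs var) Ts ⟩
    dummies Ts                           ∎
    where open ≡-Reasoning

  wkT*-subT-·⃗-dummies : (Xs : List Ty) (s : Sub Γ Δ) (f : Tm Γ (Ts ⇒⃗ ρ)) →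
                          wkT* Xs (subT s (f ·⃗ dummies Ts)) ≡ wkT* Xs (subT s f) ·⃗ dummies Ts
  wkT*-subT-·⃗-dummies {Ts = Ts} Xs s f =
    trans (cong (wkT* Xs) (trans (subT-·⃗ s f (dummies Ts)) (cong (subT s f ·⃗_) (subTs-dummies s Ts))))
          (trans (wkT*-·⃗ Xs (subT s f) (dummies Ts)) (cong (wkT* Xs (subT s f) ·⃗_) (wkTs*-dummies Xs Ts)))

  subTs-·ₜ-dummies : (s : Sub Γ Δ) (fs : Tms Γ (Ts ⇉ Us)) → subTs s (fs ·ₜ dummies Ts) ≡ subTs s fs ·ₜ dummies Ts
  subTs-·ₜ-dummies {Ts = Ts} s fs = trans (subTs-·ₜ s fs (dummies Ts)) (cong (subTs s fs ·ₜ_) (subTs-dummies s Ts))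

  wkTs*-·ₜ-dummies : (Xs : List Ty) (fs : Tms Γ (Ts ⇉ Us)) → wkTs* Xs (fs ·ₜ dummies Ts) ≡ wkTs* Xs fs ·ₜ dummies Ts
  wkTs*-·ₜ-dummies {Ts = Ts} Xs fs = trans (wkTs*-·ₜ Xs fs (dummies Ts)) (cong (wkTs* Xs fs ·ₜ_) (wkTs*-dummies Xs Ts))

module Combinators (L : Signature) (T : Logic.Fm L [] → Set) where
  open Logic L hiding (_⊢_)
  open Substitution L
  open Derivations L T
  open Tuples L

  I : Tm Γ (σ ⇒ σ)
  I {σ = σ} = Σc · Πc · Πc {σ = σ} {τ = σ}

  ƛ : Tm (σ ∷ Γ) τ → Tm Γ (σ ⇒ τ)
  ƛ (var vz)     = I
  ƛ (var (vs x)) = Πc · var x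
  ƛ (fun f)      = Πc · fun f
  ƛ Πc           = Πc · Πc
  ƛ Σc           = Πc · Σc
  ƛ sng          = Πc · sng
  ƛ cup          = Πc · cup
  ƛ bigcup       = Πc · bigcup
  ƛ (t · u)      = Σc · ƛ t · ƛ u

  ƛ-β : (s : Sub Γ Δ) (t : Tm (σ ∷ Γ) τ) (a : Tm Δ σ) → Ps ⊢ subT s (ƛ t) · a ≐ subT (s ▸ a) t
  ƛ-β s (var vz)     a = ≐-trans (axiom (ax-Σ Πc Πc a)) (axiom (ax-Π a (Πc · a)))
  ƛ-β s (var (vs x)) a = axiom (ax-Π (s x) a)
  ƛ-β s (fun f)      a = axiom (ax-Π (fun f) a)
  ƛ-β s Πc           a = axiom (ax-Π Πc a)
  ƛ-β s Σc           a = axiom (ax-Π Σc a)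
  ƛ-β s sng          a = axiom (ax-Π sng a)
  ƛ-β s cup          a = axiom (ax-Π cup a)
  ƛ-β s bigcup       a = axiom (ax-Π bigcup a)
  ƛ-β s (t · u)      a = ≐-trans (axiom (ax-Σ (subT s (ƛ t)) (subT s (ƛ u)) a)) (·-cong (ƛ-β s t a) (ƛ-β s u a))

  ƛ⃗ : (Ts : List Ty) → Tm (Ts ++ Γ) ρ → Tm Γ (Ts ⇒⃗ ρ)
  ƛ⃗ []       t = t
  ƛ⃗ (τ ∷ Ts) t = ƛ⃗ Ts (ƛ t)

  ƛₜ : (Ts : List Ty) → Tms (Ts ++ Γ) Us → Tms Γ (Ts ⇉ Us)
  ƛₜ Ts []       = []
  ƛₜ Ts (e ∷ es) = ƛ⃗ Ts e ∷ ƛₜ Ts es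

  data Pointwise (R : ∀ {τ} → Tm Γ τ → Tm Γ τ → Set) : Tms Γ Ts → Tms Γ Ts → Set where
    []  : Pointwise R [] []
    _∷_ : {a b : Tm Γ τ} {as bs : Tms Γ Ts} → R a b → Pointwise R as bs → Pointwise R (a ∷ as) (b ∷ bs)

  Pointwise-map : {R : ∀ {τ} → Tm Γ τ → Tm Γ τ → Set} {R′ : ∀ {τ} → Tm Δ τ → Tm Δ τ → Set}
                  {f : ∀ {τ} → Tm Γ τ → Tm Δ τ} → (∀ {τ} {a b : Tm Γ τ} → R a b → R′ (f a) (f b)) →
                  {as bs : Tms Γ Ts} → Pointwise R as bs → Pointwise R′ (All.map f as) (All.map f bs)
  Pointwise-map h []       = []
  Pointwise-map h (r ∷ rs) = h r ∷ Pointwise-map h rs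

  Pointwise-mono : {R R′ : ∀ {τ} → Tm Γ τ → Tm Γ τ → Set} → (∀ {τ} {a b : Tm Γ τ} → R a b → R′ a b) →
                   {as bs : Tms Γ Ts} → Pointwise R as bs → Pointwise R′ as bs
  Pointwise-mono h []       = []
  Pointwise-mono h (r ∷ rs) = h r ∷ Pointwise-mono h rs

  Pointwise-++⁻ˡ : {R : ∀ {τ} → Tm Γ τ → Tm Γ τ → Set} (Ts : List Ty) {as bs : Tms Γ (Ts ++ Us)} →
                   Pointwise R as bs → Pointwise R (++⁻ˡ Ts as) (++⁻ˡ Ts bs)
  Pointwise-++⁻ˡ []       rs       = []
  Pointwise-++⁻ˡ (τ ∷ Ts) (r ∷ rs) = r ∷ Pointwise-++⁻ˡ Ts rs

  Pointwise-++⁻ʳ : {R : ∀ {τ} → Tm Γ τ → Tm Γ τ → Set} (Ts : List Ty) {as bs : Tms Γ (Ts ++ Us)} →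
                   Pointwise R as bs → Pointwise R (++⁻ʳ Ts as) (++⁻ʳ Ts bs)
  Pointwise-++⁻ʳ []       rs       = rs
  Pointwise-++⁻ʳ (τ ∷ Ts) (r ∷ rs) = Pointwise-++⁻ʳ Ts rs

  infix 4 _⊢_≐ₜ_
  _⊢_≐ₜ_ : List (Fm Γ) → Tms Γ Ts → Tms Γ Ts → Set
  Ps ⊢ as ≐ₜ bs = Pointwise (λ a b → Ps ⊢ a ≐ b) as bs

  ≐ₜ-refl : (as : Tms Γ Ts) → Ps ⊢ as ≐ₜ as
  ≐ₜ-refl []       = []
  ≐ₜ-refl (a ∷ as) = ≐-refl a ∷ ≐ₜ-refl as

  ≐ₜ-sym : {as bs : Tms Γ Ts} → Ps ⊢ as ≐ₜ bs → Ps ⊢ bs ≐ₜ as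
  ≐ₜ-sym []       = []
  ≐ₜ-sym (e ∷ es) = ≐-sym e ∷ ≐ₜ-sym es

  ≐ₜ-trans : {as bs cs : Tms Γ Ts} → Ps ⊢ as ≐ₜ bs → Ps ⊢ bs ≐ₜ cs → Ps ⊢ as ≐ₜ cs
  ≐ₜ-trans []       []         = []
  ≐ₜ-trans (e ∷ es) (e′ ∷ es′) = ≐-trans e e′ ∷ ≐ₜ-trans es es′

  ≐ₜ-wkF : {as bs : Tms Γ Ts} → Ps ⊢ as ≐ₜ bs → map (wkF {τ = σ}) Ps ⊢ wkTs as ≐ₜ wkTs bs
  ≐ₜ-wkF = Pointwise-map ⊢-wkF

  ≡⇒≐ₜ : {as bs : Tms Γ Ts} → as ≡ bs → Ps ⊢ as ≐ₜ bs
  ≡⇒≐ₜ {as = as} refl = ≐ₜ-refl as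

  ·⃗-congˡ : {f g : Tm Γ (Ts ⇒⃗ ρ)} → Ps ⊢ f ≐ g → (as : Tms Γ Ts) → Ps ⊢ f ·⃗ as ≐ g ·⃗ as
  ·⃗-congˡ e []       = e
  ·⃗-congˡ e (a ∷ as) = ·-cong (·⃗-congˡ e as) (≐-refl a)

  ·ₜ-congˡ : {fs gs : Tms Γ (Ts ⇉ Us)} → Ps ⊢ fs ≐ₜ gs → (as : Tms Γ Ts) → Ps ⊢ fs ·ₜ as ≐ₜ gs ·ₜ as
  ·ₜ-congˡ {Us = []}     []       as = []
  ·ₜ-congˡ {Us = U ∷ Us} (e ∷ es) as = ·⃗-congˡ e as ∷ ·ₜ-congˡ es as

  ƛ⃗-β : (s : Sub Γ Δ) (Ts : List Ty) (t : Tm (Ts ++ Γ) ρ) (as : Tms Δ Ts) → Ps ⊢ subT s (ƛ⃗ Ts t) ·⃗ as ≐ subT (as ++ˢ s) t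
  ƛ⃗-β s []       t []       = ⊢-cast (cong (subT s t ≐_) (subT-cong (λ _ → refl) t)) (≐-refl _)
  ƛ⃗-β s (τ ∷ Ts) t (a ∷ as) = ≐-trans (·-cong (ƛ⃗-β s Ts (ƛ t) as) (≐-refl a)) (ƛ-β (as ++ˢ s) t a)

  ƛₜ-β : (s : Sub Γ Δ) (Ts : List Ty) (es : Tms (Ts ++ Γ) Us) (as : Tms Δ Ts) → Ps ⊢ subTs s (ƛₜ Ts es) ·ₜ as ≐ₜ subTs (as ++ˢ s) es
  ƛₜ-β s Ts []       as = []
  ƛₜ-β s Ts (e ∷ es) as = ƛ⃗-β s Ts e as ∷ ƛₜ-β s Ts es as

  ƛₜ-β-vz : (s : Sub Γ Δ) (es : Tms (σ ∷ Γ) Us) → Ps ⊢ wkTs (subTs s (ƛₜ (σ ∷ []) es)) ·ₜ (var vz ∷ []) ≐ₜ subTs (liftS s) es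
  ƛₜ-β-vz s es =
    ≐ₜ-trans (≡⇒≐ₜ (cong (_·ₜ (var vz ∷ [])) (wkTs-subTs s _)))
             (≐ₜ-trans (ƛₜ-β (vs ∘RS s) (_ ∷ []) es (var vz ∷ [])) (≡⇒≐ₜ (subTs-cong vz▸≗liftS es)))
    where
    vz▸≗liftS : (var vz ∷ []) ++ˢ (vs ∘RS s) ≗S liftS s
    vz▸≗liftS vz     = refl
    vz▸≗liftS (vs x) = refl

  wkPs : (Ts : List Ty) → List (Fm Γ) → List (Fm (Ts ++ Γ))
  wkPs []       Ps = Ps
  wkPs (σ ∷ Ts) Ps = map wkF (wkPs Ts Ps)

  ⊢-wkF* : (Ts : List Ty) {A : Fm Γ} → Ps ⊢ A → wkPs Ts Ps ⊢ wkF* Ts A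
  ⊢-wkF* []       d = d
  ⊢-wkF* (σ ∷ Ts) d = ⊢-wkF (⊢-wkF* Ts d)

  ≐ₜ-wkF* : (Xs : List Ty) {as bs : Tms Γ Ts} → Ps ⊢ as ≐ₜ bs → wkPs Xs Ps ⊢ wkTs* Xs as ≐ₜ wkTs* Xs bs
  ≐ₜ-wkF* Xs = Pointwise-map (λ {_} {a} {b} e → ⊢-cast (wkF*-≐ Xs a b) (⊢-wkF* Xs e))

  ∀⃗I : (Ts : List Ty) {A : Fm (Ts ++ Γ)} → wkPs Ts Ps ⊢ A → Ps ⊢ ∀⃗ Ts A
  ∀⃗I []       d = d
  ∀⃗I (τ ∷ Ts) d = ∀⃗I Ts (∀I d)

  ∀⃗E-vars : (Ts : List Ty) {A : Fm (Ts ++ Γ)} → Ps ⊢ ∀⃗ Ts A → wkPs Ts Ps ⊢ A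
  ∀⃗E-vars []       d = d
  ∀⃗E-vars (τ ∷ Ts) d = ∀E-vz (∀⃗E-vars Ts d)

  ∀⃗E : (Ts : List Ty) {A : Fm (Ts ++ Γ)} → Ps ⊢ ∀⃗ Ts A → (as : Tms Γ Ts) → Ps ⊢ subF (as ++ˢ var) A
  ∀⃗E []       {A} d []       = ⊢-cast (trans (sym (subF-id A)) (subF-cong (λ _ → refl) A)) d
  ∀⃗E (τ ∷ Ts) {A} d (a ∷ as) =
    ⊢-cast (trans (subF-∘ (single a) (liftS (as ++ˢ var)) A) (subF-cong (single-∘S-liftS (as ++ˢ var) a) A)) (∀E (∀⃗E Ts d as) a)

module Realizability (L : Signature) where
  open Logic L
  open Substitution L
  open Tuples L

  HrTy : Fm Γ → List Ty
  HrTy ⊥'               = []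
  HrTy (a ≐ b)          = []
  HrTy (a ∈' b)         = []
  HrTy (rel R ts)       = []
  HrTy (A ∨' B)         = HrTy A ++ HrTy B
  HrTy (A ∧' B)         = HrTy A ++ HrTy B
  HrTy (A ⇒' B)         = HrTy A ⇉ HrTy B
  HrTy (∀' σ A)         = (σ ∷ []) ⇉ HrTy A
  HrTy (∃' σ A)         = σ * ∷ HrTy A
  HrTy (∀∈ {σ = σ} t A) = (σ ∷ []) ⇉ HrTy A
  HrTy (∃∈ t A)         = HrTy A

  hr : (A : Fm Γ) → Sub Γ Δ → Tms Δ (HrTy A) → Fm Δ
  hr ⊥'         γ _        = ⊥'
  hr (a ≐ b)    γ _        = subT γ a ≐ subT γ b
  hr (a ∈' b)   γ _        = subT γ a ∈' subT γ b
  hr (rel R ts) γ _        = rel R (Vec.map (subT γ) ts)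
  hr (A ∨' B)   γ as       = hr A γ (++⁻ˡ (HrTy A) as) ∨' hr B γ (++⁻ʳ (HrTy A) as)
  hr (A ∧' B)   γ as       = hr A γ (++⁻ˡ (HrTy A) as) ∧' hr B γ (++⁻ʳ (HrTy A) as)
  hr (A ⇒' B)   γ fs       = ∀⃗ X (hr A (wkS* X γ) (vars X) ⇒' hr B (wkS* X γ) (wkTs* X fs ·ₜ vars X))
    where X = HrTy A
  hr (∀' σ A)   γ fs       = ∀' σ (hr A (liftS γ) (wkTs fs ·ₜ (var vz ∷ [])))
  hr (∃' σ A)   γ (w ∷ as) = ∃∈ w (hr A (liftS γ) (wkTs as))
  hr (∀∈ t A)   γ fs       = ∀∈ (subT γ t) (hr A (liftS γ) (wkTs fs ·ₜ (var vz ∷ [])))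
  hr (∃∈ t A)   γ as       = ∃∈ (subT γ t) (hr A (liftS γ) (wkTs as))

  hr-cong : (A : Fm Γ) {γ γ′ : Sub Γ Δ} → γ ≗S γ′ → (as : Tms Δ (HrTy A)) → hr A γ as ≡ hr A γ′ as
  hr-cong ⊥'         e as       = refl
  hr-cong (a ≐ b)    e as       = cong₂ _≐_ (subT-cong e a) (subT-cong e b)
  hr-cong (a ∈' b)   e as       = cong₂ _∈'_ (subT-cong e a) (subT-cong e b)
  hr-cong (rel R ts) e as       = cong (rel R) (VecP.map-cong (subT-cong e) ts)
  hr-cong (A ∨' B)   e as       = cong₂ _∨'_ (hr-cong A e _) (hr-cong B e _)
  hr-cong (A ∧' B)   e as       = cong₂ _∧'_ (hr-cong A e _) (hr-cong B e _)
  hr-cong (A ⇒' B)   e as       = cong (∀⃗ (HrTy A)) (cong₂ _⇒'_ (hr-cong A (cong (wkT* _) ∘ e) _) (hr-cong B (cong (wkT* _) ∘ e) _))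
  hr-cong (∀' σ A)   e as       = cong (∀' σ) (hr-cong A (liftS-cong e) _)
  hr-cong (∃' σ A)   e (w ∷ as) = cong (∃∈ w) (hr-cong A (liftS-cong e) _)
  hr-cong (∀∈ t A)   e as       = cong₂ ∀∈ (subT-cong e t) (hr-cong A (liftS-cong e) _)
  hr-cong (∃∈ t A)   e as       = cong₂ ∃∈ (subT-cong e t) (hr-cong A (liftS-cong e) _)

  subF-hr : (s : Sub Δ Θ) (A : Fm Γ) (γ : Sub Γ Δ) (as : Tms Δ (HrTy A)) → subF s (hr A γ as) ≡ hr A (s ∘S γ) (subTs s as)
  subF-hr-·vz : (s : Sub Δ Θ) (A : Fm (σ ∷ Γ)) (γ : Sub Γ Δ) (fs : Tms Δ ((σ ∷ []) ⇉ HrTy A)) →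
                subF (liftS s) (hr A (liftS γ) (wkTs fs ·ₜ (var vz ∷ []))) ≡ hr A (liftS (s ∘S γ)) (wkTs (subTs s fs) ·ₜ (var vz ∷ []))

  subF-hr s ⊥'         γ as = refl
  subF-hr s (a ≐ b)    γ as = cong₂ _≐_ (subT-∘ s γ a) (subT-∘ s γ b)
  subF-hr s (a ∈' b)   γ as = cong₂ _∈'_ (subT-∘ s γ a) (subT-∘ s γ b)
  subF-hr s (rel R ts) γ as = cong (rel R) (trans (sym (VecP.map-∘ (subT s) (subT γ) ts)) (VecP.map-cong (subT-∘ s γ) ts))
  subF-hr s (A ∨' B)   γ as =
    cong₂ _∨'_ (trans (subF-hr s A γ _) (cong (hr A _) (map-++⁻ˡ (subT s) (HrTy A) as)))
               (trans (subF-hr s B γ _) (cong (hr B _) (map-++⁻ʳ (subT s) (HrTy A) as)))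
  subF-hr s (A ∧' B)   γ as =
    cong₂ _∧'_ (trans (subF-hr s A γ _) (cong (hr A _) (map-++⁻ˡ (subT s) (HrTy A) as)))
               (trans (subF-hr s B γ _) (cong (hr B _) (map-++⁻ʳ (subT s) (HrTy A) as)))
  subF-hr s (A ⇒' B)   γ fs = trans (subF-∀⃗ s X _) (cong (∀⃗ X) (cong₂ _⇒'_ premise conclusion))
    where
    X  = HrTy A
    s* = liftS* X s
    wkS*-∘S : s* ∘S wkS* X γ ≗S wkS* X (s ∘S γ)
    wkS*-∘S x = subT-liftS*-wkT* s X (γ x)
    premise : subF s* (hr A (wkS* X γ) (vars X)) ≡ hr A (wkS* X (s ∘S γ)) (vars X)
    premise = trans (subF-hr s* A (wkS* X γ) (vars X)) (trans (hr-cong A wkS*-∘S _) (cong (hr A _) (subTs-liftS*-vars s X)))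
    conclusion : subF s* (hr B (wkS* X γ) (wkTs* X fs ·ₜ vars X)) ≡ hr B (wkS* X (s ∘S γ)) (wkTs* X (subTs s fs) ·ₜ vars X)
    conclusion = begin
      subF s* (hr B (wkS* X γ) (wkTs* X fs ·ₜ vars X))              ≡⟨ subF-hr s* B (wkS* X γ) _ ⟩
      hr B (s* ∘S wkS* X γ) (subTs s* (wkTs* X fs ·ₜ vars X))        ≡⟨ hr-cong B wkS*-∘S _ ⟩
      hr B (wkS* X (s ∘S γ)) (subTs s* (wkTs* X fs ·ₜ vars X))       ≡⟨ cong (hr B _) (subTs-·ₜ s* (wkTs* X fs) (vars X)) ⟩
      hr B (wkS* X (s ∘S γ)) (subTs s* (wkTs* X fs) ·ₜ subTs s* (vars X))
        ≡⟨ cong (hr B _) (cong₂ _·ₜ_ (subTs-liftS*-wkTs* s X fs) (subTs-liftS*-vars s X)) ⟩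
      hr B (wkS* X (s ∘S γ)) (wkTs* X (subTs s fs) ·ₜ vars X)        ∎
      where open ≡-Reasoning
  subF-hr s (∀' σ A)   γ fs = cong (∀' σ) (subF-hr-·vz s A γ fs)
  subF-hr s (∃' σ A)   γ (w ∷ as) =
    cong (∃∈ (subT s w)) (trans (subF-hr (liftS s) A (liftS γ) _) (trans (hr-cong A (liftS-∘S s γ) _) (cong (hr A _) (subTs-liftS-wkTs s as))))
  subF-hr s (∀∈ t A)   γ fs = cong₂ ∀∈ (subT-∘ s γ t) (subF-hr-·vz s A γ fs)
  subF-hr s (∃∈ t A)   γ as =
    cong₂ ∃∈ (subT-∘ s γ t) (trans (subF-hr (liftS s) A (liftS γ) _) (trans (hr-cong A (liftS-∘S s γ) _) (cong (hr A _) (subTs-liftS-wkTs s as))))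

  subF-hr-·vz s A γ fs = begin
    subF (liftS s) (hr A (liftS γ) (wkTs fs ·ₜ (var vz ∷ [])))                ≡⟨ subF-hr (liftS s) A (liftS γ) _ ⟩
    hr A (liftS s ∘S liftS γ) (subTs (liftS s) (wkTs fs ·ₜ (var vz ∷ [])))    ≡⟨ hr-cong A (liftS-∘S s γ) _ ⟩
    hr A (liftS (s ∘S γ)) (subTs (liftS s) (wkTs fs ·ₜ (var vz ∷ [])))        ≡⟨ cong (hr A _) (subTs-·ₜ (liftS s) (wkTs fs) _) ⟩
    hr A (liftS (s ∘S γ)) (subTs (liftS s) (wkTs fs) ·ₜ (var vz ∷ []))        ≡⟨ cong (λ gs → hr A _ (gs ·ₜ _)) (subTs-liftS-wkTs s fs) ⟩
    hr A (liftS (s ∘S γ)) (wkTs (subTs s fs) ·ₜ (var vz ∷ []))                ∎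
    where open ≡-Reasoning

  HrTy-subF : (s : Sub Γ Δ) (A : Fm Γ) → HrTy (subF s A) ≡ HrTy A
  HrTy-subF s ⊥'         = refl
  HrTy-subF s (a ≐ b)    = refl
  HrTy-subF s (a ∈' b)   = refl
  HrTy-subF s (rel R ts) = refl
  HrTy-subF s (A ∨' B)   = cong₂ _++_ (HrTy-subF s A) (HrTy-subF s B)
  HrTy-subF s (A ∧' B)   = cong₂ _++_ (HrTy-subF s A) (HrTy-subF s B)
  HrTy-subF s (A ⇒' B)   = cong₂ _⇉_ (HrTy-subF s A) (HrTy-subF s B)
  HrTy-subF s (∀' σ A)   = cong ((σ ∷ []) ⇉_) (HrTy-subF (liftS s) A)
  HrTy-subF s (∃' σ A)   = cong (σ * ∷_) (HrTy-subF (liftS s) A)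
  HrTy-subF s (∀∈ {σ = σ} t A) = cong ((σ ∷ []) ⇉_) (HrTy-subF (liftS s) A)
  HrTy-subF s (∃∈ t A)   = HrTy-subF (liftS s) A

  -- The implication case of hr-subF, with the realizer types abstracted so that the casts can be matched away.
  hr-⇒-castT : (A B : Fm Γ) (s : Sub Γ Θ) (γ : Sub Θ Δ) (p : Ts ≡ HrTy A) (q : Us ≡ HrTy B) (r : Ts ⇉ Us ≡ HrTy A ⇉ HrTy B)
               (fs : Tms Δ (Ts ⇉ Us)) →
               ∀⃗ Ts (hr A (wkS* Ts γ ∘S s) (castT p (vars Ts)) ⇒' hr B (wkS* Ts γ ∘S s) (castT q (wkTs* Ts fs ·ₜ vars Ts)))
               ≡ hr (A ⇒' B) (γ ∘S s) (castT r fs)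
  hr-⇒-castT {Ts = .(HrTy A)} A B s γ refl refl refl fs =
    cong (∀⃗ (HrTy A)) (cong₂ _⇒'_ (hr-cong A (λ x → subT-wkS* (HrTy A) γ (s x)) _) (hr-cong B (λ x → subT-wkS* (HrTy A) γ (s x)) _))

  hr-subF : (s : Sub Γ Θ) (A : Fm Γ) (γ : Sub Θ Δ) (as : Tms Δ (HrTy (subF s A))) →
            hr (subF s A) γ as ≡ hr A (γ ∘S s) (castT (HrTy-subF s A) as)
  hr-subF s ⊥'         γ as = refl
  hr-subF s (a ≐ b)    γ as = cong₂ _≐_ (subT-∘ γ s a) (subT-∘ γ s b)
  hr-subF s (a ∈' b)   γ as = cong₂ _∈'_ (subT-∘ γ s a) (subT-∘ γ s b)
  hr-subF s (rel R ts) γ as = cong (rel R) (trans (sym (VecP.map-∘ (subT γ) (subT s) ts)) (VecP.map-cong (subT-∘ γ s) ts))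
  hr-subF s (A ∨' B)   γ as =
    cong₂ _∨'_ (trans (hr-subF s A γ _) (cong (hr A _) (castT-++⁻ˡ (HrTy-subF s A) (HrTy-subF s B) (HrTy-subF s (A ∨' B)) as)))
               (trans (hr-subF s B γ _) (cong (hr B _) (castT-++⁻ʳ (HrTy-subF s A) (HrTy-subF s B) (HrTy-subF s (A ∨' B)) as)))
  hr-subF s (A ∧' B)   γ as =
    cong₂ _∧'_ (trans (hr-subF s A γ _) (cong (hr A _) (castT-++⁻ˡ (HrTy-subF s A) (HrTy-subF s B) (HrTy-subF s (A ∧' B)) as)))
               (trans (hr-subF s B γ _) (cong (hr B _) (castT-++⁻ʳ (HrTy-subF s A) (HrTy-subF s B) (HrTy-subF s (A ∧' B)) as)))
  hr-subF s (A ⇒' B)   γ fs =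
    trans (cong (∀⃗ X) (cong₂ _⇒'_ (hr-subF s A (wkS* X γ) (vars X)) (hr-subF s B (wkS* X γ) _)))
          (hr-⇒-castT A B s γ (HrTy-subF s A) (HrTy-subF s B) (HrTy-subF s (A ⇒' B)) fs)
    where X = HrTy (subF s A)
  hr-subF s (∀' σ A)   γ fs =
    cong (∀' σ) (trans (hr-subF (liftS s) A (liftS γ) _)
                (trans (hr-cong A (liftS-∘S γ s) _) (cong (hr A _) (castT-wkTs-·vz (HrTy-subF (liftS s) A) (HrTy-subF s (∀' σ A)) fs))))
  hr-subF s (∃' σ A)   γ (w ∷ as) =
    trans (cong (∃∈ w) (trans (hr-subF (liftS s) A (liftS γ) _)
                       (trans (hr-cong A (liftS-∘S γ s) _) (cong (hr A _) (sym (map-castT wkT (HrTy-subF (liftS s) A) as))))))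
          (cong (hr (∃' σ A) (γ ∘S s)) (sym (castT-∷ (HrTy-subF (liftS s) A) (HrTy-subF s (∃' σ A)) w as)))
  hr-subF s (∀∈ t A)   γ fs =
    cong₂ ∀∈ (subT-∘ γ s t) (trans (hr-subF (liftS s) A (liftS γ) _)
                            (trans (hr-cong A (liftS-∘S γ s) _) (cong (hr A _) (castT-wkTs-·vz (HrTy-subF (liftS s) A) (HrTy-subF s (∀∈ t A)) fs))))
  hr-subF s (∃∈ t A)   γ as =
    cong₂ ∃∈ (subT-∘ γ s t) (trans (hr-subF (liftS s) A (liftS γ) _)
                            (trans (hr-cong A (liftS-∘S γ s) _) (cong (hr A _) (sym (map-castT wkT (HrTy-subF (liftS s) A) as)))))

  HrTy-renF : (r : Ren Γ Θ) (A : Fm Γ) → HrTy (renF r A) ≡ HrTy A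
  HrTy-renF r A = trans (cong HrTy (renF≡subF r A)) (HrTy-subF (var ∘SR r) A)

  hr-≡ : {A B : Fm Γ} (p : A ≡ B) (γ : Sub Γ Δ) (as : Tms Δ (HrTy A)) → hr A γ as ≡ hr B γ (castT (cong HrTy p) as)
  hr-≡ refl γ as = refl

  hr-renF : (r : Ren Γ Θ) (A : Fm Γ) (γ : Sub Θ Δ) (as : Tms Δ (HrTy (renF r A))) →
            hr (renF r A) γ as ≡ hr A (γ ∘SR r) (castT (HrTy-renF r A) as)
  hr-renF r A γ as =
    trans (hr-≡ (renF≡subF r A) γ as)
          (trans (hr-subF (var ∘SR r) A γ _) (cong (hr A _) (subst-subst (cong HrTy (renF≡subF r A)))))

  hr-liftS-[] : (A : Fm (σ ∷ Γ)) (γ : Sub Γ Δ) (u : Tm Δ σ) (as : Tms (σ ∷ Δ) (HrTy A)) →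
                hr A (liftS γ) as [ u ] ≡ hr A (γ ▸ u) (subTs (single u) as)
  hr-liftS-[] A γ u as = trans (subF-hr (single u) A (liftS γ) as) (hr-cong A (single-∘S-liftS γ u) _)

  hr-[] : (A : Fm (σ ∷ Γ)) (t : Tm Γ σ) (γ : Sub Γ Δ) (as : Tms Δ (HrTy (A [ t ]))) →
          hr (A [ t ]) γ as ≡ hr A (γ ▸ subT γ t) (castT (HrTy-subF (single t) A) as)
  hr-[] A t γ as = trans (hr-subF (single t) A γ as) (hr-cong A (∘S-single γ t) _)

  wkF-hr : (A : Fm Γ) (γ : Sub Γ Δ) (as : Tms Δ (HrTy A)) → wkF {τ = σ} (hr A γ as) ≡ hr A (vs ∘RS γ) (wkTs as)
  wkF-hr A γ as =
    trans (renF≡subF vs _)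
          (trans (subF-hr (var ∘SR vs) A γ as) (trans (hr-cong A (λ x → sym (renT≡subT vs (γ x))) _) (cong (hr A _) (sym (wkTs≡subTs as)))))

  wkF*-hr : (Xs : List Ty) (A : Fm Γ) (γ : Sub Γ Δ) (as : Tms Δ (HrTy A)) → wkF* Xs (hr A γ as) ≡ hr A (wkS* Xs γ) (wkTs* Xs as)
  wkF*-hr []       A γ as = trans (hr-cong A (λ _ → refl) as) (cong (hr A _) (sym (map-id as)))
  wkF*-hr (σ ∷ Xs) A γ as =
    trans (cong wkF (wkF*-hr Xs A γ as)) (trans (wkF-hr A _ _) (cong (hr A _) (map-∘ as)))

  subF-++ˢ-hr : (Xs : List Ty) (as : Tms Δ Xs) (A : Fm Γ) (γ : Sub Γ Δ) (bs : Tms (Xs ++ Δ) (HrTy A)) →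
                subF (as ++ˢ var) (hr A (wkS* Xs γ) bs) ≡ hr A γ (subTs (as ++ˢ var) bs)
  subF-++ˢ-hr Xs as A γ bs = trans (subF-hr (as ++ˢ var) A (wkS* Xs γ) bs) (hr-cong A (++ˢ-∘S-wkS* Xs as γ) _)

module RealizabilityRules (L : Signature) (T : Logic.Fm L [] → Set) where
  open Logic L hiding (_⊢_)
  open Substitution L
  open Derivations L T
  open Tuples L
  open Combinators L T
  open Realizability L

  hr-≐ₜ : (A : Fm Γ) (γ : Sub Γ Δ) {as bs : Tms Δ (HrTy A)} → Ps ⊢ as ≐ₜ bs → Ps ⊢ hr A γ as → Ps ⊢ hr A γ bs
  hr-≐ₜ ⊥'         γ e d = d
  hr-≐ₜ (a ≐ b)    γ e d = d
  hr-≐ₜ (a ∈' b)   γ e d = d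
  hr-≐ₜ (rel R ts) γ e d = d
  hr-≐ₜ (A ∨' B)   γ e d =
    ∨E d (∨I₁ (hr-≐ₜ A γ (Pointwise-mono ⊢-weaken (Pointwise-++⁻ˡ (HrTy A) e)) (hyp here)))
         (∨I₂ (hr-≐ₜ B γ (Pointwise-mono ⊢-weaken (Pointwise-++⁻ʳ (HrTy A) e)) (hyp here)))
  hr-≐ₜ (A ∧' B)   γ e d = ∧I (hr-≐ₜ A γ (Pointwise-++⁻ˡ (HrTy A) e) (∧E₁ d)) (hr-≐ₜ B γ (Pointwise-++⁻ʳ (HrTy A) e) (∧E₂ d))
  hr-≐ₜ (A ⇒' B)   γ e d =
    ∀⃗I X (⇒I (hr-≐ₜ B (wkS* X γ) (Pointwise-mono ⊢-weaken (·ₜ-congˡ (≐ₜ-wkF* X e) (vars X)))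
                     (⇒E (⊢-weaken (∀⃗E-vars X d)) (hyp here))))
    where X = HrTy A
  hr-≐ₜ (∀' σ A)   γ e d = ∀I (hr-≐ₜ A (liftS γ) (·ₜ-congˡ (≐ₜ-wkF e) (var vz ∷ [])) (∀E-vz d))
  hr-≐ₜ (∃' σ A)   γ {w ∷ as} {w′ ∷ bs} (e ∷ es) d =
    ∃∈E d (∃∈I-vz (∈-congʳ (⊢-weaken (⊢-weaken (⊢-wkF e))) (hyp (there here)))
                  (hr-≐ₜ A (liftS γ) (Pointwise-mono (⊢-weaken ∘ ⊢-weaken) (≐ₜ-wkF es)) (hyp here)))
  hr-≐ₜ (∀∈ t A)   γ e d = ∀∈I (hr-≐ₜ A (liftS γ) (Pointwise-mono ⊢-weaken (·ₜ-congˡ (≐ₜ-wkF e) (var vz ∷ []))) (∀∈E-vz d))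
  hr-≐ₜ (∃∈ t A)   γ e d =
    ∃∈E d (∃∈I-vz (hyp (there here)) (hr-≐ₜ A (liftS γ) (Pointwise-mono (⊢-weaken ∘ ⊢-weaken) (≐ₜ-wkF e)) (hyp here)))

  hr-⇒E : (A B : Fm Γ) (γ : Sub Γ Δ) (fs : Tms Δ (HrTy (A ⇒' B))) (as : Tms Δ (HrTy A)) →
          Ps ⊢ hr (A ⇒' B) γ fs → Ps ⊢ hr A γ as → Ps ⊢ hr B γ (fs ·ₜ as)
  hr-⇒E A B γ fs as d = ⇒E (⊢-cast (cong₂ _⇒'_ premise conclusion) (∀⃗E X d as))
    where
    X = HrTy A
    premise : subF (as ++ˢ var) (hr A (wkS* X γ) (vars X)) ≡ hr A γ as
    premise = trans (subF-++ˢ-hr X as A γ _) (cong (hr A γ) (subTs-++ˢ-vars X as var))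
    conclusion : subF (as ++ˢ var) (hr B (wkS* X γ) (wkTs* X fs ·ₜ vars X)) ≡ hr B γ (fs ·ₜ as)
    conclusion = trans (subF-++ˢ-hr X as B γ _) (cong (hr B γ) (trans (subTs-·ₜ (as ++ˢ var) _ _)
                   (cong₂ _·ₜ_ (trans (subTs-++ˢ-wkTs* X as var fs) (subTs-id fs)) (subTs-++ˢ-vars X as var))))

  hr-⇒I : (A B : Fm Γ) (γ : Sub Γ Δ) (δ : Sub Θ Δ) (es : Tms (HrTy A ++ Θ) (HrTy B)) →
          let X = HrTy A in
          hr A (wkS* X γ) (vars X) ∷ wkPs X Ps ⊢ hr B (wkS* X γ) (subTs (vars X ++ˢ wkS* X δ) es) →
          Ps ⊢ hr (A ⇒' B) γ (subTs δ (ƛₜ X es))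
  hr-⇒I A B γ δ es d = ∀⃗I X (⇒I (hr-≐ₜ B _ (≐ₜ-sym β) d))
    where
    X = HrTy A
    β : _ ⊢ wkTs* X (subTs δ (ƛₜ X es)) ·ₜ vars X ≐ₜ subTs (vars X ++ˢ wkS* X δ) es
    β = ≐ₜ-trans (≡⇒≐ₜ (cong (_·ₜ vars X) (sym (subTs-wkS* X δ (ƛₜ X es))))) (ƛₜ-β (wkS* X δ) X es (vars X))

  ExFree⇒hr : {A : Fm Γ} → ExFree A → (γ : Sub Γ Δ) (as : Tms Δ (HrTy A)) → Ps ⊢ subF γ A → Ps ⊢ hr A γ as
  hr-⇒-ExFree : (A B : Fm Γ) → ExFree A → (γ : Sub Γ Δ) (fs : Tms Δ (HrTy (A ⇒' B))) →
                Ps ⊢ hr (A ⇒' B) γ fs → Ps ⊢ subF γ A → Ps ⊢ hr B γ (fs ·ₜ dummies (HrTy A))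
  hr⇒ExFree : {A : Fm Γ} → ExFree A → (γ : Sub Γ Δ) (as : Tms Δ (HrTy A)) → Ps ⊢ hr A γ as → Ps ⊢ subF γ A

  ExFree⇒hr (ef-at at⊥)   γ as d = d
  ExFree⇒hr (ef-at at≐)   γ as d = d
  ExFree⇒hr (ef-at at∈)   γ as d = d
  ExFree⇒hr (ef-at atrel) γ as d = d
  ExFree⇒hr (ef-∨ a b)    γ as d = ∨E d (∨I₁ (ExFree⇒hr a γ _ (hyp here))) (∨I₂ (ExFree⇒hr b γ _ (hyp here)))
  ExFree⇒hr (ef-∧ a b)    γ as d = ∧I (ExFree⇒hr a γ _ (∧E₁ d)) (ExFree⇒hr b γ _ (∧E₂ d))
  ExFree⇒hr (ef-⇒ {A = A} {B} a b) γ fs d =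
    ∀⃗I X (⇒I (ExFree⇒hr b (wkS* X γ) _ (⇒E (⊢-weaken (⊢-cast (sym (subF-wkS* X γ (A ⇒' B))) (⊢-wkF* X d)))
                                            (hr⇒ExFree a (wkS* X γ) (vars X) (hyp here)))))
    where X = HrTy A
  ExFree⇒hr (ef-∀ a)      γ fs d = ∀I (ExFree⇒hr a (liftS γ) _ (∀E-vz d))
  ExFree⇒hr (ef-∀∈ a)     γ fs d = ∀∈I (ExFree⇒hr a (liftS γ) _ (∀∈E-vz d))
  ExFree⇒hr (ef-∃∈ a)     γ as d = ∃∈E d (∃∈I-vz (hyp (there here)) (ExFree⇒hr a (liftS γ) (wkTs as) (hyp here)))

  hr⇒ExFree (ef-at at⊥)   γ as d = d
  hr⇒ExFree (ef-at at≐)   γ as d = d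
  hr⇒ExFree (ef-at at∈)   γ as d = d
  hr⇒ExFree (ef-at atrel) γ as d = d
  hr⇒ExFree (ef-∨ a b)    γ as d = ∨E d (∨I₁ (hr⇒ExFree a γ _ (hyp here))) (∨I₂ (hr⇒ExFree b γ _ (hyp here)))
  hr⇒ExFree (ef-∧ a b)    γ as d = ∧I (hr⇒ExFree a γ _ (∧E₁ d)) (hr⇒ExFree b γ _ (∧E₂ d))
  hr⇒ExFree (ef-⇒ {A = A} {B} a b) γ fs d = ⇒I (hr⇒ExFree b γ _ (hr-⇒-ExFree A B a γ fs (⊢-weaken d) (hyp here)))
  hr⇒ExFree (ef-∀ a)      γ fs d = ∀I (hr⇒ExFree a (liftS γ) _ (∀E-vz d))
  hr⇒ExFree (ef-∀∈ a)     γ fs d = ∀∈I (hr⇒ExFree a (liftS γ) _ (∀∈E-vz d))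
  hr⇒ExFree (ef-∃∈ a)     γ as d = ∃∈E d (∃∈I-vz (hyp (there here)) (hr⇒ExFree a (liftS γ) (wkTs as) (hyp here)))

  hr-⇒-ExFree A B ef γ fs d a = hr-⇒E A B γ fs (dummies (HrTy A)) d (ExFree⇒hr ef γ (dummies (HrTy A)) a)

  hr-∃⇒∃∈ : {A : Fm (σ ∷ Γ)} → ExFree A → (γ : Sub Γ Δ) (w : Tm Δ (σ *)) (as : Tms Δ (HrTy A)) →
            Ps ⊢ hr (∃' σ A) γ (w ∷ as) → Ps ⊢ ∃∈ w (subF (liftS γ) A)
  hr-∃⇒∃∈ ef γ w as d = ∃∈E d (∃∈I-vz (hyp (there here)) (hr⇒ExFree ef (liftS γ) (wkTs as) (hyp here)))

module Majorants (L : Signature) (T : Logic.Fm L [] → Set) where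
  open Logic L hiding (_⊢_)
  open Substitution L
  open Derivations L T
  open Tuples L
  open Combinators L T
  open Realizability L

  infix 20 _⊑_
  _⊑_ : Tm Γ τ → Tm Γ τ → Fm Γ
  -- Only set-typed realizer components act as bounds, so ground terms need not be compared.
  _⊑_ {τ = G}     a b = ⊥' ⇒' ⊥'
  _⊑_ {τ = σ ⇒ τ} f g = ∀' σ (wkT f · var vz ⊑ wkT g · var vz)
  _⊑_ {τ = σ *}   a b = ∀∈ a (var vz ∈' wkT b)

  subF-⊑ : (s : Sub Γ Δ) (a b : Tm Γ τ) → subF s (a ⊑ b) ≡ subT s a ⊑ subT s b
  subF-⊑ {τ = G}     s a b = refl
  subF-⊑ {τ = σ ⇒ τ} s f g =
    cong (∀' σ) (trans (subF-⊑ (liftS s) _ _) (cong₂ _⊑_ (cong (_· var vz) (subT-liftS-wkT s f)) (cong (_· var vz) (subT-liftS-wkT s g))))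
  subF-⊑ {τ = σ *}   s a b = cong (∀∈ (subT s a)) (cong (var vz ∈'_) (subT-liftS-wkT s b))

  wkF-⊑ : (a b : Tm Γ τ) → wkF {τ = σ} (a ⊑ b) ≡ wkT a ⊑ wkT b
  wkF-⊑ a b = trans (renF≡subF vs _) (trans (subF-⊑ (var ∘SR vs) a b) (cong₂ _⊑_ (sym (renT≡subT vs a)) (sym (renT≡subT vs b))))

  ⊑-≐ʳ : {a b b′ : Tm Γ τ} → Ps ⊢ a ⊑ b → Ps ⊢ b ≐ b′ → Ps ⊢ a ⊑ b′
  ⊑-≐ʳ {a = a} {b} {b′} d e = ⊢-cast (instantiate b′) (≐-subst (wkT a ⊑ var vz) e (⊢-cast (sym (instantiate b)) d))
    where
    instantiate : ∀ c → (wkT a ⊑ var vz) [ c ] ≡ a ⊑ c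
    instantiate c = trans (subF-⊑ (single c) (wkT a) (var vz)) (cong (_⊑ c) (subT-single-wkT c a))

  ⊑-≐ˡ : {a a′ b : Tm Γ τ} → Ps ⊢ a ⊑ b → Ps ⊢ a ≐ a′ → Ps ⊢ a′ ⊑ b
  ⊑-≐ˡ {a = a} {a′} {b} d e = ⊢-cast (instantiate a′) (≐-subst (var vz ⊑ wkT b) e (⊢-cast (sym (instantiate a)) d))
    where
    instantiate : ∀ c → (var vz ⊑ wkT b) [ c ] ≡ c ⊑ b
    instantiate c = trans (subF-⊑ (single c) (var vz) (wkT b)) (cong (c ⊑_) (subT-single-wkT c b))

  infix 4 _⊢_⊑ₜ_
  _⊢_⊑ₜ_ : List (Fm Γ) → Tms Γ Ts → Tms Γ Ts → Set
  Ps ⊢ as ⊑ₜ bs = Pointwise (λ a b → Ps ⊢ a ⊑ b) as bs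

  ⊑ₜ-wkF : {as bs : Tms Γ Ts} → Ps ⊢ as ⊑ₜ bs → map (wkF {τ = σ}) Ps ⊢ wkTs as ⊑ₜ wkTs bs
  ⊑ₜ-wkF = Pointwise-map (λ {_} {a} {b} e → ⊢-cast (wkF-⊑ a b) (⊢-wkF e))

  ⊑-·⃗-vars : (Ts : List Ty) {f g : Tm Γ (Ts ⇒⃗ τ)} → Ps ⊢ f ⊑ g → wkPs Ts Ps ⊢ wkT* Ts f ·⃗ vars Ts ⊑ wkT* Ts g ·⃗ vars Ts
  ⊑-·⃗-vars []           d = d
  ⊑-·⃗-vars {τ = τ} (σ ∷ Ts) {f} {g} d =
    ⊢-cast (cong₂ (λ f′ g′ → f′ · var vz ⊑ g′ · var vz) (wkT-·⃗ (wkT* Ts f) (vars Ts)) (wkT-·⃗ (wkT* Ts g) (vars Ts)))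
           (∀E-vz (⊑-·⃗-vars Ts d))

  ⊑ₜ-·ₜ-vars : (Ts : List Ty) {fs gs : Tms Γ (Ts ⇉ Us)} → Ps ⊢ fs ⊑ₜ gs →
               wkPs Ts Ps ⊢ wkTs* Ts fs ·ₜ vars Ts ⊑ₜ wkTs* Ts gs ·ₜ vars Ts
  ⊑ₜ-·ₜ-vars {Us = []}     Ts []       = []
  ⊑ₜ-·ₜ-vars {Us = U ∷ Us} Ts (d ∷ ds) = ⊑-·⃗-vars Ts d ∷ ⊑ₜ-·ₜ-vars Ts ds

  hr-⊑ₜ : (A : Fm Γ) (γ : Sub Γ Δ) {as bs : Tms Δ (HrTy A)} → Ps ⊢ as ⊑ₜ bs → Ps ⊢ hr A γ as → Ps ⊢ hr A γ bs
  hr-⊑ₜ ⊥'         γ e d = d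
  hr-⊑ₜ (a ≐ b)    γ e d = d
  hr-⊑ₜ (a ∈' b)   γ e d = d
  hr-⊑ₜ (rel R ts) γ e d = d
  hr-⊑ₜ (A ∨' B)   γ e d =
    ∨E d (∨I₁ (hr-⊑ₜ A γ (Pointwise-mono ⊢-weaken (Pointwise-++⁻ˡ (HrTy A) e)) (hyp here)))
         (∨I₂ (hr-⊑ₜ B γ (Pointwise-mono ⊢-weaken (Pointwise-++⁻ʳ (HrTy A) e)) (hyp here)))
  hr-⊑ₜ (A ∧' B)   γ e d = ∧I (hr-⊑ₜ A γ (Pointwise-++⁻ˡ (HrTy A) e) (∧E₁ d)) (hr-⊑ₜ B γ (Pointwise-++⁻ʳ (HrTy A) e) (∧E₂ d))
  hr-⊑ₜ (A ⇒' B)   γ e d =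
    ∀⃗I X (⇒I (hr-⊑ₜ B (wkS* X γ) (Pointwise-mono ⊢-weaken (⊑ₜ-·ₜ-vars X e)) (⇒E (⊢-weaken (∀⃗E-vars X d)) (hyp here))))
    where X = HrTy A
  hr-⊑ₜ (∀' σ A)   γ e d = ∀I (hr-⊑ₜ A (liftS γ) (⊑ₜ-·ₜ-vars (σ ∷ []) e) (∀E-vz d))
  hr-⊑ₜ (∃' σ A)   γ {w ∷ as} {w′ ∷ bs} (e ∷ es) d =
    ∃∈E d (∃∈I-vz vz∈w′ (hr-⊑ₜ A (liftS γ) (Pointwise-mono (⊢-weaken ∘ ⊢-weaken) (⊑ₜ-wkF es)) (hyp here)))
    where
    vz∈w′ = ⊢-cast (cong (var vz ∈'_) (renT-liftR-vs-[vz] (wkT w′))) (∀∈E (⊢-weaken (⊢-weaken (⊢-wkF e))) (var vz) (hyp (there here)))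
  hr-⊑ₜ (∀∈ t A)   γ e d = ∀∈I (hr-⊑ₜ A (liftS γ) (Pointwise-mono ⊢-weaken (⊑ₜ-·ₜ-vars (_ ∷ []) e)) (∀∈E-vz d))
  hr-⊑ₜ (∃∈ t A)   γ e d =
    ∃∈E d (∃∈I-vz (hyp (there here)) (hr-⊑ₜ A (liftS γ) (Pointwise-mono (⊢-weaken ∘ ⊢-weaken) (⊑ₜ-wkF e)) (hyp here)))

  -- join (σ ⇒ τ) is λ f g x → join τ (f x) (g x), written with combinators.
  join : (τ : Ty) → Tm Γ (τ ⇒ τ ⇒ τ)
  join G       = Πc
  join (σ *)   = cup
  join (σ ⇒ τ) = Σc · (Πc · Σc) · (Σc · (Πc · join τ))

  subT-join : (s : Sub Γ Δ) (τ : Ty) → subT s (join τ) ≡ join τ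
  subT-join s G       = refl
  subT-join s (σ *)   = refl
  subT-join s (σ ⇒ τ) = cong (λ j → Σc · (Πc · Σc) · (Σc · (Πc · j))) (subT-join s τ)

  wkT-join : (τ : Ty) → wkT {τ = σ} (join {Γ = Γ} τ) ≡ join τ
  wkT-join τ = trans (renT≡subT vs (join τ)) (subT-join _ τ)

  join-β : (f g : Tm Γ (σ ⇒ τ)) (x : Tm Γ σ) → Ps ⊢ join (σ ⇒ τ) · f · g · x ≐ join τ · (f · x) · (g · x)
  join-β {τ = τ} f g x =
    ≐-trans (·-cong (·-cong unfold-f (≐-refl g)) (≐-refl x)) (≐-trans (axiom (ax-Σ _ g x)) (·-cong unfold-x (≐-refl (g · x))))
    where
    unfold-f = ≐-trans (axiom (ax-Σ (Πc · Σc) (Σc · (Πc · join τ)) f)) (·-cong (axiom (ax-Π Σc f)) (≐-refl _))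
    unfold-x = ≐-trans (axiom (ax-Σ (Πc · join τ) f x)) (·-cong (axiom (ax-Π (join τ) x)) (≐-refl _))

  ⊑-join : (τ : Ty) (a b : Tm Γ τ) → (Ps ⊢ a ⊑ join τ · a · b) × (Ps ⊢ b ⊑ join τ · a · b)
  ⊑-join G       a b = ⇒I (hyp here) , ⇒I (hyp here)
  ⊑-join {Γ = Γ} (σ *) a b = ∀∈I (⇒E cup-intro (∨I₁ (hyp here))) , ∀∈I (⇒E cup-intro (∨I₂ (hyp here)))
    where
    cup-intro : {Qs : List (Fm (σ ∷ Γ))} → Qs ⊢ (var vz ∈' wkT a ∨' var vz ∈' wkT b) ⇒' var vz ∈' cup · wkT a · wkT b
    cup-intro = ∧E₂ (axiom (ax-cup (var vz) (wkT a) (wkT b)))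
  ⊑-join (σ ⇒ τ) a b =
    ∀I (⊑-≐ʳ (proj₁ (⊑-join τ (wkT a · var vz) (wkT b · var vz))) pointwise) ,
    ∀I (⊑-≐ʳ (proj₂ (⊑-join τ (wkT a · var vz) (wkT b · var vz))) pointwise)
    where
    pointwise : _ ⊢ join τ · (wkT a · var vz) · (wkT b · var vz) ≐ wkT (join (σ ⇒ τ) · a · b) · var vz
    pointwise = ⊢-cast (cong (λ j → join τ · (wkT a · var vz) · (wkT b · var vz) ≐ j · wkT a · wkT b · var vz) (sym (wkT-join (σ ⇒ τ))))
                       (≐-sym (join-β (wkT a) (wkT b) (var vz)))

  -- bigJoin τ w f bounds f x for all x ∈ w; bigJoin (ρ ⇒ τ) is the closed term λ w f y → bigJoin τ w (λ x → f x y).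
  bigJoin : (τ : Ty) → Tm Γ (σ * ⇒ (σ ⇒ τ) ⇒ τ)
  bigJoin-body : (τ : Ty) → Tm (ρ ∷ (σ ⇒ ρ ⇒ τ) ∷ σ * ∷ []) τ

  bigJoin G                 = Πc · (Πc · dummy G)
  bigJoin (ρ *)             = bigcup
  bigJoin {σ = σ} (ρ ⇒ τ) = renT closeR (ƛ⃗ (ρ ∷ (σ ⇒ ρ ⇒ τ) ∷ σ * ∷ []) (bigJoin-body τ))

  bigJoin-body τ = bigJoin τ · var (vs (vs vz)) · (Σc · var (vs vz) · (Πc · var vz))

  subT-bigJoin : (s : Sub Γ Δ) (τ : Ty) → subT s (bigJoin {σ = σ} τ) ≡ bigJoin τ
  subT-bigJoin s G       = refl
  subT-bigJoin s (ρ *)   = refl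
  subT-bigJoin s (ρ ⇒ τ) = subT-closed s _

  wkT-bigJoin : (τ : Ty) → wkT {τ = ρ} (bigJoin {Γ = Γ} {σ = σ} τ) ≡ bigJoin τ
  wkT-bigJoin τ = trans (renT≡subT vs (bigJoin τ)) (subT-bigJoin _ τ)

  bigJoin-β : (w : Tm Γ (σ *)) (f : Tm Γ (σ ⇒ ρ ⇒ τ)) (y : Tm Γ ρ) →
              Ps ⊢ bigJoin (ρ ⇒ τ) · w · f · y ≐ bigJoin τ · w · (Σc · f · (Πc · y))
  bigJoin-β {σ = σ} {ρ = ρ} {τ = τ} w f y =
    ⊢-cast (cong₂ (λ B B′ → B · w · f · y ≐ B′ · w · (Σc · f · (Πc · y))) (sym (renT≡subT closeR M)) (subT-bigJoin _ τ))
           (ƛ⃗-β (var ∘SR closeR) (ρ ∷ (σ ⇒ ρ ⇒ τ) ∷ σ * ∷ []) (bigJoin-body τ) (y ∷ f ∷ w ∷ []))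
    where M = ƛ⃗ (ρ ∷ (σ ⇒ ρ ⇒ τ) ∷ σ * ∷ []) (bigJoin-body τ)

  ⊑-bigJoin : (τ : Ty) {x : Tm Γ σ} {w : Tm Γ (σ *)} (f : Tm Γ (σ ⇒ τ)) → Ps ⊢ x ∈' w → Ps ⊢ f · x ⊑ bigJoin τ · w · f
  ⊑-bigJoin G       f m = ⇒I (hyp here)
  ⊑-bigJoin (ρ *)   {x} {w} f m = ∀∈I (⇒E (axiom (ax-bigcup (wkT x) (wkT w) (wkT f) (var vz))) (∧I (⊢-weaken (⊢-wkF m)) (hyp here)))
  ⊑-bigJoin (ρ ⇒ τ) {x} {w} f m = ∀I (⊑-≐ʳ (⊑-≐ˡ (⊑-bigJoin τ f·_y (⊢-wkF m)) f·_y-β) bigJoin-unfold)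
    where
    f·_y = Σc · wkT f · (Πc · var vz)
    f·_y-β = ≐-trans (axiom (ax-Σ (wkT f) (Πc · var vz) (wkT x))) (·-cong (≐-refl _) (axiom (ax-Π (var vz) (wkT x))))
    bigJoin-unfold : _ ⊢ bigJoin τ · wkT w · f·_y ≐ wkT (bigJoin (ρ ⇒ τ)) · wkT w · wkT f · var vz
    bigJoin-unfold = ⊢-cast (cong (λ B → bigJoin τ · wkT w · f·_y ≐ B · wkT w · wkT f · var vz) (sym (wkT-bigJoin (ρ ⇒ τ))))
                            (≐-sym (bigJoin-β (wkT w) (wkT f) (var vz)))

  joinₜ : Tms Γ Ts → Tms Γ Ts → Tms Γ Ts
  joinₜ []       []       = []
  joinₜ (a ∷ as) (b ∷ bs) = join _ · a · b ∷ joinₜ as bs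

  ⊑ₜ-joinₜ : (as bs : Tms Γ Ts) → (Ps ⊢ as ⊑ₜ joinₜ as bs) × (Ps ⊢ bs ⊑ₜ joinₜ as bs)
  ⊑ₜ-joinₜ []       []       = [] , []
  ⊑ₜ-joinₜ (a ∷ as) (b ∷ bs) =
    (proj₁ (⊑-join _ a b) ∷ proj₁ (⊑ₜ-joinₜ as bs)) , (proj₂ (⊑-join _ a b) ∷ proj₂ (⊑ₜ-joinₜ as bs))

  subTs-joinₜ : (s : Sub Γ Δ) (as bs : Tms Γ Ts) → subTs s (joinₜ as bs) ≡ joinₜ (subTs s as) (subTs s bs)
  subTs-joinₜ s []       []       = refl
  subTs-joinₜ s (a ∷ as) (b ∷ bs) = cong₂ _∷_ (cong (λ j → j · subT s a · subT s b) (subT-join s _)) (subTs-joinₜ s as bs)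

  bigJoinₜ : Tm Γ (σ *) → Tms Γ ((σ ∷ []) ⇉ Us) → Tms Γ Us
  bigJoinₜ {Us = []}     w []       = []
  bigJoinₜ {Us = U ∷ Us} w (f ∷ fs) = bigJoin U · w · f ∷ bigJoinₜ w fs

  ⊑ₜ-bigJoinₜ : {x : Tm Γ σ} {w : Tm Γ (σ *)} (fs : Tms Γ ((σ ∷ []) ⇉ Us)) →
                Ps ⊢ x ∈' w → Ps ⊢ fs ·ₜ (x ∷ []) ⊑ₜ bigJoinₜ w fs
  ⊑ₜ-bigJoinₜ {Us = []}     []       m = []
  ⊑ₜ-bigJoinₜ {Us = U ∷ Us} (f ∷ fs) m = ⊑-bigJoin U f m ∷ ⊑ₜ-bigJoinₜ fs m

  subTs-bigJoinₜ : (s : Sub Γ Δ) (w : Tm Γ (σ *)) (fs : Tms Γ ((σ ∷ []) ⇉ Us)) → subTs s (bigJoinₜ w fs) ≡ bigJoinₜ (subT s w) (subTs s fs)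
  subTs-bigJoinₜ {Us = []}     s w []       = refl
  subTs-bigJoinₜ {Us = U ∷ Us} s w (f ∷ fs) = cong₂ _∷_ (cong (λ B → B · subT s w · subT s f) (subT-bigJoin s U)) (subTs-bigJoinₜ s w fs)

  wkTs-bigJoinₜ : (w : Tm Γ (σ *)) (fs : Tms Γ ((σ ∷ []) ⇉ Us)) → wkTs {σ = ρ} (bigJoinₜ w fs) ≡ bigJoinₜ (wkT w) (wkTs fs)
  wkTs-bigJoinₜ {Us = []}     w []       = refl
  wkTs-bigJoinₜ {Us = U ∷ Us} w (f ∷ fs) = cong₂ _∷_ (cong (λ B → B · wkT w · wkT f) (wkT-bigJoin U)) (wkTs-bigJoinₜ w fs)

module Soundness (L : Signature) (T : Logic.Fm L [] → Set) where
  open Logic L hiding (_⊢_)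
  open Substitution L
  open Derivations L T
  open Tuples L
  open Combinators L T
  open Realizability L
  open RealizabilityRules L T
  open Majorants L T

  HrTys : List (Fm Γ) → List Ty
  HrTys []       = []
  HrTys (H ∷ Hs) = HrTy H ++ HrTys Hs

  HypsRealized : List (Fm Δ) → (Hs : List (Fm Γ)) → Sub Γ Δ → Tms Δ (HrTys Hs) → Set
  HypsRealized Ps []       γ bs = ⊤
  HypsRealized Ps (H ∷ Hs) γ bs = Ps ⊢ hr H γ (++⁻ˡ (HrTy H) bs) × HypsRealized Ps Hs γ (++⁻ʳ (HrTy H) bs)

  HypsRealized-mono : (∀ {B} → Ps ∋ B → Qs ∋ B) → (Hs : List (Fm Γ)) {γ : Sub Γ Δ} {bs : Tms Δ (HrTys Hs)} →
                      HypsRealized Ps Hs γ bs → HypsRealized Qs Hs γ bs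
  HypsRealized-mono h []       ok       = tt
  HypsRealized-mono h (H ∷ Hs) (d , ok) = ⊢-mono h d , HypsRealized-mono h Hs ok

  HypsRealized-∷ : {A : Fm Γ} {Hs : List (Fm Γ)} {γ : Sub Γ Δ} (as : Tms Δ (HrTy A)) (bs : Tms Δ (HrTys Hs)) →
                   Ps ⊢ hr A γ as → HypsRealized Ps Hs γ bs → HypsRealized Ps (A ∷ Hs) γ (++⁺ as bs)
  HypsRealized-∷ {A = A} {Hs} {γ} as bs d ok =
    ⊢-cast (cong (hr A γ) (sym (++⁻ˡ-++⁺ as bs))) d , subst (HypsRealized _ Hs γ) (sym (++⁻ʳ-++⁺ as bs)) ok

  HypsRealized-wkF* : (Xs : List Ty) (Hs : List (Fm Γ)) {γ : Sub Γ Δ} {bs : Tms Δ (HrTys Hs)} →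
                      HypsRealized Ps Hs γ bs → HypsRealized (wkPs Xs Ps) Hs (wkS* Xs γ) (wkTs* Xs bs)
  HypsRealized-wkF* Xs []       ok       = tt
  HypsRealized-wkF* Xs (H ∷ Hs) {γ} {bs} (d , ok) =
    ⊢-cast (trans (wkF*-hr Xs H γ _) (cong (hr H _) (map-++⁻ˡ (wkT* Xs) (HrTy H) bs))) (⊢-wkF* Xs d) ,
    subst (HypsRealized _ Hs _) (map-++⁻ʳ (wkT* Xs) (HrTy H) bs) (HypsRealized-wkF* Xs Hs ok)

  HrTys-wkF : (Hs : List (Fm Γ)) → HrTys (map (wkF {τ = σ}) Hs) ≡ HrTys Hs
  HrTys-wkF []       = refl
  HrTys-wkF (H ∷ Hs) = cong₂ _++_ (HrTy-renF vs H) (HrTys-wkF Hs)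

  HypsRealized-wkF : (Hs : List (Fm Γ)) {γ : Sub Γ Δ} {bs : Tms Δ (HrTys Hs)} → HypsRealized Ps Hs γ bs →
                     HypsRealized (map (wkF {τ = σ}) Ps) (map wkF Hs) (liftS γ) (castT (sym (HrTys-wkF Hs)) (wkTs bs))
  HypsRealized-wkF []       ok = tt
  HypsRealized-wkF {σ = σ} (H ∷ Hs) {γ} {bs} (d , ok) =
    ⊢-cast head (⊢-wkF d) , subst (HypsRealized _ (map wkF Hs) (liftS γ)) tail (HypsRealized-wkF Hs ok)
    where
    p = HrTy-renF (vs {τ = σ}) H
    q = HrTys-wkF {σ = σ} Hs
    r = sym (HrTys-wkF {σ = σ} (H ∷ Hs))
    head : wkF (hr H γ (++⁻ˡ (HrTy H) bs)) ≡ hr (wkF H) (liftS γ) (++⁻ˡ (HrTy (wkF H)) (castT r (wkTs bs)))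
    head = begin
      wkF (hr H γ (++⁻ˡ (HrTy H) bs))                                               ≡⟨ wkF-hr H γ _ ⟩
      hr H (vs ∘RS γ) (wkTs (++⁻ˡ (HrTy H) bs))                                      ≡⟨ cong (hr H _) (castT-cancel (sym p) p _) ⟨
      hr H (vs ∘RS γ) (castT p (castT (sym p) (wkTs (++⁻ˡ (HrTy H) bs))))            ≡⟨ cong (hr H _ ∘ castT p) shuffle ⟩
      hr H (vs ∘RS γ) (castT p (++⁻ˡ (HrTy (wkF H)) (castT r (wkTs bs))))            ≡⟨ hr-renF vs H (liftS γ) _ ⟨
      hr (wkF H) (liftS γ) (++⁻ˡ (HrTy (wkF H)) (castT r (wkTs bs)))                 ∎
      where
      open ≡-Reasoning
      shuffle = trans (cong (castT (sym p)) (map-++⁻ˡ wkT (HrTy H) bs)) (castT-++⁻ˡ (sym p) (sym q) r (wkTs bs))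
    tail : castT (sym q) (wkTs (++⁻ʳ (HrTy H) bs)) ≡ ++⁻ʳ (HrTy (wkF H)) (castT r (wkTs bs))
    tail = trans (cong (castT (sym q)) (map-++⁻ʳ wkT (HrTy H) bs)) (castT-++⁻ʳ (sym p) (sym q) r (wkTs bs))

  pick : {Hs : List (Fm Γ)} {A : Fm Γ} → Hs ∋ A → Tms Δ (HrTys Hs) → Tms Δ (HrTy A)
  pick {Hs = H ∷ Hs} here      bs = ++⁻ˡ (HrTy H) bs
  pick {Hs = H ∷ Hs} (there i) bs = pick i (++⁻ʳ (HrTy H) bs)

  subTs-pick : (s : Sub Δ Θ) {Hs : List (Fm Γ)} {A : Fm Γ} (i : Hs ∋ A) (bs : Tms Δ (HrTys Hs)) → subTs s (pick i bs) ≡ pick i (subTs s bs)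
  subTs-pick s {H ∷ Hs} here      bs = map-++⁻ˡ (subT s) (HrTy H) bs
  subTs-pick s {H ∷ Hs} (there i) bs = trans (subTs-pick s i _) (cong (pick i) (map-++⁻ʳ (subT s) (HrTy H) bs))

  HypsRealized-pick : {Hs : List (Fm Γ)} {A : Fm Γ} (i : Hs ∋ A) {γ : Sub Γ Δ} {bs : Tms Δ (HrTys Hs)} →
                      HypsRealized Ps Hs γ bs → Ps ⊢ hr A γ (pick i bs)
  HypsRealized-pick here      (d , ok) = d
  HypsRealized-pick (there i) (d , ok) = HypsRealized-pick i ok

  Realizes : (Hs : List (Fm Γ)) (A : Fm Γ) → Tms (HrTys Hs ++ Γ) (HrTy A) → Set
  Realizes {Γ = Γ} Hs A e = ∀ {Δ} (γ : Sub Γ Δ) (bs : Tms Δ (HrTys Hs)) (Ps : List (Fm Δ)) →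
                            HypsRealized Ps Hs γ bs → Ps ⊢ hr A γ (subTs (bs ++ˢ γ) e)

  Realizable : List (Fm Γ) → Fm Γ → Set
  Realizable Hs A = Σ (Tms (HrTys Hs ++ _) (HrTy A)) (Realizes Hs A)

  ++ˢ-∘S-wkS*-var : (RH : List Ty) (bs : Tms Δ RH) (γ : Sub Γ Δ) → (bs ++ˢ γ) ∘S wkS* RH var ≗S γ
  ++ˢ-∘S-wkS*-var RH bs γ x = subT-++ˢ-wkT* RH bs γ (var x)

  ++⁻ˡ-subTs-++⁺ : (s : Sub Γ Δ) (as : Tms Γ Ts) (bs : Tms Γ Us) → ++⁻ˡ Ts (subTs s (++⁺ as bs)) ≡ subTs s as
  ++⁻ˡ-subTs-++⁺ s as bs = trans (cong (++⁻ˡ _) (map-++⁺ (subT s) as bs)) (++⁻ˡ-++⁺ (subTs s as) (subTs s bs))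

  ++⁻ʳ-subTs-++⁺ : (s : Sub Γ Δ) (as : Tms Γ Ts) (bs : Tms Γ Us) → ++⁻ʳ Ts (subTs s (++⁺ as bs)) ≡ subTs s bs
  ++⁻ʳ-subTs-++⁺ s as bs = trans (cong (++⁻ʳ _) (map-++⁺ (subT s) as bs)) (++⁻ʳ-++⁺ (subTs s as) (subTs s bs))

  sound-hyp : {Hs : List (Fm Γ)} {A : Fm Γ} → Hs ∋ A → Realizable Hs A
  sound-hyp {Hs = Hs} {A} i = pick i (vars (HrTys Hs)) , realizes
    where
    realizes : Realizes Hs A (pick i (vars (HrTys Hs)))
    realizes γ bs Ps ok =
      ⊢-cast (cong (hr A γ) (sym (trans (subTs-pick (bs ++ˢ γ) i _) (cong (pick i) (subTs-++ˢ-vars _ bs γ))))) (HypsRealized-pick i ok)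

  sound-⊥E : {Hs : List (Fm Γ)} {A : Fm Γ} → Realizable Hs ⊥' → Realizable Hs A
  sound-⊥E {A = A} (_ , h) = dummies (HrTy A) , λ γ bs Ps ok → ⊥E (h γ bs Ps ok)

  sound-∧I : {Hs : List (Fm Γ)} {A B : Fm Γ} → Realizable Hs A → Realizable Hs B → Realizable Hs (A ∧' B)
  sound-∧I {A = A} {B} (e₁ , h₁) (e₂ , h₂) = ++⁺ e₁ e₂ , λ γ bs Ps ok →
    ∧I (⊢-cast (cong (hr A γ) (sym (++⁻ˡ-subTs-++⁺ (bs ++ˢ γ) e₁ e₂))) (h₁ γ bs Ps ok))
       (⊢-cast (cong (hr B γ) (sym (++⁻ʳ-subTs-++⁺ (bs ++ˢ γ) e₁ e₂))) (h₂ γ bs Ps ok))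

  sound-∧E₁ : {Hs : List (Fm Γ)} {A B : Fm Γ} → Realizable Hs (A ∧' B) → Realizable Hs A
  sound-∧E₁ {A = A} (e , h) = ++⁻ˡ (HrTy A) e , λ γ bs Ps ok →
    ⊢-cast (cong (hr A γ) (sym (map-++⁻ˡ (subT (bs ++ˢ γ)) (HrTy A) e))) (∧E₁ (h γ bs Ps ok))

  sound-∧E₂ : {Hs : List (Fm Γ)} {A B : Fm Γ} → Realizable Hs (A ∧' B) → Realizable Hs B
  sound-∧E₂ {A = A} {B} (e , h) = ++⁻ʳ (HrTy A) e , λ γ bs Ps ok →
    ⊢-cast (cong (hr B γ) (sym (map-++⁻ʳ (subT (bs ++ˢ γ)) (HrTy A) e))) (∧E₂ (h γ bs Ps ok))

  sound-∨I₁ : {Hs : List (Fm Γ)} {A B : Fm Γ} → Realizable Hs A → Realizable Hs (A ∨' B)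
  sound-∨I₁ {A = A} {B} (e , h) = ++⁺ e (dummies (HrTy B)) , λ γ bs Ps ok →
    ∨I₁ (⊢-cast (cong (hr A γ) (sym (++⁻ˡ-subTs-++⁺ (bs ++ˢ γ) e _))) (h γ bs Ps ok))

  sound-∨I₂ : {Hs : List (Fm Γ)} {A B : Fm Γ} → Realizable Hs B → Realizable Hs (A ∨' B)
  sound-∨I₂ {A = A} {B} (e , h) = ++⁺ (dummies (HrTy A)) e , λ γ bs Ps ok →
    ∨I₂ (⊢-cast (cong (hr B γ) (sym (++⁻ʳ-subTs-++⁺ (bs ++ˢ γ) (dummies (HrTy A)) e))) (h γ bs Ps ok))

  sound-⇒E : {Hs : List (Fm Γ)} {A B : Fm Γ} → Realizable Hs (A ⇒' B) → Realizable Hs A → Realizable Hs B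
  sound-⇒E {A = A} {B} (f , h₁) (a , h₂) = f ·ₜ a , λ γ bs Ps ok →
    ⊢-cast (cong (hr B γ) (sym (subTs-·ₜ (bs ++ˢ γ) f a))) (hr-⇒E A B γ _ _ (h₁ γ bs Ps ok) (h₂ γ bs Ps ok))

  -- Substitutes the realizer a for the realizer variables of the first hypothesis.
  plugHyp : (RH : List Ty) → Tms (RH ++ Γ) Ts → Sub ((Ts ++ RH) ++ Γ) (RH ++ Γ)
  plugHyp RH a = ++⁺ a (vars RH) ++ˢ wkS* RH var

  plugHyp-∘S : (RH : List Ty) (a : Tms (RH ++ Γ) Ts) (bs : Tms Δ RH) (γ : Sub Γ Δ) →
               (bs ++ˢ γ) ∘S plugHyp RH a ≗S ++⁺ (subTs (bs ++ˢ γ) a) bs ++ˢ γ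
  plugHyp-∘S RH a bs γ x =
    trans (∘S-++ˢ (bs ++ˢ γ) (++⁺ a (vars RH)) (wkS* RH var) x)
          (++ˢ-cong (trans (map-++⁺ (subT (bs ++ˢ γ)) a (vars RH)) (cong (++⁺ _) (subTs-++ˢ-vars RH bs γ))) (++ˢ-∘S-wkS*-var RH bs γ) x)

  Realizes-cut : {Hs : List (Fm Γ)} {X C : Fm Γ} (a : Tms (HrTys Hs ++ Γ) (HrTy X)) {c : Tms ((HrTy X ++ HrTys Hs) ++ Γ) (HrTy C)} →
                 Realizes (X ∷ Hs) C c → (γ : Sub Γ Δ) (bs : Tms Δ (HrTys Hs)) →
                 HypsRealized Ps Hs γ bs → Ps ⊢ hr X γ (subTs (bs ++ˢ γ) a) → Ps ⊢ hr C γ (subTs (bs ++ˢ γ) (subTs (plugHyp (HrTys Hs) a) c))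
  Realizes-cut {Ps = Ps} {Hs = Hs} {X} {C} a {c} h γ bs ok d =
    ⊢-cast (cong (hr C γ) (sym (trans (subTs-∘ (bs ++ˢ γ) (plugHyp (HrTys Hs) a) c) (subTs-cong (plugHyp-∘S (HrTys Hs) a bs γ) c))))
           (h γ (++⁺ (subTs (bs ++ˢ γ) a) bs) Ps (HypsRealized-∷ {A = X} _ bs d ok))

  sound-∨E : {Hs : List (Fm Γ)} {A B C : Fm Γ} → Realizable Hs (A ∨' B) → Realizable (A ∷ Hs) C → Realizable (B ∷ Hs) C → Realizable Hs C
  sound-∨E {Hs = Hs} {A} {B} {C} (e , h) (e₁ , h₁) (e₂ , h₂) = joinₜ c₁ c₂ , realizes
    where
    RH = HrTys Hs
    c₁ = subTs (plugHyp RH (++⁻ˡ (HrTy A) e)) e₁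
    c₂ = subTs (plugHyp RH (++⁻ʳ (HrTy A) e)) e₂
    realizes : Realizes Hs C (joinₜ c₁ c₂)
    realizes γ bs Ps ok = ⊢-cast (cong (hr C γ) (sym (subTs-joinₜ δ c₁ c₂))) (∨E (h γ bs Ps ok) left right)
      where
      δ = bs ++ˢ γ
      left : hr A γ (++⁻ˡ (HrTy A) (subTs δ e)) ∷ Ps ⊢ hr C γ (joinₜ (subTs δ c₁) (subTs δ c₂))
      left = hr-⊑ₜ C γ (proj₁ (⊑ₜ-joinₜ _ _))
               (Realizes-cut {X = A} {C} (++⁻ˡ (HrTy A) e) h₁ γ bs (HypsRealized-mono there Hs ok)
                 (⊢-cast (cong (hr A γ) (sym (map-++⁻ˡ (subT δ) (HrTy A) e))) (hyp here)))
      right : hr B γ (++⁻ʳ (HrTy A) (subTs δ e)) ∷ Ps ⊢ hr C γ (joinₜ (subTs δ c₁) (subTs δ c₂))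
      right = hr-⊑ₜ C γ (proj₂ (⊑ₜ-joinₜ _ _))
                (Realizes-cut {X = B} {C} (++⁻ʳ (HrTy A) e) h₂ γ bs (HypsRealized-mono there Hs ok)
                  (⊢-cast (cong (hr B γ) (sym (map-++⁻ʳ (subT δ) (HrTy A) e))) (hyp here)))

  -- Moves the realizer variables of the discharged hypothesis to the front, ready for ƛₜ.
  discharge : (RA RH : List Ty) → Sub ((RA ++ RH) ++ Γ) (RA ++ RH ++ Γ)
  discharge RA RH = ++⁺ (vars RA) (wkTs* RA (vars RH)) ++ˢ wkS* RA (wkS* RH var)

  discharge-∘S : (RA RH : List Ty) (as : Tms (RA ++ Δ) RA) (bs : Tms Δ RH) (γ : Sub Γ Δ) →
                 (as ++ˢ wkS* RA (bs ++ˢ γ)) ∘S discharge RA RH ≗S ++⁺ as (wkTs* RA bs) ++ˢ wkS* RA γ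
  discharge-∘S RA RH as bs γ x =
    trans (∘S-++ˢ δ′ (++⁺ (vars RA) (wkTs* RA (vars RH))) (wkS* RA (wkS* RH var)) x) (++ˢ-cong realizers variables x)
    where
    δ′ = as ++ˢ wkS* RA (bs ++ˢ γ)
    realizers : subTs δ′ (++⁺ (vars RA) (wkTs* RA (vars RH))) ≡ ++⁺ as (wkTs* RA bs)
    realizers = trans (map-++⁺ (subT δ′) (vars RA) _) (cong₂ ++⁺ (subTs-++ˢ-vars RA as _)
                  (trans (subTs-++ˢ-wkTs* RA as _ (vars RH)) (trans (subTs-wkS* RA (bs ++ˢ γ) (vars RH)) (cong (wkTs* RA) (subTs-++ˢ-vars RH bs γ)))))
    variables : δ′ ∘S wkS* RA (wkS* RH var) ≗S wkS* RA γ
    variables y = trans (subT-++ˢ-wkT* RA as _ (wkT* RH (var y)))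
                    (trans (subT-wkS* RA (bs ++ˢ γ) (wkT* RH (var y))) (cong (wkT* RA) (subT-++ˢ-wkT* RH bs γ (var y))))

  sound-⇒I : {Hs : List (Fm Γ)} {A B : Fm Γ} → Realizable (A ∷ Hs) B → Realizable Hs (A ⇒' B)
  sound-⇒I {Hs = Hs} {A} {B} (e , h) = ƛₜ RA (subTs (discharge RA RH) e) , realizes
    where
    RH = HrTys Hs
    RA = HrTy A
    realizes : Realizes Hs (A ⇒' B) (ƛₜ RA (subTs (discharge RA RH) e))
    realizes γ bs Ps ok =
      hr-⇒I A B γ (bs ++ˢ γ) _ (⊢-cast (cong (hr B _) (sym realizer-≡)) (h (wkS* RA γ) (++⁺ (vars RA) (wkTs* RA bs)) _ ok′))
      where
      ok′ = HypsRealized-∷ {A = A} (vars RA) (wkTs* RA bs) (hyp here) (HypsRealized-mono there Hs (HypsRealized-wkF* RA Hs ok))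
      realizer-≡ : subTs (vars RA ++ˢ wkS* RA (bs ++ˢ γ)) (subTs (discharge RA RH) e) ≡ subTs (++⁺ (vars RA) (wkTs* RA bs) ++ˢ wkS* RA γ) e
      realizer-≡ = trans (subTs-∘ _ (discharge RA RH) e) (subTs-cong (discharge-∘S RA RH (vars RA) bs γ) e)

  -- Re-expresses a realizer for the hypotheses pre ∷ map wkF Hs below the new variable σ.
  bindHyps : (RH : List Ty) → Tms (σ ∷ RH ++ Γ) Ts → Us ≡ RH → Sub ((Ts ++ Us) ++ σ ∷ Γ) (σ ∷ RH ++ Γ)
  bindHyps RH pre p = ++⁺ pre (castT (sym p) (wkTs (vars RH))) ++ˢ liftS (wkS* RH var)

  bindHyps-∘S : (RH : List Ty) (pre : Tms (σ ∷ RH ++ Γ) Ts) (p : Us ≡ RH) (bs : Tms Δ RH) (γ : Sub Γ Δ) →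
                liftS (bs ++ˢ γ) ∘S bindHyps RH pre p ≗S ++⁺ (subTs (liftS (bs ++ˢ γ)) pre) (castT (sym p) (wkTs bs)) ++ˢ liftS γ
  bindHyps-∘S RH pre p bs γ x =
    trans (∘S-++ˢ δ′ (++⁺ pre (castT (sym p) (wkTs (vars RH)))) (liftS (wkS* RH var)) x) (++ˢ-cong realizers variables x)
    where
    δ′ = liftS (bs ++ˢ γ)
    realizers : subTs δ′ (++⁺ pre (castT (sym p) (wkTs (vars RH)))) ≡ ++⁺ (subTs δ′ pre) (castT (sym p) (wkTs bs))
    realizers = trans (map-++⁺ (subT δ′) pre _) (cong (++⁺ _) (trans (map-castT (subT δ′) (sym p) _)
                  (cong (castT (sym p)) (trans (subTs-liftS-wkTs (bs ++ˢ γ) (vars RH)) (cong wkTs (subTs-++ˢ-vars RH bs γ))))))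
    variables : δ′ ∘S liftS (wkS* RH var) ≗S liftS γ
    variables y = trans (liftS-∘S (bs ++ˢ γ) (wkS* RH var) y) (liftS-cong (++ˢ-∘S-wkS*-var RH bs γ) y)

  sound-∀I : {Hs : List (Fm Γ)} {A : Fm (σ ∷ Γ)} → Realizable (map wkF Hs) A → Realizable Hs (∀' σ A)
  sound-∀I {σ = σ} {Hs = Hs} {A} (e , h) = ƛₜ (σ ∷ []) e′ , realizes
    where
    p = HrTys-wkF {σ = σ} Hs
    e′ = subTs (bindHyps (HrTys Hs) [] p) e
    realizes : Realizes Hs (∀' σ A) (ƛₜ (σ ∷ []) e′)
    realizes γ bs Ps ok = ∀I (hr-≐ₜ A (liftS γ) (≐ₜ-sym β) (h (liftS γ) bs′ (map wkF Ps) (HypsRealized-wkF Hs ok)))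
      where
      bs′ = castT (sym p) (wkTs bs)
      β : map wkF Ps ⊢ wkTs (subTs (bs ++ˢ γ) (ƛₜ (σ ∷ []) e′)) ·ₜ (var vz ∷ []) ≐ₜ subTs (bs′ ++ˢ liftS γ) e
      β = ≐ₜ-trans (ƛₜ-β-vz (bs ++ˢ γ) e′) (≡⇒≐ₜ (trans (subTs-∘ _ _ e) (subTs-cong (bindHyps-∘S (HrTys Hs) [] p bs γ) e)))

  sound-∀E : {Hs : List (Fm Γ)} {A : Fm (σ ∷ Γ)} → Realizable Hs (∀' σ A) → (t : Tm Γ σ) → Realizable Hs (A [ t ])
  sound-∀E {Hs = Hs} {A} (f , h) t = castT (sym P) ft , realizes
    where
    P = HrTy-subF (single t) A
    ft = f ·ₜ (wkT* (HrTys Hs) t ∷ [])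
    realizes : Realizes Hs (A [ t ]) (castT (sym P) ft)
    realizes γ bs Ps ok = ⊢-cast instance-≡ (∀E (h γ bs Ps ok) u)
      where
      δ = bs ++ˢ γ
      u = subT γ t
      F = subTs δ f
      realizer-≡ : F ·ₜ (u ∷ []) ≡ castT P (subTs δ (castT (sym P) ft))
      realizer-≡ = begin
        F ·ₜ (u ∷ [])                                   ≡⟨ cong (λ v → F ·ₜ (v ∷ [])) (subT-++ˢ-wkT* (HrTys Hs) bs γ t) ⟨
        F ·ₜ subTs δ (wkT* (HrTys Hs) t ∷ [])            ≡⟨ subTs-·ₜ δ f _ ⟨
        subTs δ ft                                     ≡⟨ castT-cancel (sym P) P _ ⟨
        castT P (castT (sym P) (subTs δ ft))           ≡⟨ cong (castT P) (map-castT (subT δ) (sym P) ft) ⟨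
        castT P (subTs δ (castT (sym P) ft))           ∎
        where open ≡-Reasoning
      instance-≡ : hr A (liftS γ) (wkTs F ·ₜ (var vz ∷ [])) [ u ] ≡ hr (A [ t ]) γ (subTs δ (castT (sym P) ft))
      instance-≡ = begin
        hr A (liftS γ) (wkTs F ·ₜ (var vz ∷ [])) [ u ]             ≡⟨ hr-liftS-[] A γ u _ ⟩
        hr A (γ ▸ u) (subTs (single u) (wkTs F ·ₜ (var vz ∷ [])))  ≡⟨ cong (hr A _) (subTs-·ₜ (single u) (wkTs F) _) ⟩
        hr A (γ ▸ u) (subTs (single u) (wkTs F) ·ₜ (u ∷ []))
          ≡⟨ cong (λ gs → hr A (γ ▸ u) (gs ·ₜ (u ∷ []))) (subTs-single-wkTs u F) ⟩
        hr A (γ ▸ u) (F ·ₜ (u ∷ []))                               ≡⟨ cong (hr A _) realizer-≡ ⟩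
        hr A (γ ▸ u) (castT P (subTs δ (castT (sym P) ft)))        ≡⟨ hr-[] A t γ _ ⟨
        hr (A [ t ]) γ (subTs δ (castT (sym P) ft))                ∎
        where open ≡-Reasoning

  sound-∃I : {Hs : List (Fm Γ)} {A : Fm (σ ∷ Γ)} (t : Tm Γ σ) → Realizable Hs (A [ t ]) → Realizable Hs (∃' σ A)
  sound-∃I {σ = σ} {Hs = Hs} {A} t (a , h) = sng · wkT* (HrTys Hs) t ∷ castT P a , realizes
    where
    P = HrTy-subF (single t) A
    realizes : Realizes Hs (∃' σ A) (sng · wkT* (HrTys Hs) t ∷ castT P a)
    realizes γ bs Ps ok =
      ⊢-cast (cong (λ w → ∃∈ (sng · w) (hr A (liftS γ) (wkTs (subTs δ (castT P a))))) (sym (subT-++ˢ-wkT* (HrTys Hs) bs γ t)))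
             (∃∈I u (∈-sng u) (⊢-cast instance-≡ (h γ bs Ps ok)))
      where
      δ = bs ++ˢ γ
      u = subT γ t
      instance-≡ : hr (A [ t ]) γ (subTs δ a) ≡ hr A (liftS γ) (wkTs (subTs δ (castT P a))) [ u ]
      instance-≡ = begin
        hr (A [ t ]) γ (subTs δ a)                                      ≡⟨ hr-[] A t γ _ ⟩
        hr A (γ ▸ u) (castT P (subTs δ a))                              ≡⟨ cong (hr A _) (map-castT (subT δ) P a) ⟨
        hr A (γ ▸ u) (subTs δ (castT P a))                              ≡⟨ cong (hr A _) (subTs-single-wkTs u _) ⟨
        hr A (γ ▸ u) (subTs (single u) (wkTs (subTs δ (castT P a))))    ≡⟨ hr-liftS-[] A γ u _ ⟨
        hr A (liftS γ) (wkTs (subTs δ (castT P a))) [ u ]               ∎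
        where open ≡-Reasoning

  sound-∃E : {Hs : List (Fm Γ)} {A : Fm (σ ∷ Γ)} {C : Fm Γ} →
             Realizable Hs (∃' σ A) → Realizable (A ∷ map wkF Hs) (wkF C) → Realizable Hs C
  sound-∃E {σ = σ} {Hs = Hs} {A} {C} (w ∷ as , h) (c , h₁) = bigJoinₜ w cs , realizes
    where
    p = HrTys-wkF {σ = σ} Hs
    q = HrTy-renF (vs {τ = σ}) C
    cs = ƛₜ (σ ∷ []) (castT q (subTs (bindHyps (HrTys Hs) (wkTs as) p) c))
    realizes : Realizes Hs C (bigJoinₜ w cs)
    realizes γ bs Ps ok = ⊢-cast (cong (hr C γ) (sym (subTs-bigJoinₜ δ w cs))) (∃∈E (h γ bs Ps ok) witness)
      where
      δ = bs ++ˢ γ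
      Rs = hr A (liftS γ) (wkTs (subTs δ as)) ∷ var vz ∈' wkT (subT δ w) ∷ map wkF Ps
      bs′ = ++⁺ (wkTs (subTs δ as)) (castT (sym p) (wkTs bs))
      ok′ : HypsRealized Rs (A ∷ map wkF Hs) (liftS γ) bs′
      ok′ = HypsRealized-∷ {A = A} _ _ (hyp here) (HypsRealized-mono (there ∘ there) (map wkF Hs) (HypsRealized-wkF Hs ok))
      realizer-≡ : subTs (liftS δ) (castT q (subTs (bindHyps (HrTys Hs) (wkTs as) p) c)) ≡ castT q (subTs (bs′ ++ˢ liftS γ) c)
      realizer-≡ = trans (map-castT _ q _) (cong (castT q) (trans (subTs-∘ _ _ c) (trans (subTs-cong (bindHyps-∘S (HrTys Hs) (wkTs as) p bs γ) c)
                     (cong (λ xs → subTs (++⁺ xs _ ++ˢ liftS γ) c) (subTs-liftS-wkTs δ as)))))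
      β : Rs ⊢ wkTs (subTs δ cs) ·ₜ (var vz ∷ []) ≐ₜ castT q (subTs (bs′ ++ˢ liftS γ) c)
      β = ≐ₜ-trans (ƛₜ-β-vz δ _) (≡⇒≐ₜ realizer-≡)
      conclusion : Rs ⊢ hr C (vs ∘RS γ) (castT q (subTs (bs′ ++ˢ liftS γ) c))
      conclusion = ⊢-cast (hr-renF vs C (liftS γ) _) (h₁ (liftS γ) bs′ Rs ok′)
      witness : Rs ⊢ wkF (hr C γ (bigJoinₜ (subT δ w) (subTs δ cs)))
      witness = ⊢-cast (sym (trans (wkF-hr C γ _) (cong (hr C _) (wkTs-bigJoinₜ (subT δ w) (subTs δ cs)))))
                  (hr-⊑ₜ C (vs ∘RS γ) (⊑ₜ-bigJoinₜ (wkTs (subTs δ cs)) (hyp (there here)))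
                    (hr-≐ₜ C (vs ∘RS γ) (≐ₜ-sym β) conclusion))

  AxiomRealizable : Fm Γ → Set
  AxiomRealizable {Γ = Γ} A = Σ (Tms Γ (HrTy A)) λ r → ∀ {Δ} (γ : Sub Γ Δ) (Ps : List (Fm Δ)) → Ps ⊢ hr A γ (subTs γ r)

  sound-ax : {Hs : List (Fm Γ)} {A : Fm Γ} → AxiomRealizable A → Realizable Hs A
  sound-ax {Hs = Hs} {A} (r , h) = wkTs* (HrTys Hs) r , λ γ bs Ps ok →
    ⊢-cast (cong (hr A γ) (sym (subTs-++ˢ-wkTs* (HrTys Hs) bs γ r))) (h γ Ps)

  AxiomRealizable-ExFree : {A : Fm Γ} → ExFree A → (∀ {Δ} (γ : Sub Γ Δ) (Ps : List (Fm Δ)) → Ps ⊢ subF γ A) → AxiomRealizable A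
  AxiomRealizable-ExFree {A = A} ef d = dummies (HrTy A) , λ γ Ps → ExFree⇒hr ef γ _ (d γ Ps)

  AxiomRealizable-∧ : {A B : Fm Γ} → AxiomRealizable A → AxiomRealizable B → AxiomRealizable (A ∧' B)
  AxiomRealizable-∧ {A = A} {B} (r₁ , h₁) (r₂ , h₂) = ++⁺ r₁ r₂ , λ γ Ps →
    ∧I (⊢-cast (cong (hr A γ) (sym (++⁻ˡ-subTs-++⁺ γ r₁ r₂))) (h₁ γ Ps))
       (⊢-cast (cong (hr B γ) (sym (++⁻ʳ-subTs-++⁺ γ r₁ r₂))) (h₂ γ Ps))

  AxiomRealizable-⇒ : (A B : Fm Γ) (es : Tms (HrTy A ++ Γ) (HrTy B)) →
            (∀ {Δ} (γ : Sub Γ Δ) (Ps : List (Fm Δ)) → let X = HrTy A in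
              hr A (wkS* X γ) (vars X) ∷ wkPs X Ps ⊢ hr B (wkS* X γ) (subTs (vars X ++ˢ wkS* X γ) es)) →
            AxiomRealizable (A ⇒' B)
  AxiomRealizable-⇒ A B es d = ƛₜ (HrTy A) es , λ γ Ps → hr-⇒I A B γ γ es (d γ Ps)

  AxiomRealizable-⇔ : (A B : Fm Γ) (p : HrTy A ≡ HrTy B) →
            (∀ {Δ} (γ : Sub Γ Δ) (as : Tms Δ (HrTy A)) (Ps : List (Fm Δ)) → Ps ⊢ hr A γ as → Ps ⊢ hr B γ (castT p as)) →
            (∀ {Δ} (γ : Sub Γ Δ) (as : Tms Δ (HrTy B)) (Ps : List (Fm Δ)) → Ps ⊢ hr B γ as → Ps ⊢ hr A γ (castT (sym p) as)) →
            AxiomRealizable (A ⇔' B)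
  AxiomRealizable-⇔ A B p f g =
    AxiomRealizable-∧ {A = A ⇒' B} {B ⇒' A} (AxiomRealizable-⇒ A B (castT p (vars _)) (transfer A B p f))
                                           (AxiomRealizable-⇒ B A (castT (sym p) (vars _)) (transfer B A (sym p) g))
    where
    transfer : (A B : Fm _) (p : HrTy A ≡ HrTy B) →
               (∀ {Δ} (γ : Sub _ Δ) (as : Tms Δ (HrTy A)) (Ps : List (Fm Δ)) → Ps ⊢ hr A γ as → Ps ⊢ hr B γ (castT p as)) →
               ∀ {Δ} (γ : Sub _ Δ) (Ps : List (Fm Δ)) → let X = HrTy A in
               hr A (wkS* X γ) (vars X) ∷ wkPs X Ps ⊢ hr B (wkS* X γ) (subTs (vars X ++ˢ wkS* X γ) (castT p (vars X)))
    transfer A B p f γ Ps =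
      ⊢-cast (cong (hr B _) (sym (trans (map-castT _ p _) (cong (castT p) (subTs-++ˢ-vars (HrTy A) (vars (HrTy A)) _))))) (f _ _ _ (hyp here))

  ax-∀∈-realizable : (t : Tm Γ (σ *)) (A : Fm (σ ∷ Γ)) → AxiomRealizable (∀∈ t A ⇔' ∀' σ (var vz ∈' wkT t ⇒' A))
  ax-∀∈-realizable {σ = σ} t A = AxiomRealizable-⇔ (∀∈ t A) (∀' σ (var vz ∈' wkT t ⇒' A)) p to from
    where
    p = cong ((σ ∷ []) ⇉_) (sym (List.map-id (HrTy A)))
    unfold : ∀ {Δ} (γ : Sub _ Δ) (fs : Tms Δ (HrTy (∀∈ t A))) →
             hr (∀' σ (var vz ∈' wkT t ⇒' A)) γ (castT p fs) ≡
             ∀' σ (var vz ∈' wkT (subT γ t) ⇒' hr A (liftS γ) (wkTs fs ·ₜ (var vz ∷ [])))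
    unfold γ fs = cong (∀' σ) (cong₂ (λ X Y → var vz ∈' X ⇒' hr A (liftS γ) Y) (subT-liftS-wkT γ t) realizer-≡)
      where
      m = List.map-id (HrTy A)
      gs = wkTs (castT p fs) ·ₜ (var vz ∷ [])
      realizer-≡ : wkTs* [] gs ·ₜ [] ≡ wkTs fs ·ₜ (var vz ∷ [])
      realizer-≡ = begin
        wkTs* [] gs ·ₜ []                                  ≡⟨ cong (_·ₜ []) (map-id gs) ⟩
        gs ·ₜ []                                           ≡⟨ ·ₜ-[] gs ⟩
        castT m gs                                         ≡⟨ cong (castT m) (castT-wkTs-·vz (sym m) p fs) ⟨
        castT m (castT (sym m) (wkTs fs ·ₜ (var vz ∷ [])))  ≡⟨ castT-cancel (sym m) m _ ⟩
        wkTs fs ·ₜ (var vz ∷ [])                           ∎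
        where open ≡-Reasoning
    to : ∀ {Δ} (γ : Sub _ Δ) as Ps → Ps ⊢ hr (∀∈ t A) γ as → Ps ⊢ hr (∀' σ (var vz ∈' wkT t ⇒' A)) γ (castT p as)
    to γ as Ps d = ⊢-cast (sym (unfold γ as)) (∀∈-unfold d)
    from : ∀ {Δ} (γ : Sub _ Δ) as Ps → Ps ⊢ hr (∀' σ (var vz ∈' wkT t ⇒' A)) γ as → Ps ⊢ hr (∀∈ t A) γ (castT (sym p) as)
    from γ as Ps d =
      ∀∈-fold (⊢-cast (trans (cong (hr (∀' σ (var vz ∈' wkT t ⇒' A)) γ) (sym (castT-cancel (sym p) p as))) (unfold γ (castT (sym p) as))) d)

  ax-∃∈-realizable : (t : Tm Γ (σ *)) (A : Fm (σ ∷ Γ)) → AxiomRealizable (∃∈ t A ⇔' ∃' σ (var vz ∈' wkT t ∧' A))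
  ax-∃∈-realizable {σ = σ} t A =
    AxiomRealizable-∧ {A = X ⇒' Y} {Y ⇒' X} (AxiomRealizable-⇒ X Y (wkT* RA t ∷ vars RA) to) (AxiomRealizable-⇒ Y X (wkTs (vars RA)) from)
    where
    X = ∃∈ t A
    Y = ∃' σ (var vz ∈' wkT t ∧' A)
    RA = HrTy A
    to : ∀ {Δ} (γ : Sub _ Δ) (Ps : List (Fm Δ)) →
         hr X (wkS* RA γ) (vars RA) ∷ wkPs RA Ps ⊢ hr Y (wkS* RA γ) (subTs (vars RA ++ˢ wkS* RA γ) (wkT* RA t ∷ vars RA))
    to γ Ps = ⊢-cast (cong (hr Y γ′) (sym (cong₂ _∷_ (subT-++ˢ-wkT* RA (vars RA) γ′ t) (subTs-++ˢ-vars RA (vars RA) γ′))))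
                (∃∈E (hyp here) (∃∈I-vz (hyp (there here))
                  (∧I (⊢-cast (cong (var vz ∈'_) (sym (subT-liftS-wkT γ′ t))) (hyp (there here))) (hyp here))))
      where γ′ = wkS* RA γ
    from : ∀ {Δ} (γ : Sub _ Δ) (Ps : List (Fm Δ)) → let RY = σ * ∷ RA in
           hr Y (wkS* RY γ) (vars RY) ∷ wkPs RY Ps ⊢ hr X (wkS* RY γ) (subTs (vars RY ++ˢ wkS* RY γ) (wkTs (vars RA)))
    from γ Ps = ⊢-cast (cong (hr X γ′) (sym (trans (subTs-▸-wkTs (wkTs (vars RA) ++ˢ γ′) (var vz) (vars RA)) (subTs-++ˢ-vars RA _ γ′))))
                  (∃∈E (hyp here) (∃∈I-vz (⊢-cast (cong (var vz ∈'_) (subT-liftS-wkT γ′ t)) (∧E₁ (hyp here))) (∧E₂ (hyp here))))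
      where γ′ = wkS* (σ * ∷ RA) γ

  -- A realizer (f , gs) of ∀x ∃y A yields the realizer ({f} , gs) of the conclusion.
  ac-realizable : (A : Fm (σ ∷ ρ ∷ Γ)) →
             AxiomRealizable (∀' ρ (∃' σ A) ⇒' ∃' (ρ ⇒ σ *) (∀' ρ (∃∈ (var (vs vz) · var vz) (renF (liftR (liftR vs)) A))))
  ac-realizable {σ = σ} {ρ = ρ} {Γ = Γ} A = AxiomRealizable-⇒ X Y es realizes
    where
    A′ = renF (liftR (liftR (vs {τ = ρ ⇒ σ *}))) A
    X = ∀' ρ (∃' σ A)
    Y = ∃' (ρ ⇒ σ *) (∀' ρ (∃∈ (var (vs vz) · var vz) A′))
    R = (ρ ∷ []) ⇉ HrTy A
    p = HrTy-renF (liftR (liftR (vs {τ = ρ ⇒ σ *}))) A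
    q = cong ((ρ ∷ []) ⇉_) (sym p)
    es : Tms (HrTy X ++ Γ) (HrTy Y)
    es = sng · var vz ∷ castT q (wkTs (vars R))
    realizes : ∀ {Δ} (γ : Sub Γ Δ) (Ps : List (Fm Δ)) → let γ′ = wkS* (HrTy X) γ in
               hr X γ′ (vars (HrTy X)) ∷ wkPs (HrTy X) Ps ⊢ hr Y γ′ (subTs (vars (HrTy X) ++ˢ γ′) es)
    realizes γ Ps = ⊢-cast (cong (hr Y γ′) (sym realizer-≡)) (∃∈I (var vz) (∈-sng (var vz)) (⊢-cast (sym body-≡) (hyp here)))
      where
      γ′ = wkS* (HrTy X) γ
      gs = wkTs (vars R)
      realizer-≡ : subTs (vars (HrTy X) ++ˢ γ′) es ≡ sng · var vz ∷ castT q gs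
      realizer-≡ = cong (sng · var vz ∷_) (trans (map-castT _ q _) (cong (castT q) (subTs-++ˢ-wkTs-vars R γ′)))
      Z = ∀' ρ (∃∈ (var (vs vz) · var vz) A′)
      unweaken : liftS (liftS (γ′ ▸ var vz)) ∘SR liftR (liftR vs) ≗S liftS (liftS γ′)
      unweaken vz          = refl
      unweaken (vs vz)     = refl
      unweaken (vs (vs x)) = refl
      hyp-realizer-≡ : castT p (wkTs (wkTs (castT q gs) ·ₜ (var vz ∷ []))) ≡ wkTs (wkTs gs ·ₜ (var vz ∷ []))
      hyp-realizer-≡ = trans (sym (map-castT wkT p _))
        (cong wkTs (trans (castT-wkTs-·vz p (sym q) _) (cong (λ hs → wkTs hs ·ₜ (var vz ∷ [])) (castT-cancel q (sym q) gs))))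
      body-≡ : hr Z (liftS γ′) (wkTs (castT q gs)) [ var vz ] ≡ hr X γ′ (var vz ∷ gs)
      body-≡ = begin
        hr Z (liftS γ′) (wkTs (castT q gs)) [ var vz ]                       ≡⟨ hr-liftS-[] Z γ′ (var vz) _ ⟩
        hr Z (γ′ ▸ var vz) (subTs (single (var vz)) (wkTs (castT q gs)))     ≡⟨ cong (hr Z _) (subTs-single-wkTs (var vz) _) ⟩
        hr Z (γ′ ▸ var vz) (castT q gs)
          ≡⟨ cong (∀' ρ ∘ ∃∈ (var (vs vz) · var vz))
                  (trans (hr-renF (liftR (liftR vs)) A _ _) (trans (hr-cong A unweaken _) (cong (hr A _) hyp-realizer-≡))) ⟩
        hr X γ′ (var vz ∷ gs)                                                ∎
        where open ≡-Reasoning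

  -- Realizers of the ∃-free B are irrelevant, so (f , gs) yields ({f dummies} , λ _ → gs dummies).
  ip-realizable : (B : Fm Γ) → ExFree B → (A : Fm (σ ∷ Γ)) →
             AxiomRealizable ((B ⇒' ∃' σ A) ⇒' ∃' (σ *) (wkF B ⇒' ∃∈ (var vz) (renF (liftR vs) A)))
  ip-realizable {Γ = Γ} {σ = σ} B eb A = AxiomRealizable-⇒ X Y es realizes
    where
    A′ = renF (liftR (vs {τ = σ *})) A
    B′ = wkF {τ = σ *} B
    X = B ⇒' ∃' σ A
    C = B′ ⇒' ∃∈ (var vz) A′
    Y = ∃' (σ *) C
    RB = HrTy B
    RB′ = HrTy B′
    RX = HrTy X
    R = RB ⇉ HrTy A
    p = HrTy-renF (liftR (vs {τ = σ *})) A
    K₀ : Tms (RX ++ Γ) (HrTy A)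
    K₀ = wkTs (vars R) ·ₜ dummies RB
    K : Tms (RB′ ++ RX ++ Γ) (HrTy A′)
    K = castT (sym p) (wkTs* RB′ K₀)
    es : Tms (RX ++ Γ) (HrTy Y)
    es = sng · (var vz ·⃗ dummies RB) ∷ ƛₜ RB′ K
    realizes : ∀ {Δ} (γ : Sub Γ Δ) (Ps : List (Fm Δ)) → let γ′ = wkS* RX γ in
               hr X γ′ (vars RX) ∷ wkPs RX Ps ⊢ hr Y γ′ (subTs (vars RX ++ˢ γ′) es)
    realizes {Δ} γ Ps = ∃∈I u (∈-sng u) (⊢-cast (sym instance-≡) (hr-⇒I B′ (∃∈ (var vz) A′) (γ′ ▸ u) δ K conclusion))
      where
      γ′ = wkS* RX γ
      δ = vars RX ++ˢ γ′
      gs = wkTs (vars R)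
      u = subT δ (var vz ·⃗ dummies RB)
      γ″ = wkS* RB′ (γ′ ▸ u)
      Rs = hr B′ γ″ (vars RB′) ∷ wkPs RB′ (hr X γ′ (vars RX) ∷ wkPs RX Ps)
      instance-≡ : hr C (liftS γ′) (wkTs (subTs δ (ƛₜ RB′ K))) [ u ] ≡ hr C (γ′ ▸ u) (subTs δ (ƛₜ RB′ K))
      instance-≡ = trans (hr-liftS-[] C γ′ u _) (cong (hr C _) (subTs-single-wkTs u _))
      instantiated : Rs ⊢ hr (∃' σ A) (wkS* RB′ γ′) (wkTs* RB′ (vars RX) ·ₜ dummies RB)
      instantiated = hr-⇒-ExFree B (∃' σ A) eb (wkS* RB′ γ′) (wkTs* RB′ (vars RX))
                       (⊢-weaken (⊢-cast (wkF*-hr RB′ X γ′ (vars RX)) (⊢-wkF* RB′ (hyp here))))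
                       (hr⇒ExFree eb (γ″ ∘SR vs) _ (⊢-cast (hr-renF vs B γ″ (vars RB′)) (hyp here)))
      realizer-≡ : castT p (subTs (vars RB′ ++ˢ wkS* RB′ δ) K) ≡ wkTs* RB′ gs ·ₜ dummies RB
      realizer-≡ = begin
        castT p (subTs (vars RB′ ++ˢ wkS* RB′ δ) K)                   ≡⟨ castT-subTs-castT p _ _ ⟩
        subTs (vars RB′ ++ˢ wkS* RB′ δ) (wkTs* RB′ K₀)                ≡⟨ subTs-vars-++ˢ-wkTs* RB′ δ K₀ ⟩
        wkTs* RB′ (subTs δ K₀)                                        ≡⟨ cong (wkTs* RB′) (subTs-·ₜ-dummies δ (wkTs (vars R))) ⟩
        wkTs* RB′ (subTs δ (wkTs (vars R)) ·ₜ dummies RB)             ≡⟨ cong (λ hs → wkTs* RB′ (hs ·ₜ dummies RB)) (subTs-++ˢ-wkTs-vars R γ′) ⟩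
        wkTs* RB′ (gs ·ₜ dummies RB)                                  ≡⟨ wkTs*-·ₜ-dummies RB′ gs ⟩
        wkTs* RB′ gs ·ₜ dummies RB                                    ∎
        where open ≡-Reasoning
      liftS-γ″∘ : liftS γ″ ∘SR liftR vs ≗S liftS (wkS* RB′ γ′)
      liftS-γ″∘ vz     = refl
      liftS-γ″∘ (vs x) = refl
      body-≡ : hr A′ (liftS γ″) (wkTs (subTs (vars RB′ ++ˢ wkS* RB′ δ) K)) ≡
               hr A (liftS (wkS* RB′ γ′)) (wkTs (wkTs* RB′ gs ·ₜ dummies RB))
      body-≡ = trans (hr-renF (liftR vs) A (liftS γ″) _)
                 (trans (hr-cong A liftS-γ″∘ _) (cong (hr A _) (trans (sym (map-castT wkT p _)) (cong wkTs realizer-≡))))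
      conclusion : Rs ⊢ hr (∃∈ (var vz) A′) γ″ (subTs (vars RB′ ++ˢ wkS* RB′ δ) K)
      conclusion = ⊢-cast (sym (cong₂ ∃∈ (wkT*-subT-·⃗-dummies RB′ δ (var vz)) body-≡)) instantiated

  module _ (T-ExFree : ∀ B → T B → ExFree B) where

    ILAx-realizable : {A : Fm Γ} → ILAx A → ExFree A → AxiomRealizable A
    ILAx-realizable a ef = AxiomRealizable-ExFree ef (λ γ Ps → axiom (ILAx-subF γ a))

    axiom-realizable : {A : Fm Γ} → IL+AC+IP+ T A → AxiomRealizable A
    axiom-realizable (inj₁ (ax-∀∈ t A))           = ax-∀∈-realizable t A
    axiom-realizable (inj₁ (ax-∃∈ t A))           = ax-∃∈-realizable t A
    axiom-realizable (inj₁ a@(ax-refl _))         = ILAx-realizable a (ef-at at≐)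
    axiom-realizable (inj₁ a@(ax-eq _ at s t))    =
      ILAx-realizable a (ef-⇒ (ef-∧ (ef-at at≐) (ef-at (Atomic-subF (single s) at))) (ef-at (Atomic-subF (single t) at)))
    axiom-realizable (inj₁ a@(ax-Σ _ _ _))        = ILAx-realizable a (ef-at at≐)
    axiom-realizable (inj₁ a@(ax-Π _ _))          = ILAx-realizable a (ef-at at≐)
    axiom-realizable (inj₁ a@(ax-sng _ _))        = ILAx-realizable a (ef-∧ (ef-⇒ (ef-at at∈) (ef-at at≐)) (ef-⇒ (ef-at at≐) (ef-at at∈)))
    axiom-realizable (inj₁ a@(ax-cup _ _ _))      =
      ILAx-realizable a (ef-∧ (ef-⇒ (ef-at at∈) (ef-∨ (ef-at at∈) (ef-at at∈))) (ef-⇒ (ef-∨ (ef-at at∈) (ef-at at∈)) (ef-at at∈)))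
    axiom-realizable (inj₁ a@(ax-bigcup _ _ _ _)) = ILAx-realizable a (ef-⇒ (ef-∧ (ef-at at∈) (ef-at at∈)) (ef-at at∈))
    axiom-realizable (inj₁ a@(ax-⋃sng _ _))       = ILAx-realizable a (ef-at at≐)
    axiom-realizable (inj₁ a@(ax-⋃cup _ _ _))     = ILAx-realizable a (ef-at at≐)
    axiom-realizable (inj₂ (inj₁ (ac A)))         = ac-realizable A
    axiom-realizable (inj₂ (inj₂ (inj₁ (ip B eb A)))) = ip-realizable B eb A
    axiom-realizable (inj₂ (inj₂ (inj₂ (tax B b)))) =
      AxiomRealizable-ExFree (subst ExFree (sym (renF≡subF closeR B)) (ExFree-subF _ (T-ExFree B b))) (λ γ Ps → ax (inj₂ (TAx-subF γ (tax B b))))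

    soundness : {Hs : List (Fm Γ)} {A : Fm Γ} → Prov (IL+AC+IP+ T) Γ Hs A → Realizable Hs A
    soundness {A = A} (hyp i)            = sound-hyp {A = A} i
    soundness {A = A} (ax a)             = sound-ax {A = A} (axiom-realizable a)
    soundness {A = A} (⊥E d)             = sound-⊥E {A = A} (soundness d)
    soundness (∧I {A = A} {B} d e)       = sound-∧I {A = A} {B} (soundness d) (soundness e)
    soundness (∧E₁ {A = A} {B} d)        = sound-∧E₁ {A = A} {B} (soundness d)
    soundness (∧E₂ {A = A} {B} d)        = sound-∧E₂ {A = A} {B} (soundness d)
    soundness (∨I₁ {A = A} {B} d)        = sound-∨I₁ {A = A} {B} (soundness d)
    soundness (∨I₂ {A = A} {B} d)        = sound-∨I₂ {A = A} {B} (soundness d)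
    soundness (∨E {A = A} {B} {C} d e f) = sound-∨E {A = A} {B} {C} (soundness d) (soundness e) (soundness f)
    soundness (⇒I {A = A} {B} d)         = sound-⇒I {A = A} {B} (soundness d)
    soundness (⇒E {A = A} {B} d e)       = sound-⇒E {A = A} {B} (soundness d) (soundness e)
    soundness (∀I {A = A} d)             = sound-∀I {A = A} (soundness d)
    soundness (∀E {A = A} d t)           = sound-∀E {A = A} (soundness d) t
    soundness (∃I {A = A} t d)           = sound-∃I {A = A} t (soundness d)
    soundness (∃E {A = A} {C} d e)       = sound-∃E {A = A} {C} (soundness d) (soundness e)

    bounded-witness : {A : Fm (ρ ∷ [])} → ExFree A → Prov (IL+AC+IP+ T) [] [] (∃' ρ A) → Σ (Tm [] (ρ *)) λ w → [] ⊢ ∃∈ w A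
    bounded-witness {A = A} A-ExFree d with soundness d
    ... | w ∷ as , realizes =
      subT var w , ⊢-cast (cong (∃∈ _) (trans (subF-cong liftS-var A) (subF-id A))) (hr-∃⇒∃∈ A-ExFree var _ _ (realizes var [] [] tt))

module HerbrandDisjunction (L : Signature) (T : Logic.Fm L [] → Set) where
  open Logic L hiding (_⊢_)
  open Substitution L
  open Derivations L T

  data Tree (τ : Ty) : Set where
    leaf : Tm [] τ → Tree τ
    node : Tree τ → Tree τ → Tree τ

  ⟦_⟧ : Tree τ → Tm [] (τ *)
  ⟦ leaf a ⟧   = sng · a
  ⟦ node l r ⟧ = cup · ⟦ l ⟧ · ⟦ r ⟧

  leaves : Tree τ → List⁺ (Tm [] τ)
  leaves (leaf a)   = List⁺.[ a ]
  leaves (node l r) = leaves l ⁺++⁺ leaves r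

  -- Tait computability; at set types it provides the tree normal form.
  Computable : (τ : Ty) → Tm [] τ → Set
  AllComputable : Tree τ → Set
  Computable G       t = ⊤
  Computable (σ ⇒ τ) t = (s : Tm [] σ) → Computable σ s → Computable τ (t · s)
  Computable (σ *)   t = Σ (Tree σ) λ N → ([] ⊢ t ≐ ⟦ N ⟧) × AllComputable N
  AllComputable {τ} (leaf a) = Computable τ a
  AllComputable (node l r)   = AllComputable l × AllComputable r

  Computable-≐ : (τ : Ty) {t t′ : Tm [] τ} → Computable τ t → [] ⊢ t ≐ t′ → Computable τ t′
  Computable-≐ G       c              e = tt
  Computable-≐ (σ ⇒ τ) c              e = λ s cs → Computable-≐ τ (c s cs) (·-cong e (≐-refl s))
  Computable-≐ (σ *)   (N , e′ , cN) e = N , ≐-trans (≐-sym e) e′ , cN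

  computable-fun : (n : ℕ) (t : Tm [] (Gⁿ n)) → Computable (Gⁿ n) t
  computable-fun zero    t = tt
  computable-fun (suc n) t = λ s _ → computable-fun n (t · s)

  computable-cup : (x y : Tm [] (σ *)) → Computable (σ *) x → Computable (σ *) y → Computable (σ *) (cup · x · y)
  computable-cup x y (M , e , cM) (N , e′ , cN) = node M N , ·-cong (·-cong (≐-refl cup) e) e′ , cM , cN

  computable-bigcup : (N : Tree σ) → AllComputable N → (f : Tm [] (σ ⇒ τ *)) → Computable (σ ⇒ τ *) f →
                      Computable (τ *) (bigcup · ⟦ N ⟧ · f)
  computable-bigcup {τ = τ} (leaf a)   ca        f cf = Computable-≐ (τ *) (cf a ca) (≐-sym (axiom (ax-⋃sng a f)))
  computable-bigcup {τ = τ} (node l r) (cl , cr) f cf =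
    Computable-≐ (τ *) (computable-cup _ _ (computable-bigcup l cl f cf) (computable-bigcup r cr f cf)) (≐-sym (axiom (ax-⋃cup ⟦ l ⟧ ⟦ r ⟧ f)))

  computable : (t : Tm [] τ) → Computable τ t
  computable (fun {n = n} f) = computable-fun n (fun f)
  computable Πc              = λ x cx y _ → Computable-≐ _ cx (≐-sym (axiom (ax-Π x y)))
  computable Σc              = λ x cx y cy z cz → Computable-≐ _ (cx z cz (y · z) (cy z cz)) (≐-sym (axiom (ax-Σ x y z)))
  computable sng             = λ a ca → leaf a , ≐-refl _ , ca
  computable cup             = λ x cx y cy → computable-cup x y cx cy
  computable bigcup          = λ { x (N , e , cN) f cf →
    Computable-≐ _ (computable-bigcup N cN f cf) (·-cong (·-cong (≐-refl bigcup) (≐-sym e)) (≐-refl f)) }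
  computable (t · u)         = computable t u (computable u)

  tree-normal-form : (t : Tm [] (τ *)) → Σ (Tree τ) λ N → [] ⊢ t ≐ ⟦ N ⟧
  tree-normal-form t with computable t
  ... | N , e , _ = N , e

  ⋁′-++ˡ : (A : Fm []) (Bs Cs : List (Fm [])) → Ps ⊢ ⋁′ A Bs → Ps ⊢ ⋁′ A (Bs ++ Cs)
  ⋁′-++ˡ A []       []       d = d
  ⋁′-++ˡ A []       (C ∷ Cs) d = ∨I₁ d
  ⋁′-++ˡ A (B ∷ Bs) Cs       d = ∨E d (∨I₁ (hyp here)) (∨I₂ (⋁′-++ˡ B Bs Cs (hyp here)))

  ⋁′-++ʳ : (A : Fm []) (Bs : List (Fm [])) (C : Fm []) (Cs : List (Fm [])) → Ps ⊢ ⋁′ C Cs → Ps ⊢ ⋁′ A (Bs ++ C ∷ Cs)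
  ⋁′-++ʳ A []       C Cs d = ∨I₂ d
  ⋁′-++ʳ A (B ∷ Bs) C Cs d = ∨I₂ (⋁′-++ʳ B Bs C Cs d)

  ⋁-⁺++⁺ˡ : (As Bs : List⁺ (Fm [])) → Ps ⊢ ⋁ As → Ps ⊢ ⋁ (As ⁺++⁺ Bs)
  ⋁-⁺++⁺ˡ (A ∷ As) (B ∷ Bs) = ⋁′-++ˡ A As (B ∷ Bs)

  ⋁-⁺++⁺ʳ : (As Bs : List⁺ (Fm [])) → Ps ⊢ ⋁ Bs → Ps ⊢ ⋁ (As ⁺++⁺ Bs)
  ⋁-⁺++⁺ʳ (A ∷ As) (B ∷ Bs) = ⋁′-++ʳ A As B Bs

  ∃∈-⟦⟧⇒⋁ : (A : Fm (τ ∷ [])) (N : Tree τ) → Ps ⊢ ∃∈ ⟦ N ⟧ A → Ps ⊢ ⋁ (List⁺.map (A [_]) (leaves N))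
  ∃∈-⟦⟧⇒⋁ A (leaf a) d = ∃∈E d (⊢-cast wk-[] (≐-subst (renF (liftR vs) A) x≐a (⊢-cast (sym (renF-liftR-vs-[vz] A)) (hyp here))))
    where
    x≐a = ⇒E (∧E₁ (axiom (ax-sng (var vz) (wkT a)))) (hyp (there here))
    wk-[] : renF (liftR vs) A [ wkT a ] ≡ wkF (A [ a ])
    wk-[] = trans (subF-renF (single (wkT a)) (liftR vs) A) (trans (sym (subF-cong (wkT∘single a) A)) (sym (renF-subF vs (single a) A)))
  ∃∈-⟦⟧⇒⋁ A (node l r) d = ∨E (∃∈-cup d)
    (⊢-cast (cong ⋁ (sym map-leaves)) (⋁-⁺++⁺ˡ Al Ar (∃∈-⟦⟧⇒⋁ A l (hyp here))))
    (⊢-cast (cong ⋁ (sym map-leaves)) (⋁-⁺++⁺ʳ Al Ar (∃∈-⟦⟧⇒⋁ A r (hyp here))))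
    where
    Al = List⁺.map (A [_]) (leaves l)
    Ar = List⁺.map (A [_]) (leaves r)
    map-leaves = List⁺ₚ.map-⁺++⁺ (A [_]) (leaves l) (leaves r)
    ∃∈-cup : ∀ {Ps} → Ps ⊢ ∃∈ (cup · ⟦ l ⟧ · ⟦ r ⟧) A → Ps ⊢ ∃∈ ⟦ l ⟧ A ∨' ∃∈ ⟦ r ⟧ A
    ∃∈-cup d = ∃∈E d (∨E (⇒E (∧E₁ (axiom (ax-cup (var vz) (wkT ⟦ l ⟧) (wkT ⟦ r ⟧)))) (hyp (there here)))
                        (∨I₁ (∃∈I-vz (hyp here) (hyp (there here))))
                        (∨I₂ (∃∈I-vz (hyp here) (hyp (there here)))))

  ∃∈⇒⋁ : (A : Fm (τ ∷ [])) (w : Tm [] (τ *)) → [] ⊢ ∃∈ w A → ∃ λ ts → [] ⊢ ⋁ (List⁺.map (A [_]) ts)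
  ∃∈⇒⋁ A w d with tree-normal-form w
  ... | N , w≐N = leaves N , ∃∈-⟦⟧⇒⋁ A N (∃∈-cong w≐N d)

corollary4 : (L : Signature) → let open Logic L in
    (T : Fm [] → Set) → (∀ B → T B → ExFree B) →
    (ρ : Ty) (A : Fm (ρ ∷ [])) → ExFree A →
    IL+AC+IP+ T ⊢ ∃' ρ A →
    ∃ λ (ts : List⁺ (Tm [] ρ)) → IL+ T ⊢ ⋁ (List⁺.map (λ t → A [ t ]) ts)
corollary4 L T T-ExFree ρ A A-ExFree d = ∃∈⇒⋁ A (proj₁ bounded) (proj₂ bounded)
  where
  open Soundness L T using (bounded-witness)
  open HerbrandDisjunction L T using (∃∈⇒⋁)
  bounded = bounded-witness T-ExFree A-ExFree d
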